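{- Let $q\ge2$ be an integer and let $T_{8q}$ be the edge labeling of $K_{8q}$ described in the context. Then $T_{8q}$ is a $1$-astray good labeling of $K_{8q}$ (with astray part the edge set of $G_3$). Furthermore, $T_{8q}$ is of $(2,2q)_p$ type for every positive integer $p\le q/2$, and hence, for the family $(T_{8q})_q$ and admissible $p$, $r(p,T_{8q})\le 0.75$.
   Context: $K_n$: complete graph; $\epsilon_n=\binom n2$; $[a]=\{1,\dots,a\}$, $[a,b]=\{a,\dots,b\}$; a 1-AP is a set of consecutive integers; $D(v)$ is the set of edges at $v$. An edge labeling of a graph with edge set $E$ is a bijection $t:E\to[|E|]$; $S(t,F)=\{t(e):e\in F\}$, $s(t,F)=\sum_{e\in F}t(e)$, $S(t,v)=S(t,D(v))$, $s(t,v)=s(t,D(v))$; $t$ is supermagic if $s(t,v)$ is constant over vertices $v$, and $\alpha$-almost supermagic if $|s(t,u)-s(t,v)|\le\alpha$ for all $u,v$. $b$-astray good: there is $A\subseteq E(K_n)$ with (1) $a=|A|\equiv\epsilon\pmod 2$ and $S(t,A)=[\frac{\epsilon-a}2+1,\frac{\epsilon+a}2]$; (2) with $L$ the edges labeled in $[\frac{\epsilon-a}2]$ and $H$ the remaining edges, $|D(v)\cap A|\le b$ and $|D(v)\cap L|=|D(v)\cap H|$ for all $v$; (3) $s(t,D(v)\setminus A)=|D(v)\setminus A|(\epsilon+1)/2$ for all $v$ (here $\epsilon=\epsilon_n$). $(m,\ell)_p$ type: for every vertex $v$ there are at most $m$ disjoint 1-APs contained in $S(t,v)$, each of length at least $2p$,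 with total length at least $\ell$. A $p$-swap $\theta$ maps $t$ to a labeling $\theta t$ with $|t(e)-\theta t(e)|\le p$ for all $e$; $R(p,t,n)=\max_\theta\max_{u\ne v}|s(\theta t,u)-s(\theta t,v)|$; $r(p,t)=\limsup R(p,t,n)/(2pn)$ as $n\to\infty$; $p=p(n)$ is admissible if $p=o(n)$, $p\to\infty$. Weaving square: $L_q(i,j)=q(i-1)+j$ on $[q]^2$; $L^0_q=L_q$, $L^1_q(i,j)=L_q(q+1-j,i)$, $L^2_q(i,j)=L_q(q+1-i,q+1-j)$, $L^3_q(i,j)=L_q(j,q+1-i)$; $B$ is the $4\times4$ array with rows $(1,6,11,16),(7,4,13,10),(12,15,2,5),(14,9,8,3)$; for $i=q(i_1-1)+i_2$, $j=q(j_1-1)+j_2$ ($i_1,j_1\in[4]$, $i_2,j_2\in[q]$), $W_{4q}(i,j)=(B(i_1,j_1)-1)q^2+L_q^{(j_1-i_1\bmod 4)}(i_2,j_2)$. Construction of $T_{8q}$: the vertices of $K_{8q}$ are $v_1,\dots,v_{4q},u_1,\dots,u_{4q}$. $G_1$ is the complete bipartite graph between $\{v_j\}$ and $\{u_i\}$; $G_3$ is the perfect matching $\{v_{2i-1}v_{2i},u_{2i-1}u_{2i}:i\in[2q]\}$; $G_2$ consists of all remaining edges, i.e. the disjoint union of $H$ (the complete graph on $\{v_j\}$ minus the matching edges $v_{2i-1}v_{2i}$) and its copy $H'$ on $\{u_i\}$ under $v_j\mapsto u_j$. Let $F_1,F_2$ be a decomposition of $H$ into two $(2q-1)$-regular spanning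 subgraphs, with copies $F_1',F_2'$ in $H'$. Let $t_0$ be a supermagic labeling of $H$ (labels in $[8q^2-4q]$), transferred to $H'$ via the copy map. Fix an ordering of the $4q$ edges of $G_3$. Define $T_{8q}(e)=t_0(e)$ for $e\in F_1\cup F_2'$; $T_{8q}(u_iv_j)=W_{4q}(i,j)+8q^2-4q$ if $W_{4q}(i,j)\le 8q^2$; $T_{8q}(e)=16q^2-4q+k$ if $e$ is the $k$-th edge of $G_3$, $k\in[4q]$; $T_{8q}(u_iv_j)=W_{4q}(i,j)+8q^2$ if $W_{4q}(i,j)>8q^2$; $T_{8q}(e)=t_0(e)+24q^2$ for $e\in F_2\cup F_1'$. -}

module Defs where

open import Data.Nat using (ℕ; zero; suc; _+_; _*_; _∸_; _≤_; _<_; _≡ᵇ_; _≤ᵇ_; _<ᵇ_; NonZero; >-nonZero; s≤s; z≤n; ∣_-_∣)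
open import Data.Nat.DivMod using (_/_; _%_)
open import Data.Nat.Combinatorics using (_C_)
open import Data.Nat.Properties using (≤-trans)
open import Data.Bool using (Bool; true; false; if_then_else_; not; _∧_)
open import Data.Fin using (Fin; toℕ; splitAt; _≟_)
import Data.Fin as Fin
open import Data.Sum using (_⊎_; inj₁; inj₂)
open import Data.Product using (_×_; _,_; ∃; ∃-syntax; proj₁; proj₂)
open import Data.List using (List; length; map)
open import Data.Nat.ListAction using (sum)
open import Data.List.Relation.Unary.All using (All)
open import Data.List.Relation.Unary.AllPairs using (AllPairs)
open import Relation.Nullary using (does)
open import Relation.Binary.PropositionalEquality using (_≡_)

sumF : ∀ {n} → (Fin n → ℕ) → ℕ
sumF {zero}  f = 0
sumF {suc n} f = f Fin.zero + sumF (λ i → f (Fin.suc i))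

count : ∀ {n} → (Fin n → Bool) → ℕ
count f = sumF (λ i → if f i then 1 else 0)

-- Graphs on vertex set Fin n are given by symmetric irreflexive Bool
-- predicates on pairs of vertices; an edge is an unordered pair {x,y}
-- with E x y ≡ true.

Kedge : ∀ {n} → Fin n → Fin n → Bool
Kedge x y = not (does (x ≟ y))

edgeCount : ∀ {n} → (Fin n → Fin n → Bool) → ℕ
edgeCount E = sumF (λ x → count (λ y → (toℕ x <ᵇ toℕ y) ∧ E x y))

IsLabeling : ∀ {n} → (Fin n → Fin n → Bool) → ℕ → (Fin n → Fin n → ℕ) → Set
IsLabeling {n} E N t =
  (∀ x y → E x y ≡ true → t x y ≡ t y x) ×
  (∀ x y → E x y ≡ true → 1 ≤ t x y × t x y ≤ N) ×
  (∀ x y x' y' → E x y ≡ true → E x' y' ≡ true → t x y ≡ t x' y' →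
     (x ≡ x' × y ≡ y') ⊎ (x ≡ y' × y ≡ x')) ×
  (∀ k → 1 ≤ k → k ≤ N → ∃[ x ] ∃[ y ] (E x y ≡ true × t x y ≡ k))

ε : ℕ → ℕ
ε n = n C 2

IsEdgeLabeling : ∀ n → (Fin n → Fin n → ℕ) → Set
IsEdgeLabeling n t = IsLabeling (Kedge {n}) (ε n) t

s : ∀ {n} → (Fin n → Fin n → ℕ) → Fin n → ℕ
s t v = sumF (λ w → if Kedge v w then t v w else 0)

AstrayGoodWith : ∀ {n} → ℕ → (Fin n → Fin n → ℕ) → (Fin n → Fin n → Bool) → Set
AstrayGoodWith {n} b t A =
  IsEdgeLabeling n t ×
  (a % 2 ≡ ε n % 2) ×
  (∀ x y → InA x y ≡ true → lo < t x y × t x y ≤ hi) ×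
  (∀ k → lo < k → k ≤ hi → ∃[ x ] ∃[ y ] (InA x y ≡ true × t x y ≡ k)) ×
  (∀ v → count (InA v) ≤ b) ×
  (∀ v → count (L v) ≡ count (Hi v)) ×
  (∀ v → 2 * sumF (λ w → if notA v w then t v w else 0)
          ≡ count (notA v) * (ε n + 1))
  where
  InA : Fin n → Fin n → Bool
  InA x y = Kedge x y ∧ A x y
  a = edgeCount InA
  lo = (ε n ∸ a) / 2
  hi = (ε n + a) / 2
  notA : Fin n → Fin n → Bool
  notA x y = Kedge x y ∧ not (A x y)
  L : Fin n → Fin n → Bool
  L x y = Kedge x y ∧ (t x y ≤ᵇ lo)
  Hi : Fin n → Fin n → Bool
  Hi x y = notA x y ∧ not (t x y ≤ᵇ lo)

AstrayGood : ∀ {n} → ℕ → (Fin n → Fin n → ℕ) → Set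
AstrayGood {n} b t = ∃[ A ] ((∀ x y → A x y ≡ A y x) × AstrayGoodWith b t A)

-- (m, ℓ)_p type.  A 1-AP is encoded as (start , length), i.e. the set
-- {start, ..., start + length - 1}.

Disjoint1AP : ℕ × ℕ → ℕ × ℕ → Set
Disjoint1AP (a , la) (b , lb) = (a + la ≤ b) ⊎ (b + lb ≤ a)

OfType : ∀ {n} → ℕ → ℕ → ℕ → (Fin n → Fin n → ℕ) → Set
OfType {n} m ℓ p t = ∀ v → ∃[ Is ]
  (length Is ≤ m ×
   All (λ I → 2 * p ≤ proj₂ I ×
              (∀ x → proj₁ I ≤ x → x < proj₁ I + proj₂ I →
                 ∃[ w ] (Kedge v w ≡ true × t v w ≡ x))) Is ×
   AllPairs Disjoint1AP Is ×
   ℓ ≤ sum (map proj₂ Is))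

-- Weaving square (1-based indices)

Lq : ℕ → ℕ → ℕ → ℕ
Lq q i j = q * (i ∸ 1) + j

Lrot : ℕ → ℕ → ℕ → ℕ → ℕ
Lrot q 0 i j = Lq q i j
Lrot q 1 i j = Lq q (q + 1 ∸ j) i
Lrot q 2 i j = Lq q (q + 1 ∸ i) (q + 1 ∸ j)
Lrot q _ i j = Lq q j (q + 1 ∸ i)

Bsq : ℕ → ℕ → ℕ
Bsq 1 1 = 1
Bsq 1 2 = 6
Bsq 1 3 = 11
Bsq 1 4 = 16
Bsq 2 1 = 7
Bsq 2 2 = 4
Bsq 2 3 = 13
Bsq 2 4 = 10
Bsq 3 1 = 12
Bsq 3 2 = 15
Bsq 3 3 = 2
Bsq 3 4 = 5
Bsq 4 1 = 14
Bsq 4 2 = 9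
Bsq 4 3 = 8
Bsq 4 4 = 3
Bsq _ _ = 0

W : (q : ℕ) → .{{NonZero q}} → ℕ → ℕ → ℕ
W q i j = (Bsq i1 j1 ∸ 1) * (q * q) + Lrot q ((j1 + 4 ∸ i1) % 4) i2 j2
  where
  i1 = (i ∸ 1) / q + 1
  i2 = (i ∸ 1) % q + 1
  j1 = (j ∸ 1) / q + 1
  j2 = (j ∸ 1) % q + 1

-- Construction of T_{8q}.  Vertices of K_{8q} are Fin (4q + 4q):
-- index j-1 is v_j and index 4q+i-1 is u_i (j, i ∈ [4q]).
-- H lives on Fin (4q) (index j-1 is v_j); H' is its copy on the u's.

-- edges of H : complete graph on the v's minus the matching v_{2i-1}v_{2i}
Hedge : (q : ℕ) → Fin (4 * q) → Fin (4 * q) → Bool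
Hedge q a b = not ((toℕ a / 2) ≡ᵇ (toℕ b / 2))

-- edges of G3 (the perfect matching v_{2i-1}v_{2i}, u_{2i-1}u_{2i})
G3 : (q : ℕ) → Fin (4 * q + 4 * q) → Fin (4 * q + 4 * q) → Bool
G3 q x y = Kedge x y ∧ ((toℕ x / 2) ≡ᵇ (toℕ y / 2))

record Choices (q : ℕ) : Set where
  field
    F1     : Fin (4 * q) → Fin (4 * q) → Bool
    F1-sym : ∀ a b → Hedge q a b ≡ true → F1 a b ≡ F1 b a
    F1-reg : ∀ a → count (λ b → Hedge q a b ∧ F1 a b) ≡ 2 * q ∸ 1
    F2-reg : ∀ a → count (λ b → Hedge q a b ∧ not (F1 a b)) ≡ 2 * q ∸ 1
    t0       : Fin (4 * q) → Fin (4 * q) → ℕ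
    t0-lab   : IsLabeling (Hedge q) (8 * q * q ∸ 4 * q) t0
    t0-magic : ∃[ c ] (∀ a → sumF (λ b → if Hedge q a b then t0 a b else 0) ≡ c)
    ord     : Fin (4 * q + 4 * q) → Fin (4 * q + 4 * q) → ℕ
    ord-lab : IsLabeling (G3 q) (4 * q) ord

T : (q : ℕ) → 2 ≤ q → Choices q → Fin (4 * q + 4 * q) → Fin (4 * q + 4 * q) → ℕ
T q hq C x y = go (splitAt (4 * q) x) (splitAt (4 * q) y)
  where
  open Choices C
  instance
    nz : NonZero q
    nz = >-nonZero (≤-trans (s≤s z≤n) hq)
  g3lab : ℕ
  g3lab = (16 * q * q ∸ 4 * q) + ord x y
  -- edge u_i v_j
  cross : ℕ → ℕ → ℕ
  cross i j = if W q i j ≤ᵇ 8 * q * q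
              then W q i j + (8 * q * q ∸ 4 * q)
              else W q i j + 8 * q * q
  go : Fin (4 * q) ⊎ Fin (4 * q) → Fin (4 * q) ⊎ Fin (4 * q) → ℕ
  go (inj₁ a) (inj₁ b) = if Hedge q a b
                         then (if F1 a b then t0 a b else t0 a b + 24 * q * q)
                         else g3lab
  go (inj₂ a) (inj₂ b) = if Hedge q a b
                         then (if F1 a b then t0 a b + 24 * q * q else t0 a b)
                         else g3lab
  go (inj₁ a) (inj₂ b) = cross (toℕ b + 1) (toℕ a + 1)
  go (inj₂ b) (inj₁ a) = cross (toℕ b + 1) (toℕ a + 1)

-- Admissible p = p(n): p = o(n) and p → ∞
Admissible : (ℕ → ℕ) → Set
Admissible p =
  (∀ k → 1 ≤ k → ∃[ N ] (∀ n → N ≤ n → k * p n ≤ n)) ×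
  (∀ M → ∃[ N ] (∀ n → N ≤ n → M ≤ p n))

-- r(p, T_{8q}) ≤ num/den for the family (T_{8q})_q given by choices C:
-- limsup_{q→∞} R(p, T_{8q}, 8q) / (2 p n) ≤ num/den, i.e. for every k ≥ 1,
-- eventually R/(2pn) ≤ num/den + 1/k, where R ≤ X means: for every
-- p-swap θ (θT any edge labeling with |T(e) - θT(e)| ≤ p on all edges)
-- and all u ≠ v, |s(θT,u) - s(θT,v)| ≤ X.
rAtMost : (C : (q : ℕ) → 2 ≤ q → Choices q) → (ℕ → ℕ) → ℕ → ℕ → Set
rAtMost C p num den =
  ∀ k → 1 ≤ k → ∃[ Q ] (∀ q (hq : 2 ≤ q) → Q ≤ q →
    ∀ (t' : Fin (4 * q + 4 * q) → Fin (4 * q + 4 * q) → ℕ) →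
    IsEdgeLabeling (4 * q + 4 * q) t' →
    (∀ x y → Kedge x y ≡ true → ∣ t' x y - T q hq (C q hq) x y ∣ ≤ p (4 * q + 4 * q)) →
    ∀ u v → Kedge u v ≡ true →
    den * k * ∣ s t' u - s t' v ∣
      ≤ (num * k + den) * (2 * p (4 * q + 4 * q) * (4 * q + 4 * q)))

module Submission where

-- T is a labeling because its five label bands [1, 8q² − 4q], (8q² − 4q, 16q² − 4q],
-- (16q² − 4q, 16q²], (16q², 24q²] and (24q², ε] are filled in turn by the low H-edges,
-- the low cross edges, the matching G₃, the high cross edges and the high H-edges; the
-- matching is astray, occupying exactly the middle band.  At each vertex the remaining
-- labels average (ε + 1)/2 because t₀ is supermagic and all rows and columns of the
-- weaving square W have the same sum, and low and high labels balance because F₁, F₂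
-- are regular and every line of W has two blocks of entries ≤ 8q² and two above.  In
-- every line of W two blocks carry q consecutive entries, giving two disjoint runs of
-- length q at each vertex.  Finally a p-swap moves each label by at most p: on a run of
-- consecutive labels this costs at most 2p² in total, the other 6q edges at a vertex
-- cost p each, and the unperturbed vertex sums differ by less than 4q; hence perturbed
-- vertex sums differ by at most 4q + 8p² + 12qp = (3/4 + o(1)) · 2p · 8q.

open import Defs
open import Data.Nat using (ℕ; _≤_; _*_)
open import Data.Product using (_×_)
open import Data.Nat
open import Data.Nat.Properties
open import Data.Nat.DivMod
open import Data.Nat.Tactic.RingSolver
open import Function using (_∘_)
open import Algebra.Properties.CommutativeSemigroup +-commutativeSemigroup using (interchange; x∙yz≈y∙xz)
open import Data.Bool using (Bool; true; false; if_then_else_; not; _∧_; _∨_)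
open import Data.Bool.Properties using (∧-identityʳ; ∧-zeroʳ; ∨-zeroʳ; not-involutive)
import Data.Fin as F
open F using (Fin; toℕ; #_; _↑ˡ_; _↑ʳ_; splitAt; combine; remQuot; fromℕ<)
open import Data.Fin.Properties using (all?; any?)
import Data.Fin.Properties as FP
open import Data.Sum using (_⊎_; inj₁; inj₂)
open import Relation.Binary.Definitions using (tri<; tri≈; tri>)
open import Data.Product using (_,_; ∃-syntax; proj₁; proj₂)
open import Data.Empty using (⊥; ⊥-elim)
open import Relation.Nullary using (¬_; yes; no; Dec)
open import Relation.Nullary.Reflects using (Reflects; ofʸ; ofⁿ; invert; fromEquivalence)
open import Relation.Nullary.Decidable using (toWitness; map′; _×-dec_; _→-dec_; dec-false; proof)
open import Relation.Binary.PropositionalEquality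
open import Data.Nat.Divisibility using (divides)
open import Data.Nat.Combinatorics using (nC1≡n; nCk+nC[k+1]≡[n+1]C[k+1]) renaming (_C_ to _Cb_)
open import Data.List using ([]; _∷_)
open import Data.List.Relation.Unary.All using ([]; _∷_)
open import Data.List.Relation.Unary.AllPairs using ([]; _∷_)

ind : Bool → ℕ
ind b = if b then 1 else 0

sumN : ℕ → (ℕ → ℕ) → ℕ
sumN zero    f = 0
sumN (suc n) f = f 0 + sumN n (f ∘ suc)

sumF-toℕ : ∀ n (f : ℕ → ℕ) → sumF {n} (f ∘ toℕ) ≡ sumN n f
sumF-toℕ zero    f = refl
sumF-toℕ (suc n) f = cong (f 0 +_) (sumF-toℕ n (f ∘ suc))

sumF-cong : ∀ {n} {f g : Fin n → ℕ} → (∀ i → f i ≡ g i) → sumF f ≡ sumF g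
sumF-cong {zero}  h = refl
sumF-cong {suc n} h = cong₂ _+_ (h F.zero) (sumF-cong (h ∘ F.suc))

sumF-mono : ∀ {n} {f g : Fin n → ℕ} → (∀ i → f i ≤ g i) → sumF f ≤ sumF g
sumF-mono {zero}  h = z≤n
sumF-mono {suc n} h = +-mono-≤ (h F.zero) (sumF-mono (h ∘ F.suc))

sumF-+ : ∀ {n} (f g : Fin n → ℕ) → sumF (λ i → f i + g i) ≡ sumF f + sumF g
sumF-+ {zero}  f g = refl
sumF-+ {suc n} f g = trans (cong (f F.zero + g F.zero +_) (sumF-+ (f ∘ F.suc) (g ∘ F.suc)))
                           (interchange (f F.zero) (g F.zero) _ _)

sumF-const : ∀ n c → sumF {n} (λ _ → c) ≡ n * c
sumF-const zero    c = refl
sumF-const (suc n) c = cong (c +_) (sumF-const n c)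

sumF-zeros : ∀ n → sumF {n} (λ _ → 0) ≡ 0
sumF-zeros n = trans (sumF-const n 0) (*-zeroʳ n)

sumF-*ˡ : ∀ {n} c (f : Fin n → ℕ) → sumF (λ i → c * f i) ≡ c * sumF f
sumF-*ˡ {zero}  c f = sym (*-zeroʳ c)
sumF-*ˡ {suc n} c f = trans (cong (c * f F.zero +_) (sumF-*ˡ c (f ∘ F.suc)))
                            (sym (*-distribˡ-+ c (f F.zero) _))

sumF-*ʳ : ∀ {n} c (f : Fin n → ℕ) → sumF (λ i → f i * c) ≡ sumF f * c
sumF-*ʳ c f = trans (sumF-cong (λ i → *-comm (f i) c)) (trans (sumF-*ˡ c f) (*-comm c _))

sumF-split : ∀ m n (f : Fin (m + n) → ℕ) →
  sumF f ≡ sumF (λ i → f (i ↑ˡ n)) + sumF (λ j → f (m ↑ʳ j))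
sumF-split zero    n f = refl
sumF-split (suc m) n f = trans (cong (f F.zero +_) (sumF-split m n (f ∘ F.suc)))
                               (sym (+-assoc (f F.zero) _ _))

sumF-combine : ∀ m n (f : Fin (m * n) → ℕ) →
  sumF f ≡ sumF {m} (λ i → sumF {n} (λ j → f (combine i j)))
sumF-combine zero    n f = refl
sumF-combine (suc m) n f = trans (sumF-split n (m * n) f)
  (cong (sumF (λ j → f (j ↑ˡ (m * n))) +_) (sumF-combine m n (λ k → f (n ↑ʳ k))))

sumF-comm : ∀ m n (f : Fin m → Fin n → ℕ) →
  sumF (λ i → sumF (λ j → f i j)) ≡ sumF (λ j → sumF (λ i → f i j))
sumF-comm zero    n f = sym (sumF-zeros n)
sumF-comm (suc m) n f = trans (cong (sumF (f F.zero) +_) (sumF-comm m n (f ∘ F.suc)))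
  (sym (sumF-+ (f F.zero) (λ j → sumF (λ i → f (F.suc i) j))))

sumF-if : ∀ {n} (P : Fin n → Bool) a b →
  sumF (λ i → if P i then a else b) ≡ count P * a + count (not ∘ P) * b
sumF-if {zero}  P a b = refl
sumF-if {suc n} P a b with P F.zero
... | true  = trans (cong (a +_) (sumF-if (P ∘ F.suc) a b)) (sym (+-assoc a _ _))
... | false = trans (cong (b +_) (sumF-if (P ∘ F.suc) a b)) (x∙yz≈y∙xz b (count (P ∘ F.suc) * a) (count (not ∘ P ∘ F.suc) * b))

sumF-single : ∀ {n} (P : Fin n → Bool) (g : Fin n → ℕ) z →
  (∀ i → P i ≡ true → i ≡ z) → P z ≡ true →
  sumF (λ i → if P i then g i else 0) ≡ g z
sumF-single {suc n} P g F.zero only hz rewrite hz =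
  trans (cong (g F.zero +_) (trans (sumF-cong rest) (sumF-zeros n))) (+-identityʳ _)
  where
  rest : ∀ i → (if P (F.suc i) then g (F.suc i) else 0) ≡ 0
  rest i with P (F.suc i) in e
  ... | false = refl
  ... | true with () ← only (F.suc i) e
sumF-single {suc n} P g (F.suc z) only hz with P F.zero in e
... | true with () ← only F.zero e
... | false = sumF-single (P ∘ F.suc) (g ∘ F.suc) z (λ i h → FP.suc-injective (only (F.suc i) h)) hz

sumF-≤-single : ∀ {n} (P : Fin n → Bool) (g : Fin n → ℕ) z →
  (∀ i → P i ≡ true → i ≡ z) → sumF (λ i → if P i then g i else 0) ≤ g z
sumF-≤-single {n} P g z only with P z in e
... | true  = ≤-reflexive (sumF-single P g z only e)
... | false = ≤-trans (≤-reflexive (trans (sumF-cong empty) (sumF-zeros n))) z≤n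
  where
  empty : ∀ i → (if P i then g i else 0) ≡ 0
  empty i with P i in e′
  ... | false = refl
  ... | true with refl ← only i e′ with () ← trans (sym e) e′

sumN-cong : ∀ n {f g : ℕ → ℕ} → (∀ k → k < n → f k ≡ g k) → sumN n f ≡ sumN n g
sumN-cong zero    h = refl
sumN-cong (suc n) h = cong₂ _+_ (h 0 z<s) (sumN-cong n (λ k k<n → h (suc k) (s<s k<n)))

sumN-mono : ∀ n {f g : ℕ → ℕ} → (∀ k → k < n → f k ≤ g k) → sumN n f ≤ sumN n g
sumN-mono zero    h = z≤n
sumN-mono (suc n) h = +-mono-≤ (h 0 z<s) (sumN-mono n (λ k k<n → h (suc k) (s<s k<n)))

sumN-+ : ∀ n (f g : ℕ → ℕ) → sumN n (λ i → f i + g i) ≡ sumN n f + sumN n g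
sumN-+ zero    f g = refl
sumN-+ (suc n) f g = trans (cong (f 0 + g 0 +_) (sumN-+ n (f ∘ suc) (g ∘ suc)))
                           (interchange (f 0) (g 0) _ _)

sumN-const : ∀ n c → sumN n (λ _ → c) ≡ n * c
sumN-const zero    c = refl
sumN-const (suc n) c = cong (c +_) (sumN-const n c)

sumN-ones : ∀ n → sumN n (λ _ → 1) ≡ n
sumN-ones n = trans (sumN-const n 1) (*-identityʳ n)

sumN-zeros : ∀ n → sumN n (λ _ → 0) ≡ 0
sumN-zeros n = trans (sumN-const n 0) (*-zeroʳ n)

sumN-*ˡ : ∀ n c (f : ℕ → ℕ) → sumN n (λ i → c * f i) ≡ c * sumN n f
sumN-*ˡ zero    c f = sym (*-zeroʳ c)
sumN-*ˡ (suc n) c f = trans (cong (c * f 0 +_) (sumN-*ˡ n c (f ∘ suc)))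
                            (sym (*-distribˡ-+ c (f 0) _))

sumN-split : ∀ m n (f : ℕ → ℕ) → sumN (m + n) f ≡ sumN m f + sumN n (λ k → f (m + k))
sumN-split zero    n f = refl
sumN-split (suc m) n f = trans (cong (f 0 +_) (sumN-split m n (f ∘ suc)))
                               (sym (+-assoc (f 0) _ _))

sumN-last : ∀ n (f : ℕ → ℕ) → sumN (suc n) f ≡ sumN n f + f n
sumN-last n f = begin
  sumN (suc n) f                     ≡⟨ cong (λ m → sumN m f) (+-comm 1 n) ⟩
  sumN (n + 1) f                     ≡⟨ sumN-split n 1 f ⟩
  sumN n f + (f (n + 0) + 0)         ≡⟨ cong (λ z → sumN n f + z) (trans (+-identityʳ _) (cong f (+-identityʳ n))) ⟩
  sumN n f + f n                     ∎
  where open ≡-Reasoning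

sumN-comm : ∀ m n (f : ℕ → ℕ → ℕ) →
  sumN m (λ i → sumN n (λ j → f i j)) ≡ sumN n (λ j → sumN m (λ i → f i j))
sumN-comm zero    n f = sym (sumN-zeros n)
sumN-comm (suc m) n f = trans (cong (sumN n (f 0) +_) (sumN-comm m n (f ∘ suc)))
  (sym (sumN-+ n (f 0) (λ j → sumN m (λ i → f (suc i) j))))

sumN≡0⇒ : ∀ n (f : ℕ → ℕ) → sumN n f ≡ 0 → ∀ k → k < n → f k ≡ 0
sumN≡0⇒ (suc n) f e zero    _         = m+n≡0⇒m≡0 (f 0) e
sumN≡0⇒ (suc n) f e (suc k) (s<s k<n) = sumN≡0⇒ n (f ∘ suc) (m+n≡0⇒n≡0 (f 0) e) k k<n


reflects-true : ∀ {A : Set} {b} → Reflects A b → b ≡ true → A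
reflects-true r refl = invert r

reflects-false : ∀ {A : Set} {b} → Reflects A b → b ≡ false → ¬ A
reflects-false r refl = invert r

true-reflects : ∀ {A : Set} {b} → Reflects A b → A → b ≡ true
true-reflects (ofʸ _)  _ = refl
true-reflects (ofⁿ ¬a) a = ⊥-elim (¬a a)

false-reflects : ∀ {A : Set} {b} → Reflects A b → ¬ A → b ≡ false
false-reflects (ofʸ a) ¬a = ⊥-elim (¬a a)
false-reflects (ofⁿ _) _  = refl

≡ᵇ-reflects-≡ : ∀ m n → Reflects (m ≡ n) (m ≡ᵇ n)
≡ᵇ-reflects-≡ m n = fromEquivalence (≡ᵇ⇒≡ m n) (≡⇒≡ᵇ m n)

≡ᵇ-sound : ∀ m n → (m ≡ᵇ n) ≡ true → m ≡ n
≡ᵇ-sound m n = reflects-true (≡ᵇ-reflects-≡ m n)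

≡ᵇ-complete : ∀ {m n} → m ≡ n → (m ≡ᵇ n) ≡ true
≡ᵇ-complete {m} {n} = true-reflects (≡ᵇ-reflects-≡ m n)

≡ᵇ-refl : ∀ m → (m ≡ᵇ m) ≡ true
≡ᵇ-refl m = ≡ᵇ-complete {m} refl

≢⇒≡ᵇ-false : ∀ {m n} → m ≢ n → (m ≡ᵇ n) ≡ false
≢⇒≡ᵇ-false {m} {n} = false-reflects (≡ᵇ-reflects-≡ m n)

≤ᵇ-sound : ∀ m n → (m ≤ᵇ n) ≡ true → m ≤ n
≤ᵇ-sound m n = reflects-true (≤ᵇ-reflects-≤ m n)

≤ᵇ-complete : ∀ {m n} → m ≤ n → (m ≤ᵇ n) ≡ true
≤ᵇ-complete {m} {n} = true-reflects (≤ᵇ-reflects-≤ m n)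

≤ᵇ-false⇒> : ∀ m n → (m ≤ᵇ n) ≡ false → n < m
≤ᵇ-false⇒> m n e = ≰⇒> (reflects-false (≤ᵇ-reflects-≤ m n) e)

>⇒≤ᵇ-false : ∀ {m n} → n < m → (m ≤ᵇ n) ≡ false
>⇒≤ᵇ-false {m} {n} p = false-reflects (≤ᵇ-reflects-≤ m n) (<⇒≱ p)

<ᵇ-sound : ∀ m n → (m <ᵇ n) ≡ true → m < n
<ᵇ-sound m n = reflects-true (<ᵇ-reflects-< m n)

<ᵇ-complete : ∀ {m n} → m < n → (m <ᵇ n) ≡ true
<ᵇ-complete {m} {n} = true-reflects (<ᵇ-reflects-< m n)

<ᵇ-false⇒≥ : ∀ m n → (m <ᵇ n) ≡ false → n ≤ m
<ᵇ-false⇒≥ m n e = ≮⇒≥ (reflects-false (<ᵇ-reflects-< m n) e)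

≥⇒<ᵇ-false : ∀ {m n} → n ≤ m → (m <ᵇ n) ≡ false
≥⇒<ᵇ-false {m} {n} p = false-reflects (<ᵇ-reflects-< m n) (≤⇒≯ p)

∧-true⁻ : ∀ a b → a ∧ b ≡ true → a ≡ true × b ≡ true
∧-true⁻ true true _ = refl , refl

imageᵇ : ∀ {m} → (Fin m → Bool) → (Fin m → ℕ) → ℕ → Bool
imageᵇ {zero}  A f y = false
imageᵇ {suc m} A f y = (A F.zero ∧ (f F.zero ≡ᵇ y)) ∨ imageᵇ (A ∘ F.suc) (f ∘ F.suc) y

imageᵇ-sound : ∀ {m} (A : Fin m → Bool) (f : Fin m → ℕ) y → imageᵇ A f y ≡ true →
  ∃[ k ] (A k ≡ true × f k ≡ y)
imageᵇ-sound {suc m} A f y h with A F.zero in a0 | f F.zero ≡ᵇ y in e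
... | true  | true  = F.zero , a0 , ≡ᵇ-sound _ _ e
... | true  | false = let k , p = imageᵇ-sound (A ∘ F.suc) (f ∘ F.suc) y h in F.suc k , p
... | false | _     = let k , p = imageᵇ-sound (A ∘ F.suc) (f ∘ F.suc) y h in F.suc k , p

imageᵇ-complete : ∀ {m} (A : Fin m → Bool) (f : Fin m → ℕ) k → A k ≡ true → imageᵇ A f (f k) ≡ true
imageᵇ-complete {suc m} A f F.zero    hA rewrite hA | ≡ᵇ-refl (f F.zero) = refl
imageᵇ-complete {suc m} A f (F.suc k) hA
  rewrite imageᵇ-complete (A ∘ F.suc) (f ∘ F.suc) k hA = ∨-zeroʳ _

sumN-remove : ∀ n (B : ℕ → Bool) (g : ℕ → ℕ) z → z < n → B z ≡ true →
  sumN n (λ y → if B y ∧ not (z ≡ᵇ y) then g y else 0) + g z ≡ sumN n (λ y → if B y then g y else 0)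
sumN-remove (suc n) B g zero z<n hB rewrite hB =
  trans (cong (_+ g 0) (sumN-cong n (λ k _ → cong (λ b → if b then g (suc k) else 0) (∧-identityʳ (B (suc k))))))
        (+-comm _ (g 0))
sumN-remove (suc n) B g (suc z) (s<s z<n) hB =
  trans (+-assoc (if B 0 ∧ true then g 0 else 0) _ (g (suc z)))
        (cong₂ _+_ (cong (λ b → if b then g 0 else 0) (∧-identityʳ (B 0)))
                   (sumN-remove n (B ∘ suc) (g ∘ suc) z z<n hB))

sumF-image+rest : ∀ {m} n (A : Fin m → Bool) (f : Fin m → ℕ) (B : ℕ → Bool) (g : ℕ → ℕ) →
  (∀ k → A k ≡ true → f k < n) → (∀ k → A k ≡ true → B (f k) ≡ true) →
  (∀ j k → A j ≡ true → A k ≡ true → f j ≡ f k → j ≡ k) →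
  sumF (λ k → if A k then g (f k) else 0) + sumN n (λ y → if B y ∧ not (imageᵇ A f y) then g y else 0)
    ≡ sumN n (λ y → if B y then g y else 0)
sumF-image+rest {zero} n A f B g _ _ _ =
  sumN-cong n (λ k _ → cong (λ b → if b then g k else 0) (∧-identityʳ (B k)))
sumF-image+rest {suc m} n A f B g bounded into inj with A F.zero in a0
... | false = sumF-image+rest n (A ∘ F.suc) (f ∘ F.suc) B g
                (bounded ∘ F.suc) (into ∘ F.suc) (λ j k hj hk e → FP.suc-injective (inj (F.suc j) (F.suc k) hj hk e))
... | true = begin
    (g f₀ + S) + X                                   ≡⟨ +-assoc (g f₀) S X ⟩
    g f₀ + (S + X)                                   ≡⟨ cong (λ z → g f₀ + (S + z)) (sumN-cong n (λ k _ → cong (λ b → if b then g k else 0) (reassoc (B k) (f₀ ≡ᵇ k) _))) ⟩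
    g f₀ + (S + X′)                                  ≡⟨ cong (g f₀ +_) IH ⟩
    g f₀ + sumN n (λ y → if B′ y then g y else 0)     ≡⟨ +-comm (g f₀) _ ⟩
    sumN n (λ y → if B′ y then g y else 0) + g f₀     ≡⟨ sumN-remove n B g f₀ (bounded F.zero a0) (into F.zero a0) ⟩
    sumN n (λ y → if B y then g y else 0)            ∎
  where
  open ≡-Reasoning
  f₀ : ℕ
  f₀ = f F.zero
  A′ : Fin m → Bool
  A′ = A ∘ F.suc
  f′ : Fin m → ℕ
  f′ = f ∘ F.suc
  B′ : ℕ → Bool
  B′ y = B y ∧ not (f₀ ≡ᵇ y)
  S X X′ : ℕ
  S  = sumF (λ k → if A′ k then g (f′ k) else 0)
  X  = sumN n (λ y → if B y ∧ not ((f₀ ≡ᵇ y) ∨ imageᵇ A′ f′ y) then g y else 0)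
  X′ = sumN n (λ y → if B′ y ∧ not (imageᵇ A′ f′ y) then g y else 0)
  reassoc : ∀ b e i → (b ∧ not (e ∨ i)) ≡ ((b ∧ not e) ∧ not i)
  reassoc false e     i = refl
  reassoc true  true  i = refl
  reassoc true  false i = refl
  into′ : ∀ k → A′ k ≡ true → B′ (f′ k) ≡ true
  into′ k h rewrite into (F.suc k) h | ≢⇒≡ᵇ-false {f₀} {f′ k} (λ e → 0≢1+n (cong toℕ (inj F.zero (F.suc k) a0 h e))) = refl
  IH : S + X′ ≡ sumN n (λ y → if B′ y then g y else 0)
  IH = sumF-image+rest n A′ f′ B′ g (bounded ∘ F.suc) into′
         (λ j k hj hk e → FP.suc-injective (inj (F.suc j) (F.suc k) hj hk e))

sumF-injective-≤ : ∀ {m} n (A : Fin m → Bool) (f : Fin m → ℕ) (B : ℕ → Bool) (g : ℕ → ℕ) →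
  (∀ k → A k ≡ true → f k < n) → (∀ k → A k ≡ true → B (f k) ≡ true) →
  (∀ j k → A j ≡ true → A k ≡ true → f j ≡ f k → j ≡ k) →
  sumF (λ k → if A k then g (f k) else 0) ≤ sumN n (λ y → if B y then g y else 0)
sumF-injective-≤ n A f B g bounded into inj =
  ≤-trans (m≤m+n _ _) (≤-reflexive (sumF-image+rest n A f B g bounded into inj))

sumF-bijective : ∀ {m} n (A : Fin m → Bool) (f : Fin m → ℕ) (B : ℕ → Bool) (g : ℕ → ℕ) →
  (∀ k → A k ≡ true → f k < n) → (∀ k → A k ≡ true → B (f k) ≡ true) →
  (∀ j k → A j ≡ true → A k ≡ true → f j ≡ f k → j ≡ k) →
  (∀ y → y < n → B y ≡ true → ∃[ k ] (A k ≡ true × f k ≡ y)) →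
  sumF (λ k → if A k then g (f k) else 0) ≡ sumN n (λ y → if B y then g y else 0)
sumF-bijective n A f B g bounded into inj onto =
  trans (sym (+-identityʳ _)) (trans (cong (_ +_) (sym rest≡0)) (sumF-image+rest n A f B g bounded into inj))
  where
  missed : ∀ y → y < n → (if B y ∧ not (imageᵇ A f y) then g y else 0) ≡ 0
  missed y y<n with B y in eB
  ... | false = refl
  ... | true with onto y y<n eB
  ... | k , hk , refl rewrite imageᵇ-complete A f k hk = refl
  rest≡0 : sumN n (λ y → if B y ∧ not (imageᵇ A f y) then g y else 0) ≡ 0
  rest≡0 = trans (sumN-cong n missed) (sumN-zeros n)

injective-onto : ∀ {m} n (A : Fin m → Bool) (f : Fin m → ℕ) (B : ℕ → Bool) →
  (∀ k → A k ≡ true → f k < n) → (∀ k → A k ≡ true → B (f k) ≡ true) →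
  (∀ j k → A j ≡ true → A k ≡ true → f j ≡ f k → j ≡ k) →
  count A ≡ sumN n (ind ∘ B) →
  ∀ y → y < n → B y ≡ true → ∃[ k ] (A k ≡ true × f k ≡ y)
injective-onto n A f B bounded into inj same y y<n hy = imageᵇ-sound A f y hit
  where
  rest≡0 : sumN n (λ y → if B y ∧ not (imageᵇ A f y) then 1 else 0) ≡ 0
  rest≡0 = +-cancelˡ-≡ (count A) _ _
    (trans (sumF-image+rest n A f B (λ _ → 1) bounded into inj) (trans (sym same) (sym (+-identityʳ _))))
  hit : imageᵇ A f y ≡ true
  hit with imageᵇ A f y in ei
  ... | true = refl
  ... | false with sumN≡0⇒ n _ rest≡0 y y<n
  ... | e rewrite hy | ei with () ← e


[n*a+b]/n≡a : ∀ n .{{_ : NonZero n}} a b → b < n → (n * a + b) / n ≡ a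
[n*a+b]/n≡a n a b b<n = begin
  (n * a + b) / n   ≡⟨ +-distrib-/ (n * a) b rems<n ⟩
  n * a / n + b / n ≡⟨ cong₂ _+_ (trans (cong (_/ n) (*-comm n a)) (m*n/n≡m a n)) (m<n⇒m/n≡0 b<n) ⟩
  a + 0             ≡⟨ +-identityʳ a ⟩
  a                 ∎
  where
  open ≡-Reasoning
  rems<n : (n * a) % n + b % n < n
  rems<n = subst (_< n) (sym (cong₂ _+_ (trans (cong (_% n) (*-comm n a)) (m*n%n≡0 a n)) (m<n⇒m%n≡m b<n))) b<n

[n*a+b]%n≡b : ∀ n .{{_ : NonZero n}} a b → b < n → (n * a + b) % n ≡ b
[n*a+b]%n≡b n a b b<n = begin
  (n * a + b) % n ≡⟨ cong (_% n) (trans (+-comm (n * a) b) (cong (b +_) (*-comm n a))) ⟩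
  (b + a * n) % n ≡⟨ [m+kn]%n≡m%n b a n ⟩
  b % n           ≡⟨ m<n⇒m%n≡m b<n ⟩
  b               ∎
  where open ≡-Reasoning

n*a+b-injective : ∀ n .{{_ : NonZero n}} {a b c d} → b < n → d < n → n * a + b ≡ n * c + d → a ≡ c × b ≡ d
n*a+b-injective n {a} {b} {c} {d} b<n d<n e =
  trans (sym ([n*a+b]/n≡a n a b b<n)) (trans (cong (_/ n) e) ([n*a+b]/n≡a n c d d<n)) ,
  trans (sym ([n*a+b]%n≡b n a b b<n)) (trans (cong (_% n) e) ([n*a+b]%n≡b n c d d<n))

∣m-n∣≤o⇒ : ∀ {m n o} → ∣ m - n ∣ ≤ o → m ≤ n + o × n ≤ m + o
∣m-n∣≤o⇒ {m} {n} h = ≤-trans (m≤n+∣m-n∣ m n) (+-monoʳ-≤ n h) ,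
                     ≤-trans (m≤n+∣m-n∣ n m) (+-monoʳ-≤ m (subst (_≤ _) (∣-∣-comm m n) h))

∣m-n∣≤o : ∀ {m n o} → m ≤ n + o → n ≤ m + o → ∣ m - n ∣ ≤ o
∣m-n∣≤o {m} {n} {o} m≤n+o n≤m+o with ≤-total m n
... | inj₁ m≤n = subst (_≤ o) (sym (m≤n⇒∣m-n∣≡n∸m m≤n)) (m≤n+o⇒m∸n≤o n m n≤m+o)
... | inj₂ n≤m = subst (_≤ o) (sym (trans (∣-∣-comm m n) (m≤n⇒∣m-n∣≡n∸m n≤m))) (m≤n+o⇒m∸n≤o m n m≤n+o)

-- Permutations of [1, N] that move every point by at most p

window-offset< : ∀ y c p → c < y + p → y < c + p → y + p ∸ suc c < 2 * p
window-offset< y c zero h1 h2 =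
  ⊥-elim (<⇒≱ (<-≤-trans h1 (≤-reflexive (+-identityʳ _))) (<⇒≤ (subst (y <_) (+-identityʳ c) h2)))
window-offset< y c (suc p) h1 h2 = m<n+o⇒m∸n<o (y + suc p) (suc c) lt
  where
  lt : y + suc p < suc c + 2 * suc p
  lt = ≤-trans (s≤s (+-monoˡ-≤ (suc p) (<⇒≤ h2)))
               (≤-reflexive (cong suc (sym (trans (cong (λ z → c + (suc p + z)) (+-identityʳ (suc p)))
                                                 (sym (+-assoc c (suc p) (suc p)))))))

-- A permutation φ of [1, N] with |φ k - k| ≤ p changes the sum over any run of
-- consecutive points by at most 2p².  By layer-cake summation the prefix sum
-- φ 1 + ... + φ c counts, for every level y, the i ≤ c with y < φ i; compared
-- with the identity this count can only drop, and it can only grow (by at most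
-- p) for the 2p levels y with |y - c| < p.
module BoundedDisplacement (N p : ℕ) (φ : ℕ → ℕ)
  (φ-range : ∀ k → 1 ≤ k → k ≤ N → 1 ≤ φ k × φ k ≤ N)
  (φ-injective : ∀ j k → 1 ≤ j → j ≤ N → 1 ≤ k → k ≤ N → φ j ≡ φ k → j ≡ k)
  (φ-onto : ∀ y → 1 ≤ y → y ≤ N → ∃[ k ] (1 ≤ k × k ≤ N × φ k ≡ y))
  (φ-near : ∀ k → 1 ≤ k → k ≤ N → φ k ≤ k + p × k ≤ φ k + p) where

  count-below : ∀ M v → v ≤ M → sumN M (λ y → ind (y <ᵇ v)) ≡ v
  count-below zero    zero    _         = refl
  count-below (suc M) zero    _         = sumN-zeros M
  count-below (suc M) (suc v) (s≤s v≤M) = cong suc (count-below M v v≤M)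

  layer-cake : ∀ c (h : ℕ → ℕ) → (∀ i → i < c → h i ≤ N) →
    sumN c h ≡ sumN N (λ y → sumN c (λ i → ind (y <ᵇ h i)))
  layer-cake c h bounded = trans (sumN-cong c (λ i i<c → sym (count-below N (h i) (bounded i i<c))))
                                 (sumN-comm c N (λ i y → ind (y <ᵇ h i)))

  prefix prefixφ : ℕ → ℕ
  prefix  c = sumN c suc
  prefixφ c = sumN c (φ ∘ suc)

  above below aboveId : ℕ → ℕ → ℕ
  above   c y = sumN c (λ i → ind (y <ᵇ φ (suc i)))
  below   c y = sumN c (λ i → ind (not (y <ᵇ φ (suc i))))
  aboveId c y = sumN c (λ i → ind (y <ᵇ suc i))

  above≡ : ∀ c y → above c y ≡ c ∸ below c y
  above≡ c y = trans (sym (m+n∸n≡m (above c y) (below c y))) (cong (_∸ below c y) above+below)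
    where
    split : ∀ b → ind b + ind (not b) ≡ 1
    split true  = refl
    split false = refl
    above+below : above c y + below c y ≡ c
    above+below = trans (sym (sumN-+ c _ _)) (trans (sumN-cong c (λ i _ → split (y <ᵇ φ (suc i)))) (sumN-ones c))

  aboveId≡ : ∀ c y → aboveId c y ≡ c ∸ y
  aboveId≡ zero    y = sym (0∸n≡0 y)
  aboveId≡ (suc c) y = trans (sumN-last c (λ i → ind (y <ᵇ suc i))) (step (y ≤? c))
    where
    step : Dec (y ≤ c) → aboveId c y + ind (y <ᵇ suc c) ≡ suc c ∸ y
    step (yes y≤c) rewrite <ᵇ-complete (s≤s y≤c) | aboveId≡ c y =
      trans (+-comm (c ∸ y) 1) (sym (+-∸-assoc 1 y≤c))
    step (no y≰c) rewrite ≥⇒<ᵇ-false {y} {suc c} (≰⇒> y≰c) | aboveId≡ c y =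
      trans (+-identityʳ _) (trans (m≤n⇒m∸n≡0 (≤-trans (n≤1+n c) (≰⇒> y≰c))) (sym (m≤n⇒m∸n≡0 (≰⇒> y≰c))))

  below≤ : ∀ c y → c ≤ N → below c y ≤ y
  below≤ c y c≤N = begin
      below c y                                 ≡⟨ sym (sumF-toℕ c (λ i → ind (not (y <ᵇ φ (suc i))))) ⟩
      sumF {c} (λ i → if A i then 1 else 0)     ≤⟨ sumF-injective-≤ y A f (λ _ → true) (λ _ → 1) bounded (λ _ _ → refl) inj ⟩
      sumN y (λ _ → 1)                          ≡⟨ sumN-ones y ⟩
      y                                         ∎
    where
    open ≤-Reasoning
    A : Fin c → Bool
    A i = not (y <ᵇ φ (suc (toℕ i)))
    f : Fin c → ℕ
    f i = φ (suc (toℕ i)) ∸ 1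
    in-range : ∀ (i : Fin c) → suc (toℕ i) ≤ N
    in-range i = ≤-trans (FP.toℕ<n i) c≤N
    φ≥1 : ∀ i → 1 ≤ φ (suc (toℕ i))
    φ≥1 i = proj₁ (φ-range _ (s≤s z≤n) (in-range i))
    bounded : ∀ k → A k ≡ true → f k < y
    bounded k h = subst (_≤ y) (sym (trans (+-comm 1 _) (m∸n+n≡m (φ≥1 k))))
                    (<ᵇ-false⇒≥ y _ (trans (sym (not-involutive _)) (cong not h)))
    inj : ∀ j k → A j ≡ true → A k ≡ true → f j ≡ f k → j ≡ k
    inj j k _ _ e = FP.toℕ-injective (suc-injective
      (φ-injective _ _ (s≤s z≤n) (in-range j) (s≤s z≤n) (in-range k) (∸-cancelʳ-≡ (φ≥1 j) (φ≥1 k) e)))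

  below≥ : ∀ c y → c ≤ N → y + p ≤ c → y ≤ below c y
  below≥ c y c≤N y+p≤c = begin
      y                                     ≡⟨ sym (trans (sumF-const y 1) (*-identityʳ y)) ⟩
      sumF {y} (λ _ → 1)                    ≤⟨ sumF-injective-≤ c (λ _ → true) f B (λ _ → 1) bounded into inj ⟩
      sumN c (λ i → if B i then 1 else 0)   ≡⟨⟩
      below c y                             ∎
    where
    open ≤-Reasoning
    B : ℕ → Bool
    B i = not (y <ᵇ φ (suc i))
    preimage : ∀ (k : Fin y) → ∃[ j ] (1 ≤ j × j ≤ N × φ j ≡ suc (toℕ k))
    preimage k = φ-onto (suc (toℕ k)) (s≤s z≤n) (≤-trans (FP.toℕ<n k) (≤-trans (≤-trans (m≤m+n y p) y+p≤c) c≤N))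
    f : Fin y → ℕ
    f k = proj₁ (preimage k) ∸ 1
    suc-f : ∀ k → suc (f k) ≡ proj₁ (preimage k)
    suc-f k = trans (+-comm 1 _) (m∸n+n≡m (proj₁ (proj₂ (preimage k))))
    φ-f : ∀ k → φ (suc (f k)) ≡ suc (toℕ k)
    φ-f k = trans (cong φ (suc-f k)) (proj₂ (proj₂ (proj₂ (preimage k))))
    bounded : ∀ k → true ≡ true → f k < c
    bounded k _ with preimage k | suc-f k
    ... | j , j≥1 , j≤N , e | s =
      subst (_≤ c) (sym s) (≤-trans (proj₂ (φ-near j j≥1 j≤N))
                              (≤-trans (+-monoˡ-≤ p (subst (_≤ y) (sym e) (FP.toℕ<n k))) y+p≤c))
    into : ∀ k → true ≡ true → B (f k) ≡ true
    into k _ rewrite φ-f k = cong not (≥⇒<ᵇ-false {y} {suc (toℕ k)} (FP.toℕ<n k))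
    inj : ∀ j k → true ≡ true → true ≡ true → f j ≡ f k → j ≡ k
    inj j k _ _ e = FP.toℕ-injective (suc-injective (trans (sym (φ-f j)) (trans (cong (φ ∘ suc) e) (φ-f k))))

  prefix≤prefixφ : ∀ c → c ≤ N → prefix c ≤ prefixφ c
  prefix≤prefixφ c c≤N = begin
      prefix c                    ≡⟨ layer-cake c suc (λ i i<c → ≤-trans i<c c≤N) ⟩
      sumN N (aboveId c)          ≤⟨ sumN-mono N levelwise ⟩
      sumN N (above c)            ≡⟨ sym (layer-cake c (φ ∘ suc) (λ i i<c → proj₂ (φ-range _ (s≤s z≤n) (≤-trans i<c c≤N)))) ⟩
      prefixφ c                   ∎
    where
    open ≤-Reasoning
    levelwise : ∀ y → y < N → aboveId c y ≤ above c y
    levelwise y _ = subst₂ _≤_ (sym (aboveId≡ c y)) (sym (above≡ c y)) (∸-monoʳ-≤ c (below≤ c y c≤N))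

  inWindow : ℕ → ℕ → ℕ
  inWindow c y = ind ((c <ᵇ y + p) ∧ (y <ᵇ c + p))

  window-size : ∀ c → sumN N (inWindow c) ≤ 2 * p
  window-size c = begin
      sumN N (inWindow c)                      ≡⟨ sym (sumF-toℕ N (inWindow c)) ⟩
      sumF {N} (λ i → if A i then 1 else 0)    ≤⟨ sumF-injective-≤ (2 * p) A f (λ _ → true) (λ _ → 1) bounded (λ _ _ → refl) inj ⟩
      sumN (2 * p) (λ _ → 1)                   ≡⟨ sumN-ones (2 * p) ⟩
      2 * p                                    ∎
    where
    open ≤-Reasoning
    A : Fin N → Bool
    A i = (c <ᵇ toℕ i + p) ∧ (toℕ i <ᵇ c + p)
    f : Fin N → ℕ
    f i = toℕ i + p ∸ suc c
    facts : ∀ i → A i ≡ true → c < toℕ i + p × toℕ i < c + p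
    facts i h = let l , r = ∧-true⁻ _ _ h in <ᵇ-sound _ _ l , <ᵇ-sound _ _ r
    bounded : ∀ k → A k ≡ true → f k < 2 * p
    bounded k h = window-offset< (toℕ k) c p (proj₁ (facts k h)) (proj₂ (facts k h))
    inj : ∀ j k → A j ≡ true → A k ≡ true → f j ≡ f k → j ≡ k
    inj j k hj hk e = FP.toℕ-injective (+-cancelʳ-≡ _ _ _ (∸-cancelʳ-≡ (proj₁ (facts j hj)) (proj₁ (facts k hk)) e))

  Err : ℕ
  Err = p * (2 * p)

  above-shifted : ∀ c y → c ≤ N → above c y ≤ aboveId c (y ∸ p)
  above-shifted c y c≤N = sumN-mono c pointwise
    where
    pointwise : ∀ i → i < c → ind (y <ᵇ φ (suc i)) ≤ ind ((y ∸ p) <ᵇ suc i)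
    pointwise i i<c with y <ᵇ φ (suc i) in e
    ... | false = z≤n
    ... | true rewrite <ᵇ-complete {y ∸ p} {suc i} (m<n+o⇒m∸n<o y p
                 (<-≤-trans (<ᵇ-sound _ _ e) (≤-trans (proj₁ (φ-near (suc i) (s≤s z≤n) (≤-trans i<c c≤N))) (≤-reflexive (+-comm (suc i) p))))) = ≤-refl

  above≤aboveId+window : ∀ c y → c ≤ N → above c y ≤ aboveId c y + p * inWindow c y
  above≤aboveId+window c y c≤N with y + p ≤? c
  ... | yes y+p≤c = ≤-trans (≤-reflexive (above≡ c y))
                      (≤-trans (∸-monoʳ-≤ c (below≥ c y c≤N y+p≤c)) (≤-trans (≤-reflexive (sym (aboveId≡ c y))) (m≤m+n _ _)))
  ... | no y+p≰c with y <? c + p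
  ...   | yes y<c+p rewrite <ᵇ-complete (≰⇒> y+p≰c) | <ᵇ-complete y<c+p | *-identityʳ p =
          ≤-trans (above-shifted c y c≤N) (≤-trans (≤-reflexive (aboveId≡ c (y ∸ p)))
            (subst (c ∸ (y ∸ p) ≤_) (cong (_+ p) (sym (aboveId≡ c y))) c∸[y∸p]≤))
    where
    c∸[y∸p]≤ : c ∸ (y ∸ p) ≤ (c ∸ y) + p
    c∸[y∸p]≤ = m≤n+o⇒m∸n≤o c (y ∸ p) (≤-trans (m≤n+m∸n c y)
                 (≤-trans (+-monoˡ-≤ (c ∸ y) (m≤n+m∸n y p)) (≤-reflexive (shuffle p (y ∸ p) (c ∸ y)))))
      where
      shuffle : ∀ a b d → (a + b) + d ≡ b + (d + a)
      shuffle = solve-∀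
  ...   | no y≮c+p = ≤-trans (≤-reflexive (trans (sumN-cong c none) (sumN-zeros c))) z≤n
    where
    none : ∀ i → i < c → ind (y <ᵇ φ (suc i)) ≡ 0
    none i i<c rewrite ≥⇒<ᵇ-false {y} {φ (suc i)} (≤-trans (proj₁ (φ-near (suc i) (s≤s z≤n) (≤-trans i<c c≤N)))
                                                     (≤-trans (+-monoˡ-≤ p i<c) (≮⇒≥ y≮c+p))) = refl

  prefixφ≤prefix+Err : ∀ c → c ≤ N → prefixφ c ≤ prefix c + Err
  prefixφ≤prefix+Err c c≤N = begin
      prefixφ c                                              ≡⟨ layer-cake c (φ ∘ suc) (λ i i<c → proj₂ (φ-range _ (s≤s z≤n) (≤-trans i<c c≤N))) ⟩
      sumN N (above c)                                       ≤⟨ sumN-mono N (λ y _ → above≤aboveId+window c y c≤N) ⟩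
      sumN N (λ y → aboveId c y + p * inWindow c y)          ≡⟨ sumN-+ N (aboveId c) (λ y → p * inWindow c y) ⟩
      sumN N (aboveId c) + sumN N (λ y → p * inWindow c y)   ≡⟨ cong₂ _+_ (sym (layer-cake c suc (λ i i<c → ≤-trans i<c c≤N))) (sumN-*ˡ N p (inWindow c)) ⟩
      prefix c + p * sumN N (inWindow c)                     ≤⟨ +-monoʳ-≤ (prefix c) (*-monoʳ-≤ p (window-size c)) ⟩
      prefix c + Err                                         ∎
    where open ≤-Reasoning

  run-φ≤run+Err : ∀ a len → a + len ≤ N → sumN len (λ i → φ (suc a + i)) ≤ sumN len (λ i → suc a + i) + Err
  run-φ≤run+Err a len h = +-cancelˡ-≤ (prefix a) _ _ (begin
      prefix a + Rφ           ≤⟨ +-monoˡ-≤ Rφ (prefix≤prefixφ a (≤-trans (m≤m+n a len) h)) ⟩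
      prefixφ a + Rφ          ≡⟨ sym (sumN-split a len (φ ∘ suc)) ⟩
      prefixφ (a + len)       ≤⟨ prefixφ≤prefix+Err (a + len) h ⟩
      prefix (a + len) + Err  ≡⟨ cong (_+ Err) (sumN-split a len suc) ⟩
      (prefix a + R) + Err    ≡⟨ +-assoc (prefix a) R Err ⟩
      prefix a + (R + Err)    ∎)
    where
    open ≤-Reasoning
    Rφ R : ℕ
    Rφ = sumN len (λ i → φ (suc a + i))
    R  = sumN len (λ i → suc a + i)

  run≤run-φ+Err : ∀ a len → a + len ≤ N → sumN len (λ i → suc a + i) ≤ sumN len (λ i → φ (suc a + i)) + Err
  run≤run-φ+Err a len h = +-cancelˡ-≤ (prefix a) _ _ (begin
      prefix a + R            ≡⟨ sym (sumN-split a len suc) ⟩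
      prefix (a + len)        ≤⟨ prefix≤prefixφ (a + len) h ⟩
      prefixφ (a + len)       ≡⟨ sumN-split a len (φ ∘ suc) ⟩
      prefixφ a + Rφ          ≤⟨ +-monoˡ-≤ Rφ (prefixφ≤prefix+Err a (≤-trans (m≤m+n a len) h)) ⟩
      (prefix a + Err) + Rφ   ≡⟨ trans (+-assoc (prefix a) Err Rφ) (cong (prefix a +_) (+-comm Err Rφ)) ⟩
      prefix a + (Rφ + Err)   ∎)
    where
    open ≤-Reasoning
    Rφ R : ℕ
    Rφ = sumN len (λ i → φ (suc a + i))
    R  = sumN len (λ i → suc a + i)

SameEdge : ∀ {A : Set} → A → A → A → A → Set
SameEdge x y x′ y′ = (x ≡ x′ × y ≡ y′) ⊎ (x ≡ y′ × y ≡ x′)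

≢⇒Kedge : ∀ {n} {x y : Fin n} → x ≢ y → Kedge x y ≡ true
≢⇒Kedge {x = x} {y} x≢y = cong not (dec-false (x FP.≟ y) x≢y)

Kedge⇒≢ : ∀ {n} {x y : Fin n} → Kedge x y ≡ true → x ≢ y
Kedge⇒≢ {x = x} {y} h = reflects-false (proof (x FP.≟ y)) (trans (sym (not-involutive _)) (cong not h))

¬Kedge⇒≡ : ∀ {n} {x y : Fin n} → Kedge x y ≡ false → x ≡ y
¬Kedge⇒≡ {x = x} {y} h = reflects-true (proof (x FP.≟ y)) (trans (sym (not-involutive _)) (cong not h))

Kedge-sym : ∀ {n} (x y : Fin n) → Kedge x y ≡ true → Kedge y x ≡ true
Kedge-sym x y h = ≢⇒Kedge (Kedge⇒≢ {x = x} {y} h ∘ sym)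

[2+t]/2≡1+t/2 : ∀ t → (2 + t) / 2 ≡ suc (t / 2)
[2+t]/2≡1+t/2 t = +-distrib-/-∣ˡ {2} t {2} (divides 1 refl)

sum-halves : ∀ N → sumN (N + N) (λ y → y / 2 + 1) ≡ N * suc N
sum-halves zero    = refl
sum-halves (suc N) = begin
  sumN (suc N + suc N) g                           ≡⟨ cong (λ z → sumN (suc z) g) (+-suc N N) ⟩
  1 + (1 + sumN (N + N) (λ y → g (2 + y)))         ≡⟨ cong (λ z → 1 + (1 + z)) (sumN-cong (N + N) (λ y _ → cong (_+ 1) (trans ([2+t]/2≡1+t/2 y) (+-comm 1 (y / 2))))) ⟩
  1 + (1 + sumN (N + N) (λ y → g y + 1))           ≡⟨ cong (λ z → 1 + (1 + z)) (trans (sumN-+ (N + N) g (λ _ → 1)) (cong₂ _+_ (sum-halves N) (sumN-ones (N + N)))) ⟩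
  1 + (1 + (N * suc N + (N + N)))                  ≡⟨ shape N ⟩
  suc N * suc (suc N)                              ∎
  where
  open ≡-Reasoning
  g : ℕ → ℕ
  g y = y / 2 + 1
  shape : ∀ N → 1 + (1 + (N * suc N + (N + N))) ≡ suc N * suc (suc N)
  shape = solve-∀

-- Over ordered pairs every label of a symmetric labeling is counted twice; the
-- pair (a, b) with label ℓ is coded as 2(ℓ - 1) or 2(ℓ - 1) + 1 according to the
-- order of a and b, a bijection onto [0, 2N).
module OrderedPairs {m} (A : Fin m → Fin m → Bool) N (t : Fin m → Fin m → ℕ) (labeling : IsLabeling A N t)
  (A-sym : ∀ {a b} → A a b ≡ true → A b a ≡ true) (irreflexive : ∀ {a b} → A a b ≡ true → a ≢ b) where

  t-sym : ∀ a b → A a b ≡ true → t a b ≡ t b a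
  t-sym = proj₁ labeling

  t-range : ∀ a b → A a b ≡ true → 1 ≤ t a b × t a b ≤ N
  t-range = proj₁ (proj₂ labeling)

  t-injective : ∀ a b a′ b′ → A a b ≡ true → A a′ b′ ≡ true → t a b ≡ t a′ b′ → SameEdge a b a′ b′
  t-injective = proj₁ (proj₂ (proj₂ labeling))

  t-onto : ∀ ℓ → 1 ≤ ℓ → ℓ ≤ N → ∃[ a ] ∃[ b ] (A a b ≡ true × t a b ≡ ℓ)
  t-onto = proj₂ (proj₂ (proj₂ labeling))

  order : Fin m → Fin m → ℕ
  order a b = ind (not (toℕ a <ᵇ toℕ b))

  order<2 : ∀ a b → order a b < 2
  order<2 a b with toℕ a <ᵇ toℕ b
  ... | true  = s≤s z≤n
  ... | false = s≤s (s≤s z≤n)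

  order-flip : ∀ a b → a ≢ b → order a b ≢ order b a
  order-flip a b a≢b with toℕ a <ᵇ toℕ b in e | toℕ b <ᵇ toℕ a in e′
  ... | true  | true  = λ _ → <-asym (<ᵇ-sound (toℕ a) (toℕ b) e) (<ᵇ-sound (toℕ b) (toℕ a) e′)
  ... | true  | false = λ ()
  ... | false | true  = λ ()
  ... | false | false = λ _ → a≢b (FP.toℕ-injective (≤-antisym (<ᵇ-false⇒≥ (toℕ b) (toℕ a) e′) (<ᵇ-false⇒≥ (toℕ a) (toℕ b) e)))

  pair : Fin (m * m) → Fin m × Fin m
  pair = remQuot m

  a⋆ b⋆ : Fin (m * m) → Fin m
  a⋆ z = proj₁ (pair z)
  b⋆ z = proj₂ (pair z)

  A⋆ : Fin (m * m) → Bool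
  A⋆ z = A (a⋆ z) (b⋆ z)

  t⋆ : Fin (m * m) → ℕ
  t⋆ z = t (a⋆ z) (b⋆ z)

  o⋆ : Fin (m * m) → ℕ
  o⋆ z = order (a⋆ z) (b⋆ z)

  o⋆<2 : ∀ z → o⋆ z < 2
  o⋆<2 z = order<2 (a⋆ z) (b⋆ z)

  code : Fin (m * m) → ℕ
  code z = 2 * (t⋆ z ∸ 1) + o⋆ z

  at-combine : ∀ a b → (if A⋆ (combine a b) then t⋆ (combine a b) else 0) ≡ (if A a b then t a b else 0)
  at-combine a b = cong (λ p → if A (proj₁ p) (proj₂ p) then t (proj₁ p) (proj₂ p) else 0) (FP.remQuot-combine a b)

  t⋆≥1 : ∀ z → A⋆ z ≡ true → 1 ≤ t⋆ z
  t⋆≥1 z h = proj₁ (t-range (a⋆ z) (b⋆ z) h)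

  halve : ∀ z → (if A⋆ z then code z / 2 + 1 else 0) ≡ (if A⋆ z then t⋆ z else 0)
  halve z with A⋆ z in h
  ... | false = refl
  ... | true  = trans (cong (_+ 1) ([n*a+b]/n≡a 2 (t⋆ z ∸ 1) (o⋆ z) (o⋆<2 z))) (m∸n+n≡m (t⋆≥1 z h))

  code< : ∀ z → A⋆ z ≡ true → code z < 2 * N
  code< z h = <-≤-trans (+-monoʳ-< (2 * (t⋆ z ∸ 1)) (o⋆<2 z)) (≤-trans (≤-reflexive two-t) (*-monoʳ-≤ 2 (proj₂ (t-range (a⋆ z) (b⋆ z) h))))
    where
    two-t : 2 * (t⋆ z ∸ 1) + 2 ≡ 2 * t⋆ z
    two-t = trans (+-comm _ 2) (trans (sym (*-suc 2 (t⋆ z ∸ 1))) (cong (2 *_) (trans (+-comm 1 _) (m∸n+n≡m (t⋆≥1 z h)))))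

  unpair : ∀ z → combine (proj₁ (pair z)) (proj₂ (pair z)) ≡ z
  unpair = FP.combine-remQuot {m} m

  code-injective : ∀ j z → A⋆ j ≡ true → A⋆ z ≡ true → code j ≡ code z → j ≡ z
  code-injective j z hj hz e with n*a+b-injective 2 (o⋆<2 j) (o⋆<2 z) e
  ... | same-label , same-order with t-injective (a⋆ j) (b⋆ j) (a⋆ z) (b⋆ z) hj hz (∸-cancelʳ-≡ (t⋆≥1 j hj) (t⋆≥1 z hz) same-label)
  ...   | inj₁ (ea , eb) = trans (sym (unpair j)) (trans (cong₂ combine ea eb) (unpair z))
  ...   | inj₂ (ea , eb) = ⊥-elim (order-flip (a⋆ j) (b⋆ j) (irreflexive hj) (trans same-order (cong₂ order (sym eb) (sym ea))))

  other-bit : ∀ {p o o′} → p < 2 → o < 2 → o′ < 2 → o ≢ o′ → p ≢ o → p ≡ o′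
  other-bit {0} {0} _ _ _ _ p≢o = ⊥-elim (p≢o refl)
  other-bit {1} {1} _ _ _ _ p≢o = ⊥-elim (p≢o refl)
  other-bit {0} {1} {0} _ _ _ _ _ = refl
  other-bit {0} {1} {1} _ _ _ o≢o′ _ = ⊥-elim (o≢o′ refl)
  other-bit {1} {0} {1} _ _ _ _ _ = refl
  other-bit {1} {0} {0} _ _ _ o≢o′ _ = ⊥-elim (o≢o′ refl)
  other-bit {suc (suc _)} (s≤s (s≤s ())) _ _ _ _
  other-bit {_} {suc (suc _)} _ (s≤s (s≤s ())) _ _ _
  other-bit {_} {_} {suc (suc _)} _ _ (s≤s (s≤s ())) _ _

  code-onto : ∀ y → y < 2 * N → true ≡ true → ∃[ z ] (A⋆ z ≡ true × code z ≡ y)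
  code-onto y y<2N _ = let a , b , h , e = t-onto (suc (y / 2)) (s≤s z≤n) (m<n*o⇒m/o<n (subst (y <_) (*-comm 2 N) y<2N))
                       in orient a b h e (y % 2 ≟ order a b)
    where
    at : ∀ a′ b′ → A a′ b′ ≡ true → t a′ b′ ≡ suc (y / 2) → y % 2 ≡ order a′ b′ → ∃[ z ] (A⋆ z ≡ true × code z ≡ y)
    at a′ b′ h′ e′ p≡o = combine a′ b′ , trans (cong (λ p → A (proj₁ p) (proj₂ p)) (FP.remQuot-combine a′ b′)) h′ , (begin
      code (combine a′ b′)                ≡⟨ cong (λ p → 2 * (t (proj₁ p) (proj₂ p) ∸ 1) + order (proj₁ p) (proj₂ p)) (FP.remQuot-combine a′ b′) ⟩
      2 * (t a′ b′ ∸ 1) + order a′ b′     ≡⟨ cong₂ (λ ℓ o → 2 * (ℓ ∸ 1) + o) e′ (sym p≡o) ⟩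
      2 * (y / 2) + y % 2                 ≡⟨ trans (+-comm _ (y % 2)) (trans (cong (y % 2 +_) (*-comm 2 (y / 2))) (sym (m≡m%n+[m/n]*n y 2))) ⟩
      y                                   ∎)
      where open ≡-Reasoning
    orient : ∀ a b → A a b ≡ true → t a b ≡ suc (y / 2) → Dec (y % 2 ≡ order a b) → ∃[ z ] (A⋆ z ≡ true × code z ≡ y)
    orient a b h e (yes p≡o) = at a b h e p≡o
    orient a b h e (no p≢o)  = at b a (A-sym h) (trans (sym (t-sym a b h)) e)
                         (other-bit (m%n<n y 2) (order<2 a b) (order<2 b a) (order-flip a b (irreflexive h)) p≢o)

  ordered-label-sum : sumF (λ a → sumF (λ b → if A a b then t a b else 0)) ≡ N * suc N
  ordered-label-sum = begin
    sumF (λ a → sumF (λ b → if A a b then t a b else 0))           ≡⟨ sym (trans (sumF-combine m m (λ z → if A⋆ z then t⋆ z else 0)) (sumF-cong (λ a → sumF-cong (λ b → at-combine a b)))) ⟩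
    sumF (λ z → if A⋆ z then t⋆ z else 0)                          ≡⟨ sym (sumF-cong halve) ⟩
    sumF (λ z → if A⋆ z then code z / 2 + 1 else 0)                ≡⟨ sumF-bijective (2 * N) A⋆ code (λ _ → true) (λ y → y / 2 + 1) code< (λ _ _ → refl) code-injective code-onto ⟩
    sumN (2 * N) (λ y → y / 2 + 1)                                 ≡⟨ cong (λ n → sumN n (λ y → y / 2 + 1)) (cong (N +_) (+-identityʳ N)) ⟩
    sumN (N + N) (λ y → y / 2 + 1)                                 ≡⟨ sum-halves N ⟩
    N * suc N                                                      ∎
    where open ≡-Reasoning

record TwoRuns (q : ℕ) (Hit : ℕ → Set) : Set where
  field
    start₁ start₂ : ℕ
    run₁          : ∀ d → d < q → Hit (start₁ + d)
    run₂          : ∀ d → d < q → Hit (start₂ + d)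
    disjoint      : Disjoint1AP (start₁ , q) (start₂ , q)

TwoRuns-map : ∀ {q} {P Q : ℕ → Set} → (∀ {ℓ} → P ℓ → Q ℓ) → TwoRuns q P → TwoRuns q Q
TwoRuns-map f R = record { TwoRuns R; run₁ = λ d d<q → f (run₁ d d<q); run₂ = λ d d<q → f (run₂ d d<q) }
  where open TwoRuns R

two-runs⇒type : ∀ {n} (t : Fin n → Fin n → ℕ) q p → 2 * p ≤ q →
  (∀ v → TwoRuns q (λ ℓ → ∃[ w ] (Kedge v w ≡ true × t v w ≡ ℓ))) → OfType 2 (2 * q) p t
two-runs⇒type t q p 2p≤q runs v =
  (start₁ , q) ∷ (start₂ , q) ∷ [] , ≤-refl , (covered run₁ ∷ covered run₂ ∷ []) , ((disjoint ∷ []) ∷ [] ∷ []) , ≤-refl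
  where
  open TwoRuns (runs v)
  covered : ∀ {s} → (∀ d → d < q → ∃[ w ] (Kedge v w ≡ true × t v w ≡ s + d)) →
    2 * p ≤ q × (∀ x → s ≤ x → x < s + q → ∃[ w ] (Kedge v w ≡ true × t v w ≡ x))
  covered {s} run = 2p≤q , λ x s≤x x<s+q →
    let w , K , e = run (x ∸ s) (+-cancelˡ-< s _ _ (subst (_< s + q) (sym (m+[n∸m]≡n s≤x)) x<s+q))
    in w , K , trans e (m+[n∸m]≡n s≤x)

-- The weaving square

-- Block indices I, J : Fin 4 stand for i₁ - 1, j₁ - 1; block I J = B(i₁, j₁) - 1.
block : Fin 4 → Fin 4 → ℕ
block I J = Bsq (toℕ I + 1) (toℕ J + 1) ∸ 1

rot : Fin 4 → Fin 4 → ℕ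
rot I J = (toℕ J + 1 + 4 ∸ (toℕ I + 1)) % 4

-- What is used of a row or column of B: its entries sum to 34 (so 30 after
-- subtracting 1), two of them are at most 8, and it meets each rotation once.
record Line (b r : Fin 4 → ℕ) : Set where
  constructor line
  field
    sum≡30             : sumF b ≡ 30
    lows≡2             : count (λ L → b L ≤ᵇ 7) ≡ 2
    highs≡2            : count (λ L → not (b L ≤ᵇ 7)) ≡ 2
    rotation<4         : ∀ L → r L < 4
    rotation-injective : ∀ L L′ → r L ≡ r L′ → L ≡ L′
    rotation-at        : ∀ (s : Fin 4) → ∃[ L ] r L ≡ toℕ s

line? : ∀ b r → Dec (Line b r)
line? b r = map′ (λ (s , l , h , r< , inj , onto) → line s l h r< inj onto)
                 (λ (line s l h r< inj onto) → s , l , h , r< , inj , onto)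
  (sumF b ≟ 30 ×-dec count (λ L → b L ≤ᵇ 7) ≟ 2 ×-dec count (λ L → not (b L ≤ᵇ 7)) ≟ 2 ×-dec
   all? (λ L → r L <? 4) ×-dec all? (λ L → all? λ L′ → (r L ≟ r L′) →-dec (L FP.≟ L′)) ×-dec
   all? (λ s → any? λ L → r L ≟ toℕ s))

-- Exhaustive checks on the 4 × 4 pattern; sealed so that conversion checking never re-runs them.
abstract
  block-injective : ∀ I J I′ J′ → block I J ≡ block I′ J′ → I ≡ I′ × J ≡ J′
  block-injective = toWitness {a? = all? λ I → all? λ J → all? λ I′ → all? λ J′ →
    (block I J ≟ block I′ J′) →-dec (I FP.≟ I′ ×-dec J FP.≟ J′)} _

  block<16 : ∀ I J → block I J < 16
  block<16 = toWitness {a? = all? λ I → all? λ J → block I J <? 16} _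

  row-line : ∀ I → Line (block I) (rot I)
  row-line = toWitness {a? = all? λ I → line? (block I) (rot I)} _

  column-line : ∀ J → Line (λ I → block I J) (λ I → rot I J)
  column-line = toWitness {a? = all? λ J → line? (λ I → block I J) (λ I → rot I J)} _

data BlockView (q : ℕ) : Fin (4 * q) → Set where
  at : ∀ (I : Fin 4) (x : Fin q) → BlockView q (combine I x)

blockView : ∀ q (b : Fin (4 * q)) → BlockView q b
blockView q b = subst (BlockView q) (FP.combine-remQuot {4} q b) (at I x)
  where
  I : Fin 4
  I = proj₁ (remQuot {4} q b)
  x : Fin q
  x = proj₂ (remQuot {4} q b)

module WeavingSquare (q : ℕ) {{_ : NonZero q}} where

  rev : ℕ → ℕ
  rev x = q ∸ suc x

  rev< : ∀ {x} → x < q → rev x < q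
  rev< x<q = ∸-monoʳ-< z<s x<q

  suc+rev : ∀ {x} → x < q → suc x + rev x ≡ q
  suc+rev x<q = m+[n∸m]≡n x<q

  rev-injective : ∀ {x y} → x < q → y < q → rev x ≡ rev y → x ≡ y
  rev-injective {x} {y} x<q y<q e = suc-injective (+-cancelʳ-≡ _ _ _
    (trans (suc+rev x<q) (trans (sym (suc+rev y<q)) (cong (suc y +_) (sym e)))))

  rev-involutive : ∀ {x} → x < q → rev (rev x) ≡ x
  rev-involutive {x} x<q = +-cancelˡ-≡ (suc (rev x)) _ _
    (trans (suc+rev (rev< x<q)) (trans (sym (suc+rev x<q)) (cong suc (+-comm x (rev x)))))

  -- 0-based row and column in L_q of the entry at 0-based position (x, y) of L^r_q
  lrow lcol : ℕ → ℕ → ℕ → ℕ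
  lrow 0 x y = x
  lrow 1 x y = rev y
  lrow 2 x y = rev x
  lrow _ x y = y
  lcol 0 x y = y
  lcol 1 x y = x
  lcol 2 x y = rev y
  lcol _ x y = rev x

  L′ : ℕ → ℕ → ℕ → ℕ
  L′ r x y = q * lrow r x y + (lcol r x y + 1)

  lrow<q : ∀ r {x y} → x < q → y < q → lrow r x y < q
  lrow<q 0                     x<q y<q = x<q
  lrow<q 1                     x<q y<q = rev< y<q
  lrow<q 2                     x<q y<q = rev< x<q
  lrow<q (suc (suc (suc r)))   x<q y<q = y<q

  lcol<q : ∀ r {x y} → x < q → y < q → lcol r x y < q
  lcol<q 0                     x<q y<q = y<q
  lcol<q 1                     x<q y<q = x<q
  lcol<q 2                     x<q y<q = rev< y<q
  lcol<q (suc (suc (suc r)))   x<q y<q = rev< x<q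

  lrow-lcol-injective : ∀ r {x y x′ y′} → r < 4 → x < q → y < q → x′ < q → y′ < q →
    lrow r x y ≡ lrow r x′ y′ → lcol r x y ≡ lcol r x′ y′ → x ≡ x′ × y ≡ y′
  lrow-lcol-injective 0 _ _   _   _    _    er ec = er , ec
  lrow-lcol-injective 1 _ x<q y<q x′<q y′<q er ec = ec , rev-injective y<q y′<q er
  lrow-lcol-injective 2 _ x<q y<q x′<q y′<q er ec = rev-injective x<q x′<q er , rev-injective y<q y′<q ec
  lrow-lcol-injective 3 _ x<q y<q x′<q y′<q er ec = rev-injective x<q x′<q ec , er
  lrow-lcol-injective (suc (suc (suc (suc r)))) (s≤s (s≤s (s≤s (s≤s ())))) _ _ _ _ _ _

  q*a+b<q*q : ∀ {a b} → a < q → b < q → q * a + b < q * q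
  q*a+b<q*q {a} {b} a<q b<q = begin-strict
    q * a + b     <⟨ +-monoʳ-< (q * a) b<q ⟩
    q * a + q     ≡⟨ trans (+-comm _ q) (sym (*-suc q a)) ⟩
    q * suc a     ≤⟨ *-monoʳ-≤ q a<q ⟩
    q * q         ∎
    where open ≤-Reasoning

  L′≡suc : ∀ r x y → L′ r x y ≡ suc (q * lrow r x y + lcol r x y)
  L′≡suc r x y = trans (cong (q * lrow r x y +_) (+-comm (lcol r x y) 1)) (+-suc _ _)

  L′≤q*q : ∀ r {x y} → x < q → y < q → L′ r x y ≤ q * q
  L′≤q*q r {x} {y} x<q y<q = subst (_≤ q * q) (sym (L′≡suc r x y)) (q*a+b<q*q (lrow<q r x<q y<q) (lcol<q r x<q y<q))

  [m+1]∸[n+1]≡m∸n : ∀ m n → m + 1 ∸ (n + 1) ≡ m ∸ n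
  [m+1]∸[n+1]≡m∸n m n = cong₂ _∸_ (+-comm m 1) (+-comm n 1)

  q∸x≡suc-rev : ∀ {x} → x < q → q ∸ x ≡ suc (rev x)
  q∸x≡suc-rev x<q = +-∸-assoc 1 x<q

  Lrot≡L′ : ∀ r {x y} → r < 4 → x < q → y < q → Lrot q r (x + 1) (y + 1) ≡ L′ r x y
  Lrot≡L′ 0 {x} {y} _ _ _ rewrite m+n∸n≡m x 1 = refl
  Lrot≡L′ 1 {x} {y} _ _ y<q rewrite [m+1]∸[n+1]≡m∸n q y | q∸x≡suc-rev y<q = refl
  Lrot≡L′ 2 {x} {y} _ x<q y<q
    rewrite [m+1]∸[n+1]≡m∸n q x | [m+1]∸[n+1]≡m∸n q y | q∸x≡suc-rev x<q | q∸x≡suc-rev y<q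
    = cong (q * rev x +_) (+-comm 1 (rev y))
  Lrot≡L′ 3 {x} {y} _ x<q _ rewrite m+n∸n≡m y 1 | [m+1]∸[n+1]≡m∸n q x | q∸x≡suc-rev x<q = cong (q * y +_) (+-comm 1 (rev x))
  Lrot≡L′ (suc (suc (suc (suc r)))) (s≤s (s≤s (s≤s (s≤s ())))) _ _

  instance
    q*q≢0 : NonZero (q * q)
    q*q≢0 = m*n≢0 q q

  rot<4 : ∀ I J → rot I J < 4
  rot<4 I J = m%n<n (toℕ J + 1 + 4 ∸ (toℕ I + 1)) 4

  cell : ℕ → ℕ → ℕ → ℕ → ℕ
  cell b r x y = b * (q * q) + L′ r x y

  entry : Fin 4 → Fin 4 → ℕ → ℕ → ℕ
  entry I J = cell (block I J) (rot I J)

  W-combine : ∀ I J (x y : Fin q) → W q (toℕ (combine I x) + 1) (toℕ (combine J y) + 1) ≡ entry I J (toℕ x) (toℕ y)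
  W-combine I J x y
    rewrite FP.toℕ-combine I x | FP.toℕ-combine J y
          | m+n∸n≡m (q * toℕ I + toℕ x) 1 | m+n∸n≡m (q * toℕ J + toℕ y) 1
          | [n*a+b]/n≡a q (toℕ I) (toℕ x) (FP.toℕ<n x) | [n*a+b]%n≡b q (toℕ I) (toℕ x) (FP.toℕ<n x)
          | [n*a+b]/n≡a q (toℕ J) (toℕ y) (FP.toℕ<n y) | [n*a+b]%n≡b q (toℕ J) (toℕ y) (FP.toℕ<n y)
    = cong (block I J * (q * q) +_) (Lrot≡L′ (rot I J) (rot<4 I J) (FP.toℕ<n x) (FP.toℕ<n y))

  cell≡suc : ∀ b r x y → cell b r x y ≡ suc ((q * q) * b + (q * lrow r x y + lcol r x y))
  cell≡suc b r x y = shape b (q * q) q (lrow r x y) (lcol r x y)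
    where
    shape : ∀ b Q q a c → b * Q + (q * a + (c + 1)) ≡ suc (Q * b + (q * a + c))
    shape = solve-∀

  entry-injective : ∀ {I J I′ J′ x y x′ y′} → x < q → y < q → x′ < q → y′ < q →
    entry I J x y ≡ entry I′ J′ x′ y′ → I ≡ I′ × J ≡ J′ × x ≡ x′ × y ≡ y′
  entry-injective {I} {J} {I′} {J′} {x} {y} {x′} {y′} x<q y<q x′<q y′<q e =
    proj₁ same-block , proj₂ same-block ,
    lrow-lcol-injective r (rot<4 I J) x<q y<q x′<q y′<q (proj₁ same-position) (proj₂ same-position)
    where
    r r′ : ℕ
    r = rot I J
    r′ = rot I′ J′
    split : block I J ≡ block I′ J′ × q * lrow r x y + lcol r x y ≡ q * lrow r′ x′ y′ + lcol r′ x′ y′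
    split = n*a+b-injective (q * q) (q*a+b<q*q (lrow<q r x<q y<q) (lcol<q r x<q y<q))
                                    (q*a+b<q*q (lrow<q r′ x′<q y′<q) (lcol<q r′ x′<q y′<q))
                                    (suc-injective (trans (sym (cell≡suc (block I J) r x y)) (trans e (cell≡suc (block I′ J′) r′ x′ y′))))
    same-block : I ≡ I′ × J ≡ J′
    same-block = block-injective I J I′ J′ (proj₁ split)
    same-position : lrow r x y ≡ lrow r x′ y′ × lcol r x y ≡ lcol r x′ y′
    same-position = n*a+b-injective q (lcol<q r x<q y<q) (lcol<q r x′<q y′<q)
                      (trans (proj₂ split) (cong (λ s → q * lrow s x′ y′ + lcol s x′ y′) (sym (cong₂ rot (proj₁ same-block) (proj₂ same-block)))))

  entry-range : ∀ I J {x y} → x < q → y < q → 1 ≤ entry I J x y × entry I J x y ≤ 16 * (q * q)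
  entry-range I J {x} {y} x<q y<q = subst (1 ≤_) (sym (cell≡suc (block I J) (rot I J) x y)) (s≤s z≤n) , (begin
      block I J * (q * q) + L′ (rot I J) x y ≤⟨ +-mono-≤ (*-monoˡ-≤ (q * q) (s≤s⁻¹ (block<16 I J))) (L′≤q*q (rot I J) x<q y<q) ⟩
      15 * (q * q) + q * q                   ≡⟨ +-comm (15 * (q * q)) (q * q) ⟩
      16 * (q * q)                           ∎)
    where open ≤-Reasoning

  -- W at the 0-based indices of u_{b+1} (row) and v_{a+1} (column)
  W′ : Fin (4 * q) → Fin (4 * q) → ℕ
  W′ b a = W q (toℕ b + 1) (toℕ a + 1)

  W′-range : ∀ b a → 1 ≤ W′ b a × W′ b a ≤ 16 * (q * q)
  W′-range b a with blockView q b | blockView q a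
  ... | at I x | at J y rewrite W-combine I J x y = entry-range I J (FP.toℕ<n x) (FP.toℕ<n y)

  W′-injective : ∀ b a b′ a′ → W′ b a ≡ W′ b′ a′ → b ≡ b′ × a ≡ a′
  W′-injective b a b′ a′ e with blockView q b | blockView q a | blockView q b′ | blockView q a′
  ... | at I x | at J y | at I′ x′ | at J′ y′ =
    let eI , eJ , ex , ey = entry-injective {I} {J} {I′} {J′} (FP.toℕ<n x) (FP.toℕ<n y) (FP.toℕ<n x′) (FP.toℕ<n y′)
                              (trans (sym (W-combine I J x y)) (trans e (W-combine I′ J′ x′ y′)))
    in cong₂ combine eI (FP.toℕ-injective ex) , cong₂ combine eJ (FP.toℕ-injective ey)

  W′-onto : ∀ w → 1 ≤ w → w ≤ 16 * (q * q) → ∃[ b ] ∃[ a ] (W′ b a ≡ w)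
  W′-onto w w≥1 w≤ =
    let z , _ , hit = injective-onto (16 * (q * q)) (λ _ → true) f (λ _ → true) f-bounded (λ _ _ → refl) f-injective sizes
                        (w ∸ 1) (≤-trans (≤-reflexive (trans (+-comm 1 _) (m∸n+n≡m w≥1))) w≤) refl
        b , a = pair z
    in b , a , trans (sym (m∸n+n≡m (proj₁ (W′-range b a)))) (trans (cong (_+ 1) hit) (trans (+-comm _ 1) (m+[n∸m]≡n w≥1)))
    where
    pair : Fin ((4 * q) * (4 * q)) → Fin (4 * q) × Fin (4 * q)
    pair = remQuot (4 * q)
    f : Fin ((4 * q) * (4 * q)) → ℕ
    f z = W′ (proj₁ (pair z)) (proj₂ (pair z)) ∸ 1
    f-bounded : ∀ z → true ≡ true → f z < 16 * (q * q)
    f-bounded z _ with W′-range (proj₁ (pair z)) (proj₂ (pair z))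
    ... | l , u = ≤-trans (≤-reflexive (trans (+-comm 1 _) (m∸n+n≡m l))) u
    f-injective : ∀ j k → true ≡ true → true ≡ true → f j ≡ f k → j ≡ k
    f-injective j k _ _ e with W′-injective (proj₁ (pair j)) (proj₂ (pair j)) (proj₁ (pair k)) (proj₂ (pair k))
                                (∸-cancelʳ-≡ (proj₁ (W′-range (proj₁ (pair j)) (proj₂ (pair j)))) (proj₁ (W′-range (proj₁ (pair k)) (proj₂ (pair k)))) e)
    ... | eb , ea = trans (sym (FP.combine-remQuot {4 * q} (4 * q) j)) (trans (cong₂ combine eb ea) (FP.combine-remQuot {4 * q} (4 * q) k))
    sizes : count {(4 * q) * (4 * q)} (λ _ → true) ≡ sumN (16 * (q * q)) (λ _ → 1)
    sizes = trans (sumF-const ((4 * q) * (4 * q)) 1) (trans (size-identity q) (sym (sumN-const (16 * (q * q)) 1)))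
      where
      size-identity : ∀ q → (4 * q) * (4 * q) * 1 ≡ 16 * (q * q) * 1
      size-identity = solve-∀

  nH : ℕ
  nH = 8 * q * q ∸ 4 * q

  -- T labels u_{b+1} v_{a+1} by crossLabel (W′ b a)
  crossLabel : ℕ → ℕ
  crossLabel w = if w ≤ᵇ 8 * q * q then w + nH else w + 8 * q * q

  shift : ℕ → ℕ
  shift b = if b ≤ᵇ 7 then nH else 8 * q * q

  cell-low : ∀ b r {x y} → x < q → y < q → (cell b r x y ≤ᵇ 8 * q * q) ≡ (b ≤ᵇ 7)
  cell-low b r {x} {y} x<q y<q with b ≤ᵇ 7 in e
  ... | true  = ≤ᵇ-complete (begin
      b * (q * q) + L′ r x y ≤⟨ +-mono-≤ (*-monoˡ-≤ (q * q) (≤ᵇ-sound b 7 e)) (L′≤q*q r x<q y<q) ⟩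
      7 * (q * q) + q * q    ≡⟨ trans (+-comm (7 * (q * q)) (q * q)) (sym (*-assoc 8 q q)) ⟩
      8 * q * q              ∎)
    where open ≤-Reasoning
  ... | false = >⇒≤ᵇ-false (begin-strict
      8 * q * q              ≡⟨ *-assoc 8 q q ⟩
      8 * (q * q)            ≤⟨ *-monoˡ-≤ (q * q) (≤ᵇ-false⇒> b 7 e) ⟩
      b * (q * q)            <⟨ m<m+n (b * (q * q)) (subst (0 <_) (sym (L′≡suc r x y)) z<s) ⟩
      b * (q * q) + L′ r x y ∎)
    where open ≤-Reasoning

  crossLabel-cell : ∀ b r {x y} → x < q → y < q → crossLabel (cell b r x y) ≡ cell b r x y + shift b
  crossLabel-cell b r x<q y<q rewrite cell-low b r x<q y<q with b ≤ᵇ 7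
  ... | true  = refl
  ... | false = refl

  lineTotal : ℕ
  lineTotal = 48 * (q * q) + 2 * nH + 2

  L′-sum : ∀ {x y} → x < q → y < q → sumN 4 (λ r → L′ r x y) ≡ 2 * (q * q) + 2
  L′-sum {x} {y} x<q y<q = trans (collect q x y (rev x) (rev y)) (square (x + rev x) (y + rev y) (suc+rev x<q) (suc+rev y<q))
    where
    collect : ∀ q x y a b → q * x + (y + 1) + (q * b + (x + 1) + (q * a + (b + 1) + (q * y + (a + 1) + 0)))
                            ≡ q * ((x + a) + (y + b)) + ((x + a) + (y + b)) + 4
    collect = solve-∀
    square-identity : ∀ s → suc s * (s + s) + (s + s) + 4 ≡ 2 * (suc s * suc s) + 2
    square-identity = solve-∀
    square : ∀ s t → suc s ≡ q → suc t ≡ q → q * (s + t) + (s + t) + 4 ≡ 2 * (q * q) + 2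
    square s .s refl refl = square-identity s

  -- Along a line the block offsets sum to 30 q², the rotations contribute each
  -- L^r once, and two of the four blocks are shifted by nH, two by 8q².
  line-total : ∀ {b r} → Line b r → ∀ {x y} → x < q → y < q →
    sumF (λ L → crossLabel (cell (b L) (r L) x y)) ≡ lineTotal
  line-total {b} {r} (line sum≡30 lows highs r<4 r-injective r-at) {x} {y} x<q y<q = begin
    sumF (λ L → crossLabel (cell (b L) (r L) x y))
      ≡⟨ sumF-cong (λ L → crossLabel-cell (b L) (r L) x<q y<q) ⟩
    sumF (λ L → b L * (q * q) + L′ (r L) x y + shift (b L))
      ≡⟨ trans (sumF-+ (λ L → b L * (q * q) + L′ (r L) x y) (shift ∘ b)) (cong (_+ sumF (shift ∘ b)) (sumF-+ (λ L → b L * (q * q)) (λ L → L′ (r L) x y))) ⟩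
    sumF (λ L → b L * (q * q)) + sumF (λ L → L′ (r L) x y) + sumF (shift ∘ b)
      ≡⟨ cong₂ (λ u v → u + v + sumF (shift ∘ b)) (trans (sumF-*ʳ (q * q) b) (cong (_* (q * q)) sum≡30)) rotations ⟩
    30 * (q * q) + (2 * (q * q) + 2) + sumF (shift ∘ b)
      ≡⟨ cong (30 * (q * q) + (2 * (q * q) + 2) +_) (trans (sumF-if (λ L → b L ≤ᵇ 7) nH (8 * q * q)) (cong₂ (λ u v → u * nH + v * (8 * q * q)) lows highs)) ⟩
    30 * (q * q) + (2 * (q * q) + 2) + (2 * nH + 2 * (8 * q * q))
      ≡⟨ total q nH ⟩
    lineTotal ∎
    where
    open ≡-Reasoning
    rotations : sumF (λ L → L′ (r L) x y) ≡ 2 * (q * q) + 2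
    rotations = trans (sumF-bijective 4 (λ _ → true) r (λ _ → true) (λ s → L′ s x y) (λ L _ → r<4 L) (λ _ _ → refl)
                        (λ L L′ _ _ → r-injective L L′)
                        (λ s s<4 _ → let L , e = r-at (fromℕ< s<4) in L , refl , trans e (FP.toℕ-fromℕ< s<4)))
                      (L′-sum x<q y<q)
    total : ∀ q h → 30 * (q * q) + (2 * (q * q) + 2) + (2 * h + 2 * (8 * q * q)) ≡ 48 * (q * q) + 2 * h + 2
    total = solve-∀

  line-low : ∀ {b r} → Line b r → ∀ {x y} → x < q → y < q →
    count (λ L → cell (b L) (r L) x y ≤ᵇ 8 * q * q) ≡ 2
  line-low {b} {r} ln x<q y<q = trans (sumF-cong (λ L → cong ind (cell-low (b L) (r L) x<q y<q))) (Line.lows≡2 ln)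

  line-high : ∀ {b r} → Line b r → ∀ {x y} → x < q → y < q →
    count (λ L → not (cell (b L) (r L) x y ≤ᵇ 8 * q * q)) ≡ 2
  line-high {b} {r} ln x<q y<q = trans (sumF-cong (λ L → cong (ind ∘ not) (cell-low (b L) (r L) x<q y<q))) (Line.highs≡2 ln)

  W′-row-sum : ∀ (g : ℕ → ℕ) c → (∀ I {x y} → x < q → y < q → sumF (λ J → g (entry I J x y)) ≡ c) →
    ∀ b → sumF (λ a → g (W′ b a)) ≡ q * c
  W′-row-sum g c per-line b with blockView q b
  ... | at I x = begin
    sumF (λ a → g (W′ (combine I x) a))                                    ≡⟨ sumF-combine 4 q (λ a → g (W′ (combine I x) a)) ⟩
    sumF {4} (λ J → sumF {q} (λ y → g (W′ (combine I x) (combine J y))))           ≡⟨ sumF-comm 4 q (λ J (y : Fin q) → g (W′ (combine I x) (combine J y))) ⟩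
    sumF {q} (λ y → sumF {4} (λ J → g (W′ (combine I x) (combine J y))))           ≡⟨ sumF-cong (λ y → trans (sumF-cong (λ J → cong g (W-combine I J x y))) (per-line I (FP.toℕ<n x) (FP.toℕ<n y))) ⟩
    sumF {q} (λ _ → c)                                                     ≡⟨ sumF-const q c ⟩
    q * c                                                                  ∎
    where open ≡-Reasoning

  W′-column-sum : ∀ (g : ℕ → ℕ) c → (∀ J {x y} → x < q → y < q → sumF (λ I → g (entry I J x y)) ≡ c) →
    ∀ a → sumF (λ b → g (W′ b a)) ≡ q * c
  W′-column-sum g c per-line a with blockView q a
  ... | at J y = begin
    sumF (λ b → g (W′ b (combine J y)))                                    ≡⟨ sumF-combine 4 q (λ b → g (W′ b (combine J y))) ⟩
    sumF {4} (λ I → sumF {q} (λ x → g (W′ (combine I x) (combine J y))))           ≡⟨ sumF-comm 4 q (λ I (x : Fin q) → g (W′ (combine I x) (combine J y))) ⟩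
    sumF {q} (λ x → sumF {4} (λ I → g (W′ (combine I x) (combine J y))))           ≡⟨ sumF-cong (λ x → trans (sumF-cong (λ I → cong g (W-combine I J x y))) (per-line J (FP.toℕ<n x) (FP.toℕ<n y))) ⟩
    sumF {q} (λ _ → c)                                                     ≡⟨ sumF-const q c ⟩
    q * c                                                                  ∎
    where open ≡-Reasoning

  runStart : ℕ → ℕ → ℕ
  runStart b t = b * (q * q) + q * t + shift b + 1

  cell-run : ∀ b r {x y} → x < q → y < q → crossLabel (cell b r x y) ≡ runStart b (lrow r x y) + lcol r x y
  cell-run b r {x} {y} x<q y<q = trans (crossLabel-cell b r x<q y<q) (shape b (q * q) q (lrow r x y) (lcol r x y) (shift b))
    where
    shape : ∀ b Q q t c s → b * Q + (q * t + (c + 1)) + s ≡ b * Q + q * t + s + 1 + c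
    shape = solve-∀

  shift-mono : ∀ {b b′} → b ≤ b′ → shift b ≤ shift b′
  shift-mono {b} {b′} b≤b′ with b ≤ᵇ 7 in e | b′ ≤ᵇ 7 in e′
  ... | true  | true  = ≤-refl
  ... | true  | false = m∸n≤m (8 * q * q) (4 * q)
  ... | false | false = ≤-refl
  ... | false | true  = ⊥-elim (<⇒≱ (≤ᵇ-false⇒> b 7 e) (≤-trans b≤b′ (≤ᵇ-sound b′ 7 e′)))

  runStart-gap : ∀ {b b′} t t′ → b < b′ → t < q → runStart b t + q ≤ runStart b′ t′
  runStart-gap {b} {b′} t t′ b<b′ t<q = begin
      runStart b t + q                          ≡⟨ shape b (q * q) q t (shift b) ⟩
      b * (q * q) + q * suc t + shift b + 1     ≤⟨ +-monoˡ-≤ 1 (+-monoˡ-≤ (shift b) (+-monoʳ-≤ (b * (q * q)) (*-monoʳ-≤ q t<q))) ⟩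
      b * (q * q) + q * q + shift b + 1         ≡⟨ cong (λ z → z + shift b + 1) (+-comm (b * (q * q)) (q * q)) ⟩
      suc b * (q * q) + shift b + 1             ≤⟨ +-monoˡ-≤ 1 (+-mono-≤ (*-monoˡ-≤ (q * q) b<b′) (shift-mono (<⇒≤ b<b′))) ⟩
      b′ * (q * q) + shift b′ + 1               ≤⟨ +-monoˡ-≤ 1 (+-monoˡ-≤ (shift b′) (m≤m+n (b′ * (q * q)) (q * t′))) ⟩
      runStart b′ t′                            ∎
    where
    open ≤-Reasoning
    shape : ∀ b Q q t s → b * Q + q * t + s + 1 + q ≡ b * Q + q * suc t + s + 1
    shape = solve-∀

  runs-disjoint : ∀ {b b′ t t′} → b ≢ b′ → t < q → t′ < q → Disjoint1AP (runStart b t , q) (runStart b′ t′ , q)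
  runs-disjoint {b} {b′} {t} {t′} b≢b′ t<q t′<q with <-cmp b b′
  ... | tri< b<b′ _ _ = inj₁ (runStart-gap t t′ b<b′ t<q)
  ... | tri≈ _ b≡b′ _ = ⊥-elim (b≢b′ b≡b′)
  ... | tri> _ _ b′<b = inj₂ (runStart-gap t′ t b′<b t′<q)

  ColumnHit RowHit : Fin (4 * q) → ℕ → Set
  ColumnHit a ℓ = ∃[ b ] crossLabel (W′ b a) ≡ ℓ
  RowHit    b ℓ = ∃[ a ] crossLabel (W′ b a) ≡ ℓ

  W′-run : ∀ I J (x y : Fin q) →
    crossLabel (W′ (combine I x) (combine J y)) ≡ runStart (block I J) (lrow (rot I J) (toℕ x) (toℕ y)) + lcol (rot I J) (toℕ x) (toℕ y)
  W′-run I J x y = trans (cong crossLabel (W-combine I J x y)) (cell-run (block I J) (rot I J) (FP.toℕ<n x) (FP.toℕ<n y))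

  distinct-blocks : ∀ I J I′ J′ {r r′} → rot I J ≡ r → rot I′ J′ ≡ r′ → r ≢ r′ → block I J ≢ block I′ J′
  distinct-blocks I J I′ J′ e e′ r≢r′ same with block-injective I J I′ J′ same
  ... | eI , eJ = r≢r′ (trans (sym e) (trans (cong₂ rot eI eJ) e′))

  -- In column (J, y) the blocks with rotation 1 and 3 are runs, read top-down
  -- and bottom-up respectively; in row (I, x) the blocks with rotation 0 and 2.
  column-runs : ∀ a → TwoRuns q (ColumnHit a)
  column-runs a with blockView q a
  ... | at J y with Line.rotation-at (column-line J) (# 1) | Line.rotation-at (column-line J) (# 3)
  ... | I₁ , rot₁ | I₃ , rot₃ = record
    { start₁ = runStart (block I₁ J) (rev (toℕ y)) ; start₂ = runStart (block I₃ J) (toℕ y)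
    ; run₁ = λ d d<q → combine I₁ (fromℕ< d<q) , hit₁ d d<q
    ; run₂ = λ d d<q → combine I₃ (fromℕ< (rev< d<q)) , hit₃ d d<q
    ; disjoint = runs-disjoint (distinct-blocks I₁ J I₃ J rot₁ rot₃ λ ()) (rev< (FP.toℕ<n y)) (FP.toℕ<n y) }
    where
    hit₁ : ∀ d (d<q : d < q) → crossLabel (W′ (combine I₁ (fromℕ< d<q)) (combine J y)) ≡ runStart (block I₁ J) (rev (toℕ y)) + d
    hit₁ d d<q rewrite W′-run I₁ J (fromℕ< d<q) y | rot₁ | FP.toℕ-fromℕ< d<q = refl
    hit₃ : ∀ d (d<q : d < q) → crossLabel (W′ (combine I₃ (fromℕ< (rev< d<q))) (combine J y)) ≡ runStart (block I₃ J) (toℕ y) + d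
    hit₃ d d<q rewrite W′-run I₃ J (fromℕ< (rev< d<q)) y | rot₃ | FP.toℕ-fromℕ< (rev< d<q) | rev-involutive d<q = refl

  row-runs : ∀ b → TwoRuns q (RowHit b)
  row-runs b with blockView q b
  ... | at I x with Line.rotation-at (row-line I) (# 0) | Line.rotation-at (row-line I) (# 2)
  ... | J₀ , rot₀ | J₂ , rot₂ = record
    { start₁ = runStart (block I J₀) (toℕ x) ; start₂ = runStart (block I J₂) (rev (toℕ x))
    ; run₁ = λ d d<q → combine J₀ (fromℕ< d<q) , hit₀ d d<q
    ; run₂ = λ d d<q → combine J₂ (fromℕ< (rev< d<q)) , hit₂ d d<q
    ; disjoint = runs-disjoint (distinct-blocks I J₀ I J₂ rot₀ rot₂ λ ()) (FP.toℕ<n x) (rev< (FP.toℕ<n x)) }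
    where
    hit₀ : ∀ d (d<q : d < q) → crossLabel (W′ (combine I x) (combine J₀ (fromℕ< d<q))) ≡ runStart (block I J₀) (toℕ x) + d
    hit₀ d d<q rewrite W′-run I J₀ x (fromℕ< d<q) | rot₀ | FP.toℕ-fromℕ< d<q = refl
    hit₂ : ∀ d (d<q : d < q) → crossLabel (W′ (combine I x) (combine J₂ (fromℕ< (rev< d<q)))) ≡ runStart (block I J₂) (rev (toℕ x)) + d
    hit₂ d d<q rewrite W′-run I J₂ x (fromℕ< (rev< d<q)) | rot₂ | FP.toℕ-fromℕ< (rev< d<q) | rev-involutive d<q = refl

-- The labeling T of K_{8q}

2*[nC2]≡n*[n-1] : ∀ n → 2 * (n Cb 2) ≡ n * (n ∸ 1)
2*[nC2]≡n*[n-1] zero    = refl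
2*[nC2]≡n*[n-1] (suc n) = begin
  2 * (suc n Cb 2)          ≡⟨ cong (2 *_) (sym (nCk+nC[k+1]≡[n+1]C[k+1] n 1)) ⟩
  2 * (n Cb 1 + n Cb 2)     ≡⟨ cong (λ z → 2 * (z + n Cb 2)) (nC1≡n n) ⟩
  2 * (n + n Cb 2)          ≡⟨ *-distribˡ-+ 2 n (n Cb 2) ⟩
  2 * n + 2 * (n Cb 2)      ≡⟨ cong (2 * n +_) (2*[nC2]≡n*[n-1] n) ⟩
  2 * n + n * (n ∸ 1)       ≡⟨ step n ⟩
  suc n * n                 ∎
  where
  open ≡-Reasoning
  step : ∀ n → 2 * n + n * (n ∸ 1) ≡ suc n * n
  step zero    = refl
  step (suc n) = shape n
    where
    shape : ∀ n → 2 * suc n + suc n * n ≡ suc (suc n) * suc n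
    shape = solve-∀

-- nH = |E(H)| is the number of labels of t₀, the matching G₃ gets lo + 1, …, lo + 4q, and
-- deg is the degree of F₁ and F₂; identities involving ∸ are proved after adding 4q.
module Sizes (q : ℕ) (q≥1 : 1 ≤ q) where

  nH lo deg E : ℕ
  nH  = 8 * q * q ∸ 4 * q
  lo  = 16 * q * q ∸ 4 * q
  deg = 2 * q ∸ 1
  E   = ε (4 * q + 4 * q)

  4q≤8q² : 4 * q ≤ 8 * q * q
  4q≤8q² = subst₂ _≤_ (*-identityʳ (4 * q)) (shape q) (*-monoʳ-≤ (4 * q) (≤-trans q≥1 (m≤m+n q (q + 0))))
    where
    shape : ∀ q → 4 * q * (2 * q) ≡ 8 * q * q
    shape = solve-∀

  nH+4q≡8q² : nH + 4 * q ≡ 8 * q * q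
  nH+4q≡8q² = m∸n+n≡m 4q≤8q²

  lo+4q≡16q² : lo + 4 * q ≡ 16 * q * q
  lo+4q≡16q² = m∸n+n≡m (≤-trans 4q≤8q² (subst (8 * q * q ≤_) (shape q) (m≤m+n _ _)))
    where
    shape : ∀ q → 8 * q * q + 8 * q * q ≡ 16 * q * q
    shape = solve-∀

  deg+1≡2q : deg + 1 ≡ 2 * q
  deg+1≡2q = m∸n+n≡m (≤-trans q≥1 (m≤m+n q (q + 0)))

  E+4q≡32q² : E + 4 * q ≡ 32 * q * q
  E+4q≡32q² = *-cancelˡ-≡ _ _ 2 (begin
    2 * (E + 4 * q)                                       ≡⟨ *-distribˡ-+ 2 E (4 * q) ⟩
    2 * E + 2 * (4 * q)                                   ≡⟨ cong (_+ 2 * (4 * q)) (2*[nC2]≡n*[n-1] (4 * q + 4 * q)) ⟩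
    (4 * q + 4 * q) * (4 * q + 4 * q ∸ 1) + 2 * (4 * q)   ≡⟨ cong ((4 * q + 4 * q) * (4 * q + 4 * q ∸ 1) +_) (shape′ q) ⟩
    (4 * q + 4 * q) * (4 * q + 4 * q ∸ 1) + (4 * q + 4 * q) * 1 ≡⟨ trans (sym (*-distribˡ-+ (4 * q + 4 * q) _ 1)) (cong ((4 * q + 4 * q) *_) (m∸n+n≡m 8q≥1)) ⟩
    (4 * q + 4 * q) * (4 * q + 4 * q)                     ≡⟨ shape q ⟩
    2 * (32 * q * q)                                      ∎)
    where
    open ≡-Reasoning
    8q≥1 : 1 ≤ 4 * q + 4 * q
    8q≥1 = ≤-trans q≥1 (≤-trans (m≤m+n q (3 * q)) (m≤m+n (4 * q) (4 * q)))
    shape : ∀ q → (4 * q + 4 * q) * (4 * q + 4 * q) ≡ 2 * (32 * q * q)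
    shape = solve-∀
    shape′ : ∀ q → 2 * (4 * q) ≡ (4 * q + 4 * q) * 1
    shape′ = solve-∀

  cancel-4q : ∀ {a b} → a + 4 * q ≡ b + 4 * q → a ≡ b
  cancel-4q {a} {b} = +-cancelʳ-≡ (4 * q) a b

  nH+8q²≡lo : nH + 8 * q * q ≡ lo
  nH+8q²≡lo = cancel-4q (begin
    nH + 8 * q * q + 4 * q     ≡⟨ x∙yz≈yx∙z′ ⟩
    nH + 4 * q + 8 * q * q     ≡⟨ cong (_+ 8 * q * q) nH+4q≡8q² ⟩
    8 * q * q + 8 * q * q      ≡⟨ shape q ⟩
    16 * q * q                 ≡⟨ sym lo+4q≡16q² ⟩
    lo + 4 * q                 ∎)
    where
    open ≡-Reasoning
    x∙yz≈yx∙z′ : nH + 8 * q * q + 4 * q ≡ nH + 4 * q + 8 * q * q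
    x∙yz≈yx∙z′ = trans (+-assoc nH _ _) (trans (cong (nH +_) (+-comm (8 * q * q) (4 * q))) (sym (+-assoc nH _ _)))
    shape : ∀ q → 8 * q * q + 8 * q * q ≡ 16 * q * q
    shape = solve-∀

  24q²+nH≡E : 24 * q * q + nH ≡ E
  24q²+nH≡E = cancel-4q (begin
    24 * q * q + nH + 4 * q    ≡⟨ +-assoc (24 * q * q) nH (4 * q) ⟩
    24 * q * q + (nH + 4 * q)  ≡⟨ cong (24 * q * q +_) nH+4q≡8q² ⟩
    24 * q * q + 8 * q * q     ≡⟨ shape q ⟩
    32 * q * q                 ≡⟨ sym E+4q≡32q² ⟩
    E + 4 * q                  ∎)
    where
    open ≡-Reasoning
    shape : ∀ q → 24 * q * q + 8 * q * q ≡ 32 * q * q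
    shape = solve-∀

  E≡2lo+4q : E ≡ 2 * lo + 4 * q
  E≡2lo+4q = cancel-4q (begin
    E + 4 * q                  ≡⟨ E+4q≡32q² ⟩
    32 * q * q                 ≡⟨ shape q ⟩
    2 * (16 * q * q)           ≡⟨ cong (2 *_) (sym lo+4q≡16q²) ⟩
    2 * (lo + 4 * q)           ≡⟨ shape′ lo q ⟩
    2 * lo + 4 * q + 4 * q     ∎)
    where
    open ≡-Reasoning
    shape : ∀ q → 32 * q * q ≡ 2 * (16 * q * q)
    shape = solve-∀
    shape′ : ∀ l q → 2 * (l + 4 * q) ≡ 2 * l + 4 * q + 4 * q
    shape′ = solve-∀

  nH≡4q*deg : nH ≡ 4 * q * deg
  nH≡4q*deg = cancel-4q (begin
    nH + 4 * q                 ≡⟨ nH+4q≡8q² ⟩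
    8 * q * q                  ≡⟨ shape q ⟩
    4 * q * (2 * q)            ≡⟨ cong (4 * q *_) (sym deg+1≡2q) ⟩
    4 * q * (deg + 1)          ≡⟨ shape′ q deg ⟩
    4 * q * deg + 4 * q        ∎)
    where
    open ≡-Reasoning
    shape : ∀ q → 8 * q * q ≡ 4 * q * (2 * q)
    shape = solve-∀
    shape′ : ∀ q d → 4 * q * (d + 1) ≡ 4 * q * d + 4 * q
    shape′ = solve-∀

  16q²+8q²≡24q² : 16 * q * q + 8 * q * q ≡ 24 * q * q
  16q²+8q²≡24q² = shape q
    where
    shape : ∀ q → 16 * q * q + 8 * q * q ≡ 24 * q * q
    shape = solve-∀

  8q²+8q²≡16q² : 8 * q * q + 8 * q * q ≡ 16 * q * q
  8q²+8q²≡16q² = shape q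
    where
    shape : ∀ q → 8 * q * q + 8 * q * q ≡ 16 * q * q
    shape = solve-∀

  nH≤lo : nH ≤ lo
  nH≤lo = subst (nH ≤_) nH+8q²≡lo (m≤m+n nH _)

  lo≤16q² : lo ≤ 16 * q * q
  lo≤16q² = subst (lo ≤_) lo+4q≡16q² (m≤m+n lo _)

  16q²≤24q² : 16 * q * q ≤ 24 * q * q
  16q²≤24q² = subst (16 * q * q ≤_) 16q²+8q²≡24q² (m≤m+n _ _)

  24q²≤E : 24 * q * q ≤ E
  24q²≤E = subst (24 * q * q ≤_) 24q²+nH≡E (m≤m+n _ _)

mate : ℕ → ℕ
mate t = 2 * (t / 2) + (1 ∸ t % 2)

t≡2*[t/2]+t%2 : ∀ t → t ≡ 2 * (t / 2) + t % 2
t≡2*[t/2]+t%2 t = trans (m≡m%n+[m/n]*n t 2) (trans (+-comm (t % 2) _) (cong (_+ t % 2) (*-comm (t / 2) 2)))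

t%2≡0⊎1 : ∀ t → t % 2 ≡ 0 ⊎ t % 2 ≡ 1
t%2≡0⊎1 t with t % 2 | m%n<n t 2
... | 0 | _ = inj₁ refl
... | 1 | _ = inj₂ refl
... | suc (suc _) | s≤s (s≤s ())

1∸t%2<2 : ∀ t → 1 ∸ t % 2 < 2
1∸t%2<2 t = s≤s (m∸n≤m 1 (t % 2))

mate/2 : ∀ t → mate t / 2 ≡ t / 2
mate/2 t = [n*a+b]/n≡a 2 (t / 2) (1 ∸ t % 2) (1∸t%2<2 t)

mate≢ : ∀ t → mate t ≢ t
mate≢ t e = flips (t%2≡0⊎1 t) (trans (sym ([n*a+b]%n≡b 2 (t / 2) (1 ∸ t % 2) (1∸t%2<2 t))) (cong (_% 2) e))
  where
  flips : t % 2 ≡ 0 ⊎ t % 2 ≡ 1 → 1 ∸ t % 2 ≢ t % 2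
  flips (inj₁ b) e rewrite b with () ← e
  flips (inj₂ b) e rewrite b with () ← e

mate-unique : ∀ s t → s / 2 ≡ t / 2 → s ≢ t → s ≡ mate t
mate-unique s t same-pair s≢t = trans (t≡2*[t/2]+t%2 s) (cong₂ (λ u v → 2 * u + v) same-pair (other (t%2≡0⊎1 s) (t%2≡0⊎1 t)))
  where
  same-bit : s % 2 ≡ t % 2 → ⊥
  same-bit e = s≢t (trans (t≡2*[t/2]+t%2 s) (trans (cong₂ (λ u v → 2 * u + v) same-pair e) (sym (t≡2*[t/2]+t%2 t))))
  other : s % 2 ≡ 0 ⊎ s % 2 ≡ 1 → t % 2 ≡ 0 ⊎ t % 2 ≡ 1 → s % 2 ≡ 1 ∸ t % 2
  other (inj₁ a) (inj₂ b) = trans a (sym (cong (1 ∸_) b))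
  other (inj₂ a) (inj₁ b) = trans a (sym (cong (1 ∸_) b))
  other (inj₁ a) (inj₁ b) = ⊥-elim (same-bit (trans a (sym b)))
  other (inj₂ a) (inj₂ b) = ⊥-elim (same-bit (trans a (sym b)))

mate< : ∀ t m → t < 2 * m → mate t < 2 * m
mate< t m t<2m = begin-strict
    2 * (t / 2) + (1 ∸ t % 2) <⟨ +-monoʳ-< (2 * (t / 2)) (1∸t%2<2 t) ⟩
    2 * (t / 2) + 2           ≡⟨ trans (+-comm _ 2) (sym (*-suc 2 (t / 2))) ⟩
    2 * suc (t / 2)           ≤⟨ *-monoʳ-≤ 2 (m<n*o⇒m/o<n {t} {m} {2} (subst (t <_) (*-comm 2 m) t<2m)) ⟩
    2 * m                     ∎
  where open ≤-Reasoning

mate-2+ : ∀ t → mate (2 + t) ≡ 2 + mate t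
mate-2+ t = trans (cong₂ (λ u v → 2 * u + (1 ∸ v)) ([2+t]/2≡1+t/2 t) (trans (cong (_% 2) (+-comm 2 t)) ([m+n]%n≡m%n t 2)))
                  (shape (t / 2) (1 ∸ t % 2))
  where
  shape : ∀ a b → 2 * suc a + b ≡ 2 + (2 * a + b)
  shape = solve-∀

count-below-mate : ∀ m → sumN (m + m) (λ t → ind (t <ᵇ mate t)) ≡ m
count-below-mate zero    = refl
count-below-mate (suc m) = trans (cong (λ n → sumN n (λ t → ind (t <ᵇ mate t))) (cong suc (+-suc m m)))
  (cong suc (trans (sumN-cong (m + m) (λ t _ → cong (λ z → ind ((2 + t) <ᵇ z)) (mate-2+ t))) (count-below-mate m)))

module Labeling (q : ℕ) (hq : 2 ≤ q) (C : Choices q) where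
  open Choices C

  q≥1 : 1 ≤ q
  q≥1 = ≤-trans (s≤s z≤n) hq

  instance
    q≢0 : NonZero q
    q≢0 = >-nonZero q≥1

  open Sizes q q≥1 public hiding (nH)
  open WeavingSquare q public

  n8 : ℕ
  n8 = 4 * q + 4 * q

  Tq : Fin n8 → Fin n8 → ℕ
  Tq = T q hq C

  V U : Fin (4 * q) → Fin n8
  V a = a ↑ˡ (4 * q)
  U b = (4 * q) ↑ʳ b

  data Vertex : Fin n8 → Set where
    isV : ∀ a → Vertex (V a)
    isU : ∀ b → Vertex (U b)

  vertex : ∀ x → Vertex x
  vertex x with splitAt (4 * q) x in e
  ... | inj₁ a = subst Vertex (FP.splitAt⁻¹-↑ˡ e) (isV a)
  ... | inj₂ b = subst Vertex (FP.splitAt⁻¹-↑ʳ e) (isU b)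

  V-injective : ∀ {a b} → V a ≡ V b → a ≡ b
  V-injective = FP.↑ˡ-injective (4 * q) _ _

  U-injective : ∀ {a b} → U a ≡ U b → a ≡ b
  U-injective = FP.↑ʳ-injective (4 * q) _ _

  V≢U : ∀ a b → V a ≢ U b
  V≢U a b e = <⇒≱ (subst (_< 4 * q) (sym (FP.toℕ-↑ˡ a (4 * q))) (FP.toℕ<n a))
                  (subst (4 * q ≤_) (trans (sym (FP.toℕ-↑ʳ (4 * q) b)) (cong toℕ (sym e))) (m≤m+n (4 * q) (toℕ b)))

  Kedge-VU : ∀ a b → Kedge (V a) (U b) ≡ true
  Kedge-VU a b = ≢⇒Kedge (V≢U a b)

  Kedge-UV : ∀ b a → Kedge (U b) (V a) ≡ true
  Kedge-UV b a = ≢⇒Kedge (V≢U a b ∘ sym)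

  Tq-VV : ∀ a b → Tq (V a) (V b) ≡ (if Hedge q a b then (if F1 a b then t0 a b else t0 a b + 24 * q * q) else lo + ord (V a) (V b))
  Tq-VV a b rewrite FP.splitAt-↑ˡ (4 * q) a (4 * q) | FP.splitAt-↑ˡ (4 * q) b (4 * q) = refl

  Tq-UU : ∀ a b → Tq (U a) (U b) ≡ (if Hedge q a b then (if F1 a b then t0 a b + 24 * q * q else t0 a b) else lo + ord (U a) (U b))
  Tq-UU a b rewrite FP.splitAt-↑ʳ (4 * q) (4 * q) a | FP.splitAt-↑ʳ (4 * q) (4 * q) b = refl

  Tq-VU : ∀ a b → Tq (V a) (U b) ≡ crossLabel (W′ b a)
  Tq-VU a b rewrite FP.splitAt-↑ˡ (4 * q) a (4 * q) | FP.splitAt-↑ʳ (4 * q) (4 * q) b = refl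

  Tq-UV : ∀ b a → Tq (U b) (V a) ≡ crossLabel (W′ b a)
  Tq-UV b a rewrite FP.splitAt-↑ˡ (4 * q) a (4 * q) | FP.splitAt-↑ʳ (4 * q) (4 * q) b = refl

  Hedge-sym : ∀ a b → Hedge q a b ≡ Hedge q b a
  Hedge-sym a b = cong not (≡ᵇ-sym (toℕ a / 2) (toℕ b / 2))
    where
    ≡ᵇ-sym : ∀ m n → (m ≡ᵇ n) ≡ (n ≡ᵇ m)
    ≡ᵇ-sym zero    zero    = refl
    ≡ᵇ-sym zero    (suc n) = refl
    ≡ᵇ-sym (suc m) zero    = refl
    ≡ᵇ-sym (suc m) (suc n) = ≡ᵇ-sym m n

  Hedge⇒≢ : ∀ {a b} → Hedge q a b ≡ true → a ≢ b
  Hedge⇒≢ {a} h refl with () ← trans (sym (cong not (≡ᵇ-refl (toℕ a / 2)))) h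

  4q≡2q*2 : 4 * q ≡ 2 * q * 2
  4q≡2q*2 = shape q
    where
    shape : ∀ q → 4 * q ≡ 2 * q * 2
    shape = solve-∀

  [4q+t]/2≡2q+t/2 : ∀ t → (4 * q + t) / 2 ≡ 2 * q + t / 2
  [4q+t]/2≡2q+t/2 t = trans (+-distrib-/-∣ˡ t (divides (2 * q) 4q≡2q*2)) (cong (_+ t / 2) (trans (cong (_/ 2) 4q≡2q*2) (m*n/n≡m (2 * q) 2)))

  a/2<2q : ∀ (a : Fin (4 * q)) → toℕ a / 2 < 2 * q
  a/2<2q a = m<n*o⇒m/o<n (subst (toℕ a <_) 4q≡2q*2 (FP.toℕ<n a))

  G3-VV : ∀ a b → G3 q (V a) (V b) ≡ Kedge (V a) (V b) ∧ not (Hedge q a b)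
  G3-VV a b rewrite FP.toℕ-↑ˡ a (4 * q) | FP.toℕ-↑ˡ b (4 * q) = cong (Kedge (V a) (V b) ∧_) (sym (not-involutive _))

  G3-UU : ∀ a b → G3 q (U a) (U b) ≡ Kedge (U a) (U b) ∧ not (Hedge q a b)
  G3-UU a b rewrite FP.toℕ-↑ʳ (4 * q) a | FP.toℕ-↑ʳ (4 * q) b | [4q+t]/2≡2q+t/2 (toℕ a) | [4q+t]/2≡2q+t/2 (toℕ b) =
    cong (Kedge (U a) (U b) ∧_) (trans (≡ᵇ-+ (2 * q) (toℕ a / 2) (toℕ b / 2)) (sym (not-involutive _)))
    where
    ≡ᵇ-+ : ∀ c m n → (c + m ≡ᵇ c + n) ≡ (m ≡ᵇ n)
    ≡ᵇ-+ zero    m n = refl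
    ≡ᵇ-+ (suc c) m n = ≡ᵇ-+ c m n

  G3-VU : ∀ a b → G3 q (V a) (U b) ≡ false
  G3-VU a b rewrite FP.toℕ-↑ˡ a (4 * q) | FP.toℕ-↑ʳ (4 * q) b | [4q+t]/2≡2q+t/2 (toℕ b)
                  | ≢⇒≡ᵇ-false {toℕ a / 2} {2 * q + toℕ b / 2} (λ e → <⇒≱ (a/2<2q a) (subst (2 * q ≤_) (sym e) (m≤m+n _ _))) =
    ∧-zeroʳ _

  G3-UV : ∀ b a → G3 q (U b) (V a) ≡ false
  G3-UV b a rewrite FP.toℕ-↑ˡ a (4 * q) | FP.toℕ-↑ʳ (4 * q) b | [4q+t]/2≡2q+t/2 (toℕ b)
                  | ≢⇒≡ᵇ-false {2 * q + toℕ b / 2} {toℕ a / 2} (λ e → <⇒≱ (a/2<2q a) (subst (2 * q ≤_) e (m≤m+n _ _))) =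
    ∧-zeroʳ _

  data Side : Set where
    v-side u-side : Side

  emb : Side → Fin (4 * q) → Fin n8
  emb v-side = V
  emb u-side = U

  emb-injective : ∀ s {a b} → emb s a ≡ emb s b → a ≡ b
  emb-injective v-side = V-injective
  emb-injective u-side = U-injective

  onSide : Side → Bool → Bool
  onSide v-side f = f
  onSide u-side f = not f

  onSide-injective : ∀ s s′ f → onSide s f ≡ onSide s′ f → s ≡ s′
  onSide-injective v-side v-side f     e = refl
  onSide-injective u-side u-side f     e = refl
  onSide-injective v-side u-side false ()
  onSide-injective v-side u-side true  ()
  onSide-injective u-side v-side false ()
  onSide-injective u-side v-side true  ()

  sideWith : Bool → Bool → Side
  sideWith true  true  = v-side
  sideWith true  false = u-side
  sideWith false true  = u-side
  sideWith false false = v-side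

  onSide-sideWith : ∀ l f → onSide (sideWith l f) f ≡ l
  onSide-sideWith true  true  = refl
  onSide-sideWith true  false = refl
  onSide-sideWith false true  = refl
  onSide-sideWith false false = refl

  -- the H-edge lies in F₁ (v-side) or in F₂′ (u-side), so it carries t₀ rather than t₀ + 24q²
  low : Side → Fin (4 * q) → Fin (4 * q) → Bool
  low s a b = onSide s (F1 a b)

  hLabel : Side → Fin (4 * q) → Fin (4 * q) → ℕ
  hLabel s a b = if low s a b then t0 a b else t0 a b + 24 * q * q

  Tq-H : ∀ s a b → Hedge q a b ≡ true → Tq (emb s a) (emb s b) ≡ hLabel s a b
  Tq-H v-side a b h rewrite Tq-VV a b | h = refl
  Tq-H u-side a b h rewrite Tq-UU a b | h with F1 a b
  ... | true  = refl
  ... | false = refl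

  G3-emb : ∀ s a b → G3 q (emb s a) (emb s b) ≡ Kedge (emb s a) (emb s b) ∧ not (Hedge q a b)
  G3-emb v-side = G3-VV
  G3-emb u-side = G3-UU

  Kedge-emb : ∀ s {a b} → Hedge q a b ≡ true → Kedge (emb s a) (emb s b) ≡ true
  Kedge-emb s h = ≢⇒Kedge (Hedge⇒≢ h ∘ emb-injective s)

  Tq-G3 : ∀ x y → G3 q x y ≡ true → Tq x y ≡ lo + ord x y
  Tq-G3 x y g with vertex x | vertex y
  ... | isV a | isU b with () ← trans (sym (G3-VU a b)) g
  ... | isU b | isV a with () ← trans (sym (G3-UV b a)) g
  ... | isV a | isV b with Hedge q a b in h
  ...   | false = trans (Tq-VV a b) (cong (λ z → if z then (if F1 a b then t0 a b else t0 a b + 24 * q * q) else lo + ord (V a) (V b)) h)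
  ...   | true with () ← trans (sym g) (trans (G3-VV a b) (trans (cong (λ z → Kedge (V a) (V b) ∧ not z) h) (∧-zeroʳ _)))
  Tq-G3 x y g | isU a | isU b with Hedge q a b in h
  ...   | false = trans (Tq-UU a b) (cong (λ z → if z then (if F1 a b then t0 a b + 24 * q * q else t0 a b) else lo + ord (U a) (U b)) h)
  ...   | true with () ← trans (sym g) (trans (G3-UU a b) (trans (cong (λ z → Kedge (U a) (U b) ∧ not z) h) (∧-zeroʳ _)))

  data EdgeClass (x y : Fin n8) : Set where
    h-edge : ∀ s a b → x ≡ emb s a → y ≡ emb s b → Hedge q a b ≡ true → EdgeClass x y
    m-edge : G3 q x y ≡ true → EdgeClass x y
    c-edge : ∀ a b → SameEdge x y (V a) (U b) → EdgeClass x y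

  classify : ∀ x y → Kedge x y ≡ true → EdgeClass x y
  classify x y K with vertex x | vertex y
  ... | isV a | isU b = c-edge a b (inj₁ (refl , refl))
  ... | isU b | isV a = c-edge a b (inj₂ (refl , refl))
  ... | isV a | isV b with Hedge q a b in h
  ...   | true  = h-edge v-side a b refl refl h
  ...   | false = m-edge (trans (G3-VV a b) (cong₂ (λ κ η → κ ∧ not η) K h))
  classify x y K | isU a | isU b with Hedge q a b in h
  ...   | true  = h-edge u-side a b refl refl h
  ...   | false = m-edge (trans (G3-UU a b) (cong₂ (λ κ η → κ ∧ not η) K h))

  t0-range : ∀ {a b} → Hedge q a b ≡ true → 1 ≤ t0 a b × t0 a b ≤ nH
  t0-range {a} {b} = proj₁ (proj₂ t0-lab) a b

  ord-range : ∀ {x y} → G3 q x y ≡ true → 1 ≤ ord x y × ord x y ≤ 4 * q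
  ord-range {x} {y} = proj₁ (proj₂ ord-lab) x y

  hLabel-range : ∀ s {a b} → Hedge q a b ≡ true →
    (1 ≤ hLabel s a b × hLabel s a b ≤ nH) ⊎ (24 * q * q < hLabel s a b × hLabel s a b ≤ E)
  hLabel-range s {a} {b} h with low s a b
  ... | true  = inj₁ (t0-range h)
  ... | false = inj₂ (+-monoˡ-≤ (24 * q * q) (proj₁ (t0-range h)) ,
                      subst (t0 a b + 24 * q * q ≤_) (trans (+-comm nH _) 24q²+nH≡E) (+-monoˡ-≤ (24 * q * q) (proj₂ (t0-range h))))

  mLabel-range : ∀ {x y} → G3 q x y ≡ true → lo < lo + ord x y × lo + ord x y ≤ 16 * q * q
  mLabel-range {x} {y} g = subst (_≤ lo + ord x y) (+-comm lo 1) (+-monoʳ-≤ lo (proj₁ (ord-range g))) ,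
                   ≤-trans (+-monoʳ-≤ lo (proj₂ (ord-range g))) (≤-reflexive lo+4q≡16q²)

  crossLabel-range : ∀ {w} → 1 ≤ w → w ≤ 16 * q * q →
    (nH < crossLabel w × crossLabel w ≤ lo) ⊎ (16 * q * q < crossLabel w × crossLabel w ≤ 24 * q * q)
  crossLabel-range {w} w≥1 w≤ with w ≤ᵇ 8 * q * q in e
  ... | true  = inj₁ (+-monoˡ-≤ nH w≥1 ,
                      ≤-trans (+-monoˡ-≤ nH (≤ᵇ-sound w _ e)) (≤-reflexive (trans (+-comm _ nH) nH+8q²≡lo)))
  ... | false = inj₂ (subst (_< w + 8 * q * q) 8q²+8q²≡16q² (+-monoˡ-< (8 * q * q) (≤ᵇ-false⇒> w _ e)) ,
                      ≤-trans (+-monoˡ-≤ (8 * q * q) w≤) (≤-reflexive 16q²+8q²≡24q²))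

  crossLabel-low : ∀ {w} → w ≤ 8 * q * q → crossLabel w ≡ w + nH
  crossLabel-low w≤ rewrite ≤ᵇ-complete w≤ = refl

  crossLabel-high : ∀ {w} → 8 * q * q < w → crossLabel w ≡ w + 8 * q * q
  crossLabel-high w> rewrite >⇒≤ᵇ-false w> = refl

  W′≤16q² : ∀ b a → W′ b a ≤ 16 * q * q
  W′≤16q² b a = ≤-trans (proj₂ (W′-range b a)) (≤-reflexive (sym (*-assoc 16 q q)))

  crossLabel-injective : ∀ {w w′} → w ≤ 16 * q * q → w′ ≤ 16 * q * q → crossLabel w ≡ crossLabel w′ → w ≡ w′
  crossLabel-injective {w} {w′} w≤ w′≤ e with w ≤ᵇ 8 * q * q in ew | w′ ≤ᵇ 8 * q * q in ew′
  ... | true  | true  = +-cancelʳ-≡ nH w w′ e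
  ... | false | false = +-cancelʳ-≡ (8 * q * q) w w′ e
  ... | true  | false = ⊥-elim (<⇒≢ (low<high (≤ᵇ-sound w _ ew) (≤ᵇ-false⇒> w′ _ ew′)) e)
    where
    low<high : ∀ {u v} → u ≤ 8 * q * q → 8 * q * q < v → u + nH < v + 8 * q * q
    low<high {u} {v} u≤ v> = ≤-<-trans (≤-trans (+-monoˡ-≤ nH u≤) (≤-reflexive (trans (+-comm _ nH) nH+8q²≡lo)))
                               (≤-<-trans lo≤16q² (subst (_< v + 8 * q * q) 8q²+8q²≡16q² (+-monoˡ-< (8 * q * q) v>)))
  ... | false | true  = ⊥-elim (<⇒≢ (low<high (≤ᵇ-sound w′ _ ew′) (≤ᵇ-false⇒> w _ ew)) (sym e))
    where
    low<high : ∀ {u v} → u ≤ 8 * q * q → 8 * q * q < v → u + nH < v + 8 * q * q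
    low<high {u} {v} u≤ v> = ≤-<-trans (≤-trans (+-monoˡ-≤ nH u≤) (≤-reflexive (trans (+-comm _ nH) nH+8q²≡lo)))
                               (≤-<-trans lo≤16q² (subst (_< v + 8 * q * q) 8q²+8q²≡16q² (+-monoˡ-< (8 * q * q) v>)))

  data Band : Set where
    h-band c-band m-band : Band

  h≢m : h-band ≢ m-band
  h≢m ()

  h≢c : h-band ≢ c-band
  h≢c ()

  c≢m : c-band ≢ m-band
  c≢m ()

  pick : Bool → Bool → Bool → Bool → Band
  pick true  _     _     _     = h-band
  pick false true  _     _     = c-band
  pick false false true  _     = m-band
  pick false false false true  = c-band
  pick false false false false = h-band

  band : ℕ → Band
  band ℓ = pick (ℓ ≤ᵇ nH) (ℓ ≤ᵇ lo) (ℓ ≤ᵇ 16 * q * q) (ℓ ≤ᵇ 24 * q * q)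

  band≡pick : ∀ ℓ {b₁ b₂ b₃ b₄} → (ℓ ≤ᵇ nH) ≡ b₁ → (ℓ ≤ᵇ lo) ≡ b₂ → (ℓ ≤ᵇ 16 * q * q) ≡ b₃ → (ℓ ≤ᵇ 24 * q * q) ≡ b₄ →
    band ℓ ≡ pick b₁ b₂ b₃ b₄
  band≡pick ℓ refl refl refl refl = refl

  band-H : ∀ {ℓ} → (1 ≤ ℓ × ℓ ≤ nH) ⊎ (24 * q * q < ℓ × ℓ ≤ E) → band ℓ ≡ h-band
  band-H {ℓ} (inj₁ (_ , ℓ≤)) = band≡pick ℓ (≤ᵇ-complete ℓ≤) refl refl refl
  band-H {ℓ} (inj₂ (ℓ> , _)) = band≡pick ℓ (>⇒≤ᵇ-false (≤-<-trans (≤-trans nH≤lo (≤-trans lo≤16q² 16q²≤24q²)) ℓ>))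
    (>⇒≤ᵇ-false (≤-<-trans (≤-trans lo≤16q² 16q²≤24q²) ℓ>)) (>⇒≤ᵇ-false (≤-<-trans 16q²≤24q² ℓ>)) (>⇒≤ᵇ-false ℓ>)

  band-M : ∀ {ℓ} → lo < ℓ × ℓ ≤ 16 * q * q → band ℓ ≡ m-band
  band-M {ℓ} (ℓ> , ℓ≤) = band≡pick ℓ (>⇒≤ᵇ-false (≤-<-trans nH≤lo ℓ>)) (>⇒≤ᵇ-false ℓ>) (≤ᵇ-complete ℓ≤) refl

  band-C : ∀ {ℓ} → (nH < ℓ × ℓ ≤ lo) ⊎ (16 * q * q < ℓ × ℓ ≤ 24 * q * q) → band ℓ ≡ c-band
  band-C {ℓ} (inj₁ (ℓ> , ℓ≤)) = band≡pick ℓ (>⇒≤ᵇ-false ℓ>) (≤ᵇ-complete ℓ≤) refl refl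
  band-C {ℓ} (inj₂ (ℓ> , ℓ≤)) = band≡pick ℓ (>⇒≤ᵇ-false (≤-<-trans (≤-trans nH≤lo lo≤16q²) ℓ>)) (>⇒≤ᵇ-false (≤-<-trans lo≤16q² ℓ>))
    (>⇒≤ᵇ-false ℓ>) (≤ᵇ-complete ℓ≤)

  classBand : ∀ {x y} → EdgeClass x y → Band
  classBand (h-edge _ _ _ _ _ _) = h-band
  classBand (m-edge _)           = m-band
  classBand (c-edge _ _ _)       = c-band

  Tq-cross : ∀ {x y} a b → SameEdge x y (V a) (U b) → Tq x y ≡ crossLabel (W′ b a)
  Tq-cross a b (inj₁ (refl , refl)) = Tq-VU a b
  Tq-cross a b (inj₂ (refl , refl)) = Tq-UV b a

  in-range-and-band : ∀ {x y} (c : EdgeClass x y) → (1 ≤ Tq x y × Tq x y ≤ E) × band (Tq x y) ≡ classBand c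
  in-range-and-band (h-edge s a b refl refl h) rewrite Tq-H s a b h = range (hLabel-range s h) , band-H (hLabel-range s h)
    where
    range : ∀ {ℓ} → (1 ≤ ℓ × ℓ ≤ nH) ⊎ (24 * q * q < ℓ × ℓ ≤ E) → 1 ≤ ℓ × ℓ ≤ E
    range (inj₁ (ℓ≥1 , ℓ≤)) = ℓ≥1 , ≤-trans ℓ≤ (≤-trans nH≤lo (≤-trans lo≤16q² (≤-trans 16q²≤24q² 24q²≤E)))
    range (inj₂ (ℓ> , ℓ≤))  = ≤-trans (s≤s z≤n) ℓ> , ℓ≤
  in-range-and-band {x} {y} (m-edge g) rewrite Tq-G3 x y g =
    (≤-trans (s≤s z≤n) (proj₁ (mLabel-range g)) , ≤-trans (proj₂ (mLabel-range g)) (≤-trans 16q²≤24q² 24q²≤E)) ,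
    band-M (mLabel-range g)
  in-range-and-band (c-edge a b o) rewrite Tq-cross a b o = range cr , band-C cr
    where
    cr : (nH < crossLabel (W′ b a) × crossLabel (W′ b a) ≤ lo) ⊎ (16 * q * q < crossLabel (W′ b a) × crossLabel (W′ b a) ≤ 24 * q * q)
    cr = crossLabel-range (proj₁ (W′-range b a)) (W′≤16q² b a)
    range : ∀ {ℓ} → (nH < ℓ × ℓ ≤ lo) ⊎ (16 * q * q < ℓ × ℓ ≤ 24 * q * q) → 1 ≤ ℓ × ℓ ≤ E
    range (inj₁ (ℓ> , ℓ≤)) = ≤-trans (s≤s z≤n) ℓ> , ≤-trans ℓ≤ (≤-trans lo≤16q² (≤-trans 16q²≤24q² 24q²≤E))
    range (inj₂ (ℓ> , ℓ≤)) = ≤-trans (s≤s z≤n) ℓ> , ≤-trans ℓ≤ 24q²≤E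

  Tq-range : ∀ x y → Kedge x y ≡ true → 1 ≤ Tq x y × Tq x y ≤ E
  Tq-range x y K = proj₁ (in-range-and-band (classify x y K))

  t0-sym : ∀ {a b} → Hedge q a b ≡ true → t0 a b ≡ t0 b a
  t0-sym {a} {b} = proj₁ t0-lab a b

  t0-injective : ∀ {a b a′ b′} → Hedge q a b ≡ true → Hedge q a′ b′ ≡ true → t0 a b ≡ t0 a′ b′ → SameEdge a b a′ b′
  t0-injective {a} {b} {a′} {b′} = proj₁ (proj₂ (proj₂ t0-lab)) a b a′ b′

  F1-same : ∀ {a b a′ b′} → Hedge q a b ≡ true → SameEdge a b a′ b′ → F1 a b ≡ F1 a′ b′
  F1-same h (inj₁ (refl , refl)) = refl
  F1-same h (inj₂ (refl , refl)) = F1-sym _ _ h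

  low-H<high-H : ∀ {a b a′ b′} → Hedge q a b ≡ true → Hedge q a′ b′ ≡ true → t0 a b < t0 a′ b′ + 24 * q * q
  low-H<high-H h h′ = <-≤-trans (s≤s (≤-trans (proj₂ (t0-range h)) (≤-trans nH≤lo (≤-trans lo≤16q² 16q²≤24q²))))
                                (+-monoˡ-≤ (24 * q * q) (proj₁ (t0-range h′)))

  same-side : ∀ s s′ {a b a′ b′ l} → Hedge q a b ≡ true → low s a b ≡ l → low s′ a′ b′ ≡ l → SameEdge a b a′ b′ → s ≡ s′
  same-side s s′ {a} {b} h e e′ same = onSide-injective s s′ (F1 a b) (trans e (sym (trans (cong (onSide s′) (F1-same h same)) e′)))

  hLabel-injective : ∀ s s′ {a b a′ b′} → Hedge q a b ≡ true → Hedge q a′ b′ ≡ true →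
    hLabel s a b ≡ hLabel s′ a′ b′ → s ≡ s′ × SameEdge a b a′ b′
  hLabel-injective s s′ {a} {b} {a′} {b′} h h′ e with low s a b in l | low s′ a′ b′ in l′
  ... | true  | true  = let same = t0-injective h h′ e in same-side s s′ h l l′ same , same
  ... | false | false = let same = t0-injective h h′ (+-cancelʳ-≡ (24 * q * q) _ _ e) in same-side s s′ h l l′ same , same
  ... | true  | false = ⊥-elim (<⇒≢ (low-H<high-H h h′) e)
  ... | false | true  = ⊥-elim (<⇒≢ (low-H<high-H h′ h) (sym e))

  Tq-injective : ∀ x y x′ y′ → Kedge x y ≡ true → Kedge x′ y′ ≡ true → Tq x y ≡ Tq x′ y′ → SameEdge x y x′ y′
  Tq-injective x y x′ y′ K K′ e = same (classify x y K) (classify x′ y′ K′)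
    where
    bands : (c : EdgeClass x y) (c′ : EdgeClass x′ y′) → classBand c ≡ classBand c′
    bands c c′ = trans (sym (proj₂ (in-range-and-band c))) (trans (cong band e) (proj₂ (in-range-and-band c′)))
    same : EdgeClass x y → EdgeClass x′ y′ → SameEdge x y x′ y′
    same (h-edge s a b refl refl h) (h-edge s′ a′ b′ refl refl h′)
      with hLabel-injective s s′ h h′ (trans (sym (Tq-H s a b h)) (trans e (Tq-H s′ a′ b′ h′)))
    ... | refl , inj₁ (refl , refl) = inj₁ (refl , refl)
    ... | refl , inj₂ (refl , refl) = inj₂ (refl , refl)
    same (m-edge g) (m-edge g′) =
      proj₁ (proj₂ (proj₂ ord-lab)) x y x′ y′ g g′ (+-cancelˡ-≡ lo _ _ (trans (sym (Tq-G3 x y g)) (trans e (Tq-G3 x′ y′ g′))))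
    same (c-edge a b o) (c-edge a′ b′ o′) = orient o (subst₂ (λ b″ a″ → SameEdge x′ y′ (V a″) (U b″)) (sym (proj₁ ends)) (sym (proj₂ ends)) o′)
      where
      ends : b ≡ b′ × a ≡ a′
      ends = W′-injective b a b′ a′ (crossLabel-injective (W′≤16q² b a) (W′≤16q² b′ a′) (trans (sym (Tq-cross a b o)) (trans e (Tq-cross a′ b′ o′))))
      orient : ∀ {x y x′ y′ z w} → SameEdge x y z w → SameEdge x′ y′ z w → SameEdge x y x′ y′
      orient (inj₁ (refl , refl)) (inj₁ (refl , refl)) = inj₁ (refl , refl)
      orient (inj₁ (refl , refl)) (inj₂ (refl , refl)) = inj₂ (refl , refl)
      orient (inj₂ (refl , refl)) (inj₁ (refl , refl)) = inj₂ (refl , refl)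
      orient (inj₂ (refl , refl)) (inj₂ (refl , refl)) = inj₁ (refl , refl)
    same c@(h-edge _ _ _ _ _ _) c′@(m-edge _)           = ⊥-elim (h≢m (bands c c′))
    same c@(h-edge _ _ _ _ _ _) c′@(c-edge _ _ _)       = ⊥-elim (h≢c (bands c c′))
    same c@(m-edge _)           c′@(h-edge _ _ _ _ _ _) = ⊥-elim (h≢m (sym (bands c c′)))
    same c@(m-edge _)           c′@(c-edge _ _ _)       = ⊥-elim (c≢m (sym (bands c c′)))
    same c@(c-edge _ _ _)       c′@(h-edge _ _ _ _ _ _) = ⊥-elim (h≢c (sym (bands c c′)))
    same c@(c-edge _ _ _)       c′@(m-edge _)           = ⊥-elim (c≢m (bands c c′))

  G3-sym : ∀ x y → G3 q x y ≡ true → G3 q y x ≡ true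
  G3-sym x y g with ∧-true⁻ (Kedge x y) (toℕ x / 2 ≡ᵇ toℕ y / 2) g
  ... | K , m = cong₂ _∧_ (Kedge-sym x y K) (≡ᵇ-complete (sym (≡ᵇ-sound (toℕ x / 2) (toℕ y / 2) m)))

  hLabel-sym : ∀ s {a b} → Hedge q a b ≡ true → hLabel s a b ≡ hLabel s b a
  hLabel-sym s {a} {b} h = cong₂ (λ f t → if onSide s f then t else t + 24 * q * q) (F1-sym a b h) (t0-sym {a} {b} h)

  Tq-sym : ∀ x y → Kedge x y ≡ true → Tq x y ≡ Tq y x
  Tq-sym x y K = symmetric (classify x y K)
    where
    symmetric : EdgeClass x y → Tq x y ≡ Tq y x
    symmetric (h-edge s a b refl refl h) =
      trans (Tq-H s a b h) (trans (hLabel-sym s h) (sym (Tq-H s b a (trans (Hedge-sym b a) h))))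
    symmetric (m-edge g) =
      trans (Tq-G3 x y g) (trans (cong (lo +_) (proj₁ ord-lab x y g)) (sym (Tq-G3 y x (G3-sym x y g))))
    symmetric (c-edge a b o) = trans (Tq-cross a b o) (sym (Tq-cross a b (swap o)))
      where
      swap : ∀ {x y z w} → SameEdge x y z w → SameEdge y x z w
      swap (inj₁ (p , r)) = inj₂ (r , p)
      swap (inj₂ (p , r)) = inj₁ (r , p)

  Labelled : ℕ → Set
  Labelled ℓ = ∃[ x ] ∃[ y ] (Kedge x y ≡ true × Tq x y ≡ ℓ)

  H-labelled : ∀ l {a b} → Hedge q a b ≡ true → Labelled (if l then t0 a b else t0 a b + 24 * q * q)
  H-labelled l {a} {b} h = emb side a , emb side b , Kedge-emb side h ,
    trans (Tq-H side a b h) (cong (λ z → if z then t0 a b else t0 a b + 24 * q * q) (onSide-sideWith l (F1 a b)))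
    where
    side : Side
    side = sideWith l (F1 a b)

  cross-labelled : ∀ {w} → 1 ≤ w → w ≤ 16 * q * q → Labelled (crossLabel w)
  cross-labelled {w} w≥1 w≤ = let b , a , e = W′-onto w w≥1 (≤-trans w≤ (≤-reflexive (*-assoc 16 q q)))
                              in V a , U b , Kedge-VU a b , trans (Tq-VU a b) (cong crossLabel e)

  t0-onto : ∀ {j} → 1 ≤ j → j ≤ nH → ∃[ a ] ∃[ b ] (Hedge q a b ≡ true × t0 a b ≡ j)
  t0-onto {j} = proj₂ (proj₂ (proj₂ t0-lab)) j

  H-low-onto : ∀ {ℓ} → 1 ≤ ℓ → ℓ ≤ nH → Labelled ℓ
  H-low-onto ℓ≥1 ℓ≤ = let a , b , h , e = t0-onto ℓ≥1 ℓ≤ in subst Labelled e (H-labelled true h)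

  cross-low-onto : ∀ {ℓ} → nH < ℓ → ℓ ≤ lo → Labelled ℓ
  cross-low-onto {ℓ} ℓ> ℓ≤ =
    subst Labelled (trans (crossLabel-low w≤8q²) (m∸n+n≡m (<⇒≤ ℓ>)))
          (cross-labelled (m+n≤o⇒m≤o∸n 1 ℓ>) (≤-trans w≤8q² (≤-trans (m≤m+n _ _) (≤-reflexive 8q²+8q²≡16q²))))
    where
    w≤8q² : ℓ ∸ nH ≤ 8 * q * q
    w≤8q² = m≤n+o⇒m∸n≤o ℓ nH (≤-trans ℓ≤ (≤-reflexive (sym nH+8q²≡lo)))

  matching-labelled : ∀ {ℓ} → lo < ℓ → ℓ ≤ 16 * q * q → ∃[ x ] ∃[ y ] (G3 q x y ≡ true × Tq x y ≡ ℓ)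
  matching-labelled {ℓ} ℓ> ℓ≤ =
    let x , y , g , e = proj₂ (proj₂ (proj₂ ord-lab)) (ℓ ∸ lo) (m+n≤o⇒m≤o∸n 1 ℓ>)
                          (m≤n+o⇒m∸n≤o ℓ lo (≤-trans ℓ≤ (≤-reflexive (sym lo+4q≡16q²))))
    in x , y , g , trans (Tq-G3 x y g) (trans (cong (lo +_) e) (m+[n∸m]≡n (<⇒≤ ℓ>)))

  cross-high-onto : ∀ {ℓ} → 16 * q * q < ℓ → ℓ ≤ 24 * q * q → Labelled ℓ
  cross-high-onto {ℓ} ℓ> ℓ≤ = subst Labelled (trans (crossLabel-high 8q²<w) (m∸n+n≡m 8q²≤ℓ)) (cross-labelled (≤-trans (s≤s z≤n) 8q²<w) w≤16q²)
    where
    8q²≤ℓ : 8 * q * q ≤ ℓ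
    8q²≤ℓ = ≤-trans (m≤m+n _ (8 * q * q)) (≤-trans (≤-reflexive 8q²+8q²≡16q²) (<⇒≤ ℓ>))
    8q²<w : 8 * q * q < ℓ ∸ 8 * q * q
    8q²<w = m+n≤o⇒m≤o∸n (suc (8 * q * q)) (subst (_≤ ℓ) (cong suc (sym 8q²+8q²≡16q²)) ℓ>)
    w≤16q² : ℓ ∸ 8 * q * q ≤ 16 * q * q
    w≤16q² = m≤n+o⇒m∸n≤o ℓ (8 * q * q) (≤-trans ℓ≤ (≤-reflexive (trans (sym 16q²+8q²≡24q²) (+-comm (16 * q * q) (8 * q * q)))))

  H-high-onto : ∀ {ℓ} → 24 * q * q < ℓ → ℓ ≤ E → Labelled ℓ
  H-high-onto {ℓ} ℓ> ℓ≤ =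
    let a , b , h , e = t0-onto (m+n≤o⇒m≤o∸n 1 ℓ>) (m≤n+o⇒m∸n≤o ℓ (24 * q * q) (≤-trans ℓ≤ (≤-reflexive (sym 24q²+nH≡E))))
    in subst Labelled (trans (cong (_+ 24 * q * q) e) (m∸n+n≡m (<⇒≤ ℓ>))) (H-labelled false h)

  Tq-onto : ∀ ℓ → 1 ≤ ℓ → ℓ ≤ E → Labelled ℓ
  Tq-onto ℓ ℓ≥1 ℓ≤E = beyond-0 (ℓ ≤? nH)
    where
    beyond-3 : Dec (ℓ ≤ 24 * q * q) → 16 * q * q < ℓ → Labelled ℓ
    beyond-3 (yes ℓ≤) ℓ> = cross-high-onto ℓ> ℓ≤
    beyond-3 (no ℓ≰) _  = H-high-onto (≰⇒> ℓ≰) ℓ≤E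
    beyond-2 : Dec (ℓ ≤ 16 * q * q) → lo < ℓ → Labelled ℓ
    beyond-2 (yes ℓ≤) ℓ> = let x , y , g , e = matching-labelled ℓ> ℓ≤ in x , y , proj₁ (∧-true⁻ (Kedge x y) _ g) , e
    beyond-2 (no ℓ≰) _  = beyond-3 (ℓ ≤? 24 * q * q) (≰⇒> ℓ≰)
    beyond-1 : Dec (ℓ ≤ lo) → nH < ℓ → Labelled ℓ
    beyond-1 (yes ℓ≤) ℓ> = cross-low-onto ℓ> ℓ≤
    beyond-1 (no ℓ≰) _  = beyond-2 (ℓ ≤? 16 * q * q) (≰⇒> ℓ≰)
    beyond-0 : Dec (ℓ ≤ nH) → Labelled ℓ
    beyond-0 (yes ℓ≤) = H-low-onto ℓ≥1 ℓ≤
    beyond-0 (no ℓ≰)  = beyond-1 (ℓ ≤? lo) (≰⇒> ℓ≰)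

  Tq-labeling : IsEdgeLabeling n8 Tq
  Tq-labeling = Tq-sym , Tq-range , Tq-injective , Tq-onto

  n8≡2*4q : 2 * (4 * q) ≡ n8
  n8≡2*4q = cong (4 * q +_) (+-identityʳ (4 * q))

  partner : Fin n8 → Fin n8
  partner x = fromℕ< (subst (mate (toℕ x) <_) n8≡2*4q (mate< (toℕ x) (4 * q) (subst (toℕ x <_) (sym n8≡2*4q) (FP.toℕ<n x))))

  toℕ-partner : ∀ x → toℕ (partner x) ≡ mate (toℕ x)
  toℕ-partner x = FP.toℕ-fromℕ< _

  InA notA : Fin n8 → Fin n8 → Bool
  InA  x y = Kedge x y ∧ G3 q x y
  notA x y = Kedge x y ∧ not (G3 q x y)

  InA⇒G3 : ∀ x y → InA x y ≡ true → G3 q x y ≡ true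
  InA⇒G3 x y h = proj₂ (∧-true⁻ (Kedge x y) (G3 q x y) h)

  InA-partner : ∀ x → InA x (partner x) ≡ true
  InA-partner x rewrite ≢⇒Kedge (λ e → mate≢ (toℕ x) (sym (trans (cong toℕ e) (toℕ-partner x)))) | toℕ-partner x | mate/2 (toℕ x) =
    ≡ᵇ-refl (toℕ x / 2)

  InA⇒partner : ∀ x y → InA x y ≡ true → y ≡ partner x
  InA⇒partner x y h with ∧-true⁻ (Kedge x y) (G3 q x y) h
  ... | K , g = FP.toℕ-injective (trans (mate-unique (toℕ y) (toℕ x) (sym (≡ᵇ-sound _ _ (proj₂ (∧-true⁻ (Kedge x y) _ g))))
                                                      (λ e → Kedge⇒≢ {x = x} {y} K (FP.toℕ-injective (sym e))))
                                        (sym (toℕ-partner x)))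

  count-InA≤1 : ∀ x → count (InA x) ≤ 1
  count-InA≤1 x = sumF-≤-single (InA x) (λ _ → 1) (partner x) (InA⇒partner x)

  edgeCount-InA : edgeCount InA ≡ 4 * q
  edgeCount-InA = trans (sumF-cong forward-partner) (trans (sumF-toℕ n8 (λ t → ind (t <ᵇ mate t))) (count-below-mate (4 * q)))
    where
    forward-partner : ∀ x → count (λ y → (toℕ x <ᵇ toℕ y) ∧ InA x y) ≡ ind (toℕ x <ᵇ mate (toℕ x))
    forward-partner x with toℕ x <ᵇ mate (toℕ x) in e
    ... | true  = sumF-single _ (λ _ → 1) (partner x) (λ y h → InA⇒partner x y (proj₂ (∧-true⁻ (toℕ x <ᵇ toℕ y) (InA x y) h)))
                    (cong₂ _∧_ (trans (cong (toℕ x <ᵇ_) (toℕ-partner x)) e) (InA-partner x))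
    ... | false = trans (sumF-cong none) (sumF-zeros n8)
      where
      none : ∀ y → ind ((toℕ x <ᵇ toℕ y) ∧ InA x y) ≡ 0
      none y with InA x y in h
      ... | false = cong ind (∧-zeroʳ _)
      ... | true rewrite InA⇒partner x y h | toℕ-partner x | e = refl

  lo-is : (E ∸ edgeCount InA) / 2 ≡ lo
  lo-is = begin
    (E ∸ edgeCount InA) / 2     ≡⟨ cong (λ a → (E ∸ a) / 2) edgeCount-InA ⟩
    (E ∸ 4 * q) / 2             ≡⟨ cong (λ e → (e ∸ 4 * q) / 2) E≡2lo+4q ⟩
    (2 * lo + 4 * q ∸ 4 * q) / 2 ≡⟨ cong (_/ 2) (trans (m+n∸n≡m (2 * lo) (4 * q)) (*-comm 2 lo)) ⟩
    lo * 2 / 2                  ≡⟨ m*n/n≡m lo 2 ⟩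
    lo                          ∎
    where open ≡-Reasoning

  hi-is : (E + edgeCount InA) / 2 ≡ 16 * q * q
  hi-is = begin
    (E + edgeCount InA) / 2     ≡⟨ cong (λ a → (E + a) / 2) edgeCount-InA ⟩
    (E + 4 * q) / 2             ≡⟨ cong (λ e → (e + 4 * q) / 2) E≡2lo+4q ⟩
    (2 * lo + 4 * q + 4 * q) / 2 ≡⟨ cong (_/ 2) (shape lo q) ⟩
    (lo + 4 * q) * 2 / 2        ≡⟨ m*n/n≡m (lo + 4 * q) 2 ⟩
    lo + 4 * q                  ≡⟨ lo+4q≡16q² ⟩
    16 * q * q                  ∎
    where
    open ≡-Reasoning
    shape : ∀ l q → 2 * l + 4 * q + 4 * q ≡ (l + 4 * q) * 2
    shape = solve-∀

  same-parity : edgeCount InA % 2 ≡ E % 2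
  same-parity = begin
    edgeCount InA % 2           ≡⟨ cong (_% 2) (trans edgeCount-InA 4q≡2q*2) ⟩
    (2 * q) * 2 % 2             ≡⟨ m*n%n≡0 (2 * q) 2 ⟩
    0                           ≡⟨ sym (m*n%n≡0 (lo + 2 * q) 2) ⟩
    (lo + 2 * q) * 2 % 2        ≡⟨ cong (_% 2) (sym (trans E≡2lo+4q (shape lo q))) ⟩
    E % 2                       ∎
    where
    open ≡-Reasoning
    shape : ∀ l q → 2 * l + 4 * q ≡ (l + 2 * q) * 2
    shape = solve-∀

  other : Side → Side
  other v-side = u-side
  other u-side = v-side

  crossAt : Side → Fin (4 * q) → Fin (4 * q) → ℕ
  crossAt v-side a b = W′ b a
  crossAt u-side b a = W′ b a

  Tq-other : ∀ s a b → Tq (emb s a) (emb (other s) b) ≡ crossLabel (crossAt s a b)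
  Tq-other v-side a b = Tq-VU a b
  Tq-other u-side b a = Tq-UV b a

  Kedge-other : ∀ s a b → Kedge (emb s a) (emb (other s) b) ≡ true
  Kedge-other v-side a b = Kedge-VU a b
  Kedge-other u-side b a = Kedge-UV b a

  G3-other : ∀ s a b → G3 q (emb s a) (emb (other s) b) ≡ false
  G3-other v-side a b = G3-VU a b
  G3-other u-side b a = G3-UV b a

  crossAt-range : ∀ s a b → 1 ≤ crossAt s a b × crossAt s a b ≤ 16 * q * q
  crossAt-range v-side a b = proj₁ (W′-range b a) , W′≤16q² b a
  crossAt-range u-side b a = proj₁ (W′-range b a) , W′≤16q² b a

  crossAt-sum : ∀ s a → sumF (λ b → crossLabel (crossAt s a b)) ≡ q * lineTotal
  crossAt-sum v-side = W′-column-sum crossLabel lineTotal (λ J x<q y<q → line-total (column-line J) x<q y<q)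
  crossAt-sum u-side = W′-row-sum crossLabel lineTotal (λ I x<q y<q → line-total (row-line I) x<q y<q)

  crossAt-low : ∀ s a → count (λ b → crossAt s a b ≤ᵇ 8 * q * q) ≡ q * 2
  crossAt-low v-side = W′-column-sum (λ w → ind (w ≤ᵇ 8 * q * q)) 2 (λ J x<q y<q → line-low (column-line J) x<q y<q)
  crossAt-low u-side = W′-row-sum (λ w → ind (w ≤ᵇ 8 * q * q)) 2 (λ I x<q y<q → line-low (row-line I) x<q y<q)

  crossAt-high : ∀ s a → count (λ b → not (crossAt s a b ≤ᵇ 8 * q * q)) ≡ q * 2
  crossAt-high v-side = W′-column-sum (λ w → ind (not (w ≤ᵇ 8 * q * q))) 2 (λ J x<q y<q → line-high (column-line J) x<q y<q)
  crossAt-high u-side = W′-row-sum (λ w → ind (not (w ≤ᵇ 8 * q * q))) 2 (λ I x<q y<q → line-high (row-line I) x<q y<q)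

  sumF-sides : ∀ s (f : Fin n8 → ℕ) → sumF f ≡ sumF (f ∘ emb s) + sumF (f ∘ emb (other s))
  sumF-sides v-side f = sumF-split (4 * q) (4 * q) f
  sumF-sides u-side f = trans (sumF-split (4 * q) (4 * q) f) (+-comm (sumF (f ∘ V)) _)

  data Placed : Fin n8 → Set where
    placed : ∀ s a → Placed (emb s a)

  placement : ∀ x → Placed x
  placement x with vertex x
  ... | isV a = placed v-side a
  ... | isU b = placed u-side b

  count-low : ∀ s a → count (λ b → Hedge q a b ∧ low s a b) ≡ deg
  count-low v-side a = F1-reg a
  count-low u-side a = F2-reg a

  count-high : ∀ s a → count (λ b → Hedge q a b ∧ not (low s a b)) ≡ deg
  count-high v-side a = F2-reg a
  count-high u-side a = trans (sumF-cong (λ b → cong (λ z → ind (Hedge q a b ∧ z)) (not-involutive (F1 a b)))) (F1-reg a)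

  notA-emb : ∀ s a b → notA (emb s a) (emb s b) ≡ Hedge q a b
  notA-emb s a b = trans (cong (λ g → Kedge (emb s a) (emb s b) ∧ not g) (G3-emb s a b)) (by-Kedge (Kedge (emb s a) (emb s b)) refl)
    where
    by-Kedge : ∀ κ → Kedge (emb s a) (emb s b) ≡ κ → κ ∧ not (κ ∧ not (Hedge q a b)) ≡ Hedge q a b
    by-Kedge true  _ = not-involutive _
    by-Kedge false e = sym (trans (cong (Hedge q a) (sym (emb-injective s (¬Kedge⇒≡ e)))) (cong not (≡ᵇ-refl (toℕ a / 2))))

  notA-other : ∀ s a b → notA (emb s a) (emb (other s) b) ≡ true
  notA-other s a b = cong₂ (λ κ g → κ ∧ not g) (Kedge-other s a b) (G3-other s a b)

  hLabel≤lo : ∀ s {a b} → Hedge q a b ≡ true → (hLabel s a b ≤ᵇ lo) ≡ low s a b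
  hLabel≤lo s {a} {b} h with low s a b
  ... | true  = ≤ᵇ-complete (≤-trans (proj₂ (t0-range h)) nH≤lo)
  ... | false = >⇒≤ᵇ-false (≤-<-trans (≤-trans lo≤16q² 16q²≤24q²) (+-monoˡ-≤ (24 * q * q) (proj₁ (t0-range h))))

  crossLabel≤lo : ∀ {w} → 1 ≤ w → w ≤ 16 * q * q → (crossLabel w ≤ᵇ lo) ≡ (w ≤ᵇ 8 * q * q)
  crossLabel≤lo {w} w≥1 w≤ with w ≤? 8 * q * q
  ... | yes w≤8q² = trans (cong (_≤ᵇ lo) (crossLabel-low w≤8q²))
                          (trans (≤ᵇ-complete (≤-trans (+-monoˡ-≤ nH w≤8q²) (≤-reflexive (trans (+-comm _ nH) nH+8q²≡lo))))
                                 (sym (≤ᵇ-complete w≤8q²)))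
  ... | no w≰8q²  = trans (cong (_≤ᵇ lo) (crossLabel-high (≰⇒> w≰8q²)))
                          (trans (>⇒≤ᵇ-false (≤-<-trans lo≤16q² (subst (_< w + 8 * q * q) 8q²+8q²≡16q² (+-monoˡ-< (8 * q * q) (≰⇒> w≰8q²)))))
                                 (sym (>⇒≤ᵇ-false (≰⇒> w≰8q²))))

  L-emb : ∀ s a b → (Kedge (emb s a) (emb s b) ∧ (Tq (emb s a) (emb s b) ≤ᵇ lo)) ≡ (Hedge q a b ∧ low s a b)
  L-emb s a b = by-Hedge (Hedge q a b) refl
    where
    x y : Fin n8
    x = emb s a
    y = emb s b
    by-Kedge : ∀ κ → Kedge x y ≡ κ → Hedge q a b ≡ false → (κ ∧ (Tq x y ≤ᵇ lo)) ≡ false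
    by-Kedge true  eK eH = trans (cong (_≤ᵇ lo) (Tq-G3 x y g)) (>⇒≤ᵇ-false (proj₁ (mLabel-range g)))
      where
      g : G3 q x y ≡ true
      g = trans (G3-emb s a b) (cong₂ (λ κ η → κ ∧ not η) eK eH)
    by-Kedge false _  _  = refl
    by-Hedge : ∀ η → Hedge q a b ≡ η → (Kedge x y ∧ (Tq x y ≤ᵇ lo)) ≡ (η ∧ low s a b)
    by-Hedge true  eH = trans (cong (_∧ (Tq x y ≤ᵇ lo)) (Kedge-emb s eH)) (trans (cong (_≤ᵇ lo) (Tq-H s a b eH)) (hLabel≤lo s eH))
    by-Hedge false eH = by-Kedge (Kedge x y) refl eH

  Hi-emb : ∀ s a b → (notA (emb s a) (emb s b) ∧ not (Tq (emb s a) (emb s b) ≤ᵇ lo)) ≡ (Hedge q a b ∧ not (low s a b))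
  Hi-emb s a b = trans (cong (_∧ not (Tq (emb s a) (emb s b) ≤ᵇ lo)) (notA-emb s a b)) (by-Hedge (Hedge q a b) refl)
    where
    by-Hedge : ∀ η → Hedge q a b ≡ η → (η ∧ not (Tq (emb s a) (emb s b) ≤ᵇ lo)) ≡ (η ∧ not (low s a b))
    by-Hedge true  eH = cong not (trans (cong (_≤ᵇ lo) (Tq-H s a b eH)) (hLabel≤lo s eH))
    by-Hedge false _  = refl

  nonA-emb : ∀ s a b → (if notA (emb s a) (emb s b) then Tq (emb s a) (emb s b) else 0) ≡ (if Hedge q a b then hLabel s a b else 0)
  nonA-emb s a b = trans (cong (λ z → if z then Tq (emb s a) (emb s b) else 0) (notA-emb s a b)) (by-Hedge (Hedge q a b) refl)
    where
    by-Hedge : ∀ η → Hedge q a b ≡ η → (if η then Tq (emb s a) (emb s b) else 0) ≡ (if η then hLabel s a b else 0)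
    by-Hedge true  eH = Tq-H s a b eH
    by-Hedge false _  = refl

  L-other : ∀ s a b → (Kedge (emb s a) (emb (other s) b) ∧ (Tq (emb s a) (emb (other s) b) ≤ᵇ lo)) ≡ (crossAt s a b ≤ᵇ 8 * q * q)
  L-other s a b = trans (cong₂ (λ κ t → κ ∧ (t ≤ᵇ lo)) (Kedge-other s a b) (Tq-other s a b))
                        (crossLabel≤lo (proj₁ (crossAt-range s a b)) (proj₂ (crossAt-range s a b)))

  Hi-other : ∀ s a b → (notA (emb s a) (emb (other s) b) ∧ not (Tq (emb s a) (emb (other s) b) ≤ᵇ lo)) ≡ not (crossAt s a b ≤ᵇ 8 * q * q)
  Hi-other s a b = trans (cong₂ (λ n t → n ∧ not (t ≤ᵇ lo)) (notA-other s a b) (Tq-other s a b))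
                         (cong not (crossLabel≤lo (proj₁ (crossAt-range s a b)) (proj₂ (crossAt-range s a b))))

  nonA-other : ∀ s a b → (if notA (emb s a) (emb (other s) b) then Tq (emb s a) (emb (other s) b) else 0) ≡ crossLabel (crossAt s a b)
  nonA-other s a b = trans (cong (λ z → if z then Tq (emb s a) (emb (other s) b) else 0) (notA-other s a b)) (Tq-other s a b)

  low-high-balance : ∀ x → count (λ w → Kedge x w ∧ (Tq x w ≤ᵇ lo)) ≡ count (λ w → notA x w ∧ not (Tq x w ≤ᵇ lo))
  low-high-balance x = balanced (placement x)
    where
    balanced : ∀ {x} → Placed x → count (λ w → Kedge x w ∧ (Tq x w ≤ᵇ lo)) ≡ count (λ w → notA x w ∧ not (Tq x w ≤ᵇ lo))
    balanced (placed s a) = begin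
      count (λ w → Kedge (emb s a) w ∧ (Tq (emb s a) w ≤ᵇ lo))
        ≡⟨ sumF-sides s _ ⟩
      count (λ b → Kedge (emb s a) (emb s b) ∧ (Tq (emb s a) (emb s b) ≤ᵇ lo))
        + count (λ b → Kedge (emb s a) (emb (other s) b) ∧ (Tq (emb s a) (emb (other s) b) ≤ᵇ lo))
        ≡⟨ cong₂ _+_ (trans (sumF-cong (λ b → cong ind (L-emb s a b))) (count-low s a))
                     (trans (sumF-cong (λ b → cong ind (L-other s a b))) (crossAt-low s a)) ⟩
      deg + q * 2
        ≡⟨ sym (cong₂ _+_ (trans (sumF-cong (λ b → cong ind (Hi-emb s a b))) (count-high s a))
                          (trans (sumF-cong (λ b → cong ind (Hi-other s a b))) (crossAt-high s a))) ⟩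
      count (λ b → notA (emb s a) (emb s b) ∧ not (Tq (emb s a) (emb s b) ≤ᵇ lo))
        + count (λ b → notA (emb s a) (emb (other s) b) ∧ not (Tq (emb s a) (emb (other s) b) ≤ᵇ lo))
        ≡⟨ sym (sumF-sides s _) ⟩
      count (λ w → notA (emb s a) w ∧ not (Tq (emb s a) w ≤ᵇ lo)) ∎
      where open ≡-Reasoning

  magic : ℕ
  magic = proj₁ t0-magic

  magic≡ : magic ≡ deg * suc nH
  magic≡ = *-cancelˡ-≡ magic (deg * suc nH) (4 * q) {{m*n≢0 4 q}} (begin
    4 * q * magic                                                 ≡⟨ sym (sumF-const (4 * q) magic) ⟩
    sumF {4 * q} (λ _ → magic)                                    ≡⟨ sumF-cong (λ a → sym (proj₂ t0-magic a)) ⟩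
    sumF (λ a → sumF (λ b → if Hedge q a b then t0 a b else 0))   ≡⟨ OrderedPairs.ordered-label-sum (Hedge q) nH t0 t0-lab (λ {a} {b} h → trans (Hedge-sym b a) h) Hedge⇒≢ ⟩
    nH * suc nH                                                   ≡⟨ cong (_* suc nH) nH≡4q*deg ⟩
    4 * q * deg * suc nH                                          ≡⟨ *-assoc (4 * q) deg (suc nH) ⟩
    4 * q * (deg * suc nH)                                        ∎)
    where open ≡-Reasoning

  H-sum : ∀ s a → sumF (λ b → if Hedge q a b then hLabel s a b else 0) ≡ magic + 24 * q * q * deg
  H-sum s a = begin
    sumF (λ b → if Hedge q a b then hLabel s a b else 0)
      ≡⟨ sumF-cong (λ b → split (Hedge q a b) (low s a b)) ⟩
    sumF (λ b → (if Hedge q a b then t0 a b else 0) + 24 * q * q * ind (Hedge q a b ∧ not (low s a b)))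
      ≡⟨ sumF-+ (λ b → if Hedge q a b then t0 a b else 0) (λ b → 24 * q * q * ind (Hedge q a b ∧ not (low s a b))) ⟩
    sumF (λ b → if Hedge q a b then t0 a b else 0) + sumF (λ b → 24 * q * q * ind (Hedge q a b ∧ not (low s a b)))
      ≡⟨ cong₂ _+_ (proj₂ t0-magic a) (trans (sumF-*ˡ (24 * q * q) (λ b → ind (Hedge q a b ∧ not (low s a b)))) (cong (24 * q * q *_) (count-high s a))) ⟩
    magic + 24 * q * q * deg ∎
    where
    open ≡-Reasoning
    split : ∀ {b} η l → (if η then (if l then t0 a b else t0 a b + 24 * q * q) else 0)
                        ≡ (if η then t0 a b else 0) + 24 * q * q * ind (η ∧ not l)
    split false _     = sym (*-zeroʳ (24 * q * q))
    split {b} true true  = sym (trans (cong (t0 a b +_) (*-zeroʳ (24 * q * q))) (+-identityʳ _))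
    split {b} true false = cong (t0 a b +_) (sym (*-identityʳ (24 * q * q)))

  nonA-total : ℕ
  nonA-total = magic + 24 * q * q * deg + q * lineTotal

  nonA-sum : ∀ x → sumF (λ w → if notA x w then Tq x w else 0) ≡ nonA-total
  nonA-sum x = at-vertex (placement x)
    where
    at-vertex : ∀ {x} → Placed x → sumF (λ w → if notA x w then Tq x w else 0) ≡ nonA-total
    at-vertex (placed s a) =
      trans (sumF-sides s _) (cong₂ _+_ (trans (sumF-cong (nonA-emb s a)) (H-sum s a)) (trans (sumF-cong (nonA-other s a)) (crossAt-sum s a)))

  nonA-count : ∀ x → count (notA x) ≡ (deg + deg) + 4 * q * 1
  nonA-count x = at-vertex (placement x)
    where
    split : ∀ η f → ind η ≡ ind (η ∧ f) + ind (η ∧ not f)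
    split false _     = refl
    split true  true  = refl
    split true  false = refl
    at-vertex : ∀ {x} → Placed x → count (notA x) ≡ (deg + deg) + 4 * q * 1
    at-vertex (placed s a) = trans (sumF-sides s _) (cong₂ _+_
      (trans (sumF-cong (λ b → trans (cong ind (notA-emb s a b)) (split (Hedge q a b) (low s a b))))
             (trans (sumF-+ (λ b → ind (Hedge q a b ∧ low s a b)) (λ b → ind (Hedge q a b ∧ not (low s a b)))) (cong₂ _+_ (count-low s a) (count-high s a))))
      (trans (sumF-cong (λ b → cong ind (notA-other s a b))) (sumF-const (4 * q) 1)))

  nonA-average : ∀ x → 2 * sumF (λ w → if notA x w then Tq x w else 0) ≡ count (notA x) * (E + 1)
  nonA-average x = begin
    2 * sumF (λ w → if notA x w then Tq x w else 0)                     ≡⟨ cong (2 *_) (nonA-sum x) ⟩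
    2 * (magic + 24 * q * q * deg + q * lineTotal)                      ≡⟨ cong (λ c → 2 * (c + 24 * q * q * deg + q * (48 * (q * q) + 2 * nH + 2))) magic≡ ⟩
    2 * (deg * suc nH + 24 * q * q * deg + q * (48 * (q * q) + 2 * nH + 2)) ≡⟨ cong (λ h → 2 * (deg * suc h + 24 * q * q * deg + q * (48 * (q * q) + 2 * h + 2))) nH≡4q*deg ⟩
    2 * (deg * suc (4 * q * deg) + 24 * q * q * deg + q * (48 * (q * q) + 2 * (4 * q * deg) + 2)) ≡⟨ shape q deg ⟩
    ((deg + deg) + 4 * q * 1) * (24 * q * q + 4 * q * deg + 1)          ≡⟨ cong (λ h → ((deg + deg) + 4 * q * 1) * (24 * q * q + h + 1)) (sym nH≡4q*deg) ⟩
    ((deg + deg) + 4 * q * 1) * (24 * q * q + nH + 1)                   ≡⟨ cong₂ (λ c e → c * (e + 1)) (sym (nonA-count x)) 24q²+nH≡E ⟩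
    count (notA x) * (E + 1)                                            ∎
    where
    open ≡-Reasoning
    shape : ∀ q d → 2 * (d * suc (4 * q * d) + 24 * q * q * d + q * (48 * (q * q) + 2 * (4 * q * d) + 2))
                    ≡ ((d + d) + 4 * q * 1) * (24 * q * q + 4 * q * d + 1)
    shape = solve-∀

  matching-labels : ∀ x y → InA x y ≡ true → (E ∸ edgeCount InA) / 2 < Tq x y × Tq x y ≤ (E + edgeCount InA) / 2
  matching-labels x y h = subst₂ (λ l u → l < Tq x y × Tq x y ≤ u) (sym lo-is) (sym hi-is)
    (subst (λ t → lo < t × t ≤ 16 * q * q) (sym (Tq-G3 x y (InA⇒G3 x y h))) (mLabel-range (InA⇒G3 x y h)))

  matching-onto : ∀ ℓ → (E ∸ edgeCount InA) / 2 < ℓ → ℓ ≤ (E + edgeCount InA) / 2 → ∃[ x ] ∃[ y ] (InA x y ≡ true × Tq x y ≡ ℓ)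
  matching-onto ℓ ℓ> ℓ≤ = let x , y , g , e = matching-labelled (subst (_< ℓ) lo-is ℓ>) (subst (ℓ ≤_) hi-is ℓ≤)
                          in x , y , cong₂ _∧_ (proj₁ (∧-true⁻ (Kedge x y) _ g)) g , e

  astray : AstrayGoodWith 1 Tq (G3 q)
  astray = Tq-labeling , same-parity , matching-labels , matching-onto , count-InA≤1 ,
           subst (λ l → ∀ x → count (λ w → Kedge x w ∧ (Tq x w ≤ᵇ l)) ≡ count (λ w → notA x w ∧ not (Tq x w ≤ᵇ l))) (sym lo-is) low-high-balance ,
           nonA-average

  Hit : Fin n8 → ℕ → Set
  Hit v ℓ = ∃[ w ] (Kedge v w ≡ true × Tq v w ≡ ℓ)

  vertex-runs : ∀ v → TwoRuns q (Hit v)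
  vertex-runs v = at-vertex (vertex v)
    where
    at-vertex : ∀ {v} → Vertex v → TwoRuns q (Hit v)
    at-vertex (isV a) = TwoRuns-map (λ (b , e) → U b , Kedge-VU a b , trans (Tq-VU a b) e) (column-runs a)
    at-vertex (isU b) = TwoRuns-map (λ (a , e) → V a , Kedge-UV b a , trans (Tq-UV b a) e) (row-runs b)

-- Perturbing T by a p-swap

module Perturbation (q : ℕ) (hq : 2 ≤ q) (C : Choices q) (P : ℕ)
  (t′ : Fin (4 * q + 4 * q) → Fin (4 * q + 4 * q) → ℕ) (t′-labeling : IsEdgeLabeling (4 * q + 4 * q) t′)
  (near : ∀ x y → Kedge x y ≡ true → ∣ t′ x y - T q hq C x y ∣ ≤ P) where
  open Labeling q hq C

  t′-sym : ∀ x y → Kedge x y ≡ true → t′ x y ≡ t′ y x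
  t′-sym = proj₁ t′-labeling

  t′-same : ∀ {x y x′ y′} → Kedge x y ≡ true → SameEdge x y x′ y′ → t′ x y ≡ t′ x′ y′
  t′-same K (inj₁ (refl , refl)) = refl
  t′-same K (inj₂ (refl , refl)) = t′-sym _ _ K

  Tq-same : ∀ {x y x′ y′} → Kedge x y ≡ true → SameEdge x y x′ y′ → Tq x y ≡ Tq x′ y′
  Tq-same K (inj₁ (refl , refl)) = refl
  Tq-same K (inj₂ (refl , refl)) = Tq-sym _ _ K

  -- φ ℓ is the new label of the edge that T labels ℓ (and ℓ itself outside [1, ε]).
  relabel : ∀ ℓ → Dec (1 ≤ ℓ) → Dec (ℓ ≤ E) → ℕ
  relabel ℓ (yes ℓ≥1) (yes ℓ≤E) = let x , y , _ = Tq-onto ℓ ℓ≥1 ℓ≤E in t′ x y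
  relabel ℓ _         _         = ℓ

  φ : ℕ → ℕ
  φ ℓ = relabel ℓ (1 ≤? ℓ) (ℓ ≤? E)

  φ-witness : ∀ ℓ → 1 ≤ ℓ → ℓ ≤ E → ∃[ x ] ∃[ y ] (Kedge x y ≡ true × Tq x y ≡ ℓ × φ ℓ ≡ t′ x y)
  φ-witness ℓ ℓ≥1 ℓ≤E = witness (1 ≤? ℓ) (ℓ ≤? E)
    where
    witness : (d₁ : Dec (1 ≤ ℓ)) (d₂ : Dec (ℓ ≤ E)) → ∃[ x ] ∃[ y ] (Kedge x y ≡ true × Tq x y ≡ ℓ × relabel ℓ d₁ d₂ ≡ t′ x y)
    witness (yes p₁) (yes p₂) = let x , y , K , e = Tq-onto ℓ p₁ p₂ in x , y , K , e , refl
    witness (no ¬p₁) _        = ⊥-elim (¬p₁ ℓ≥1)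
    witness (yes _)  (no ¬p₂) = ⊥-elim (¬p₂ ℓ≤E)

  φ-edge : ∀ x y → Kedge x y ≡ true → φ (Tq x y) ≡ t′ x y
  φ-edge x y K = let x′ , y′ , K′ , e , φ≡ = φ-witness (Tq x y) (proj₁ (Tq-range x y K)) (proj₂ (Tq-range x y K))
                 in trans φ≡ (t′-same K′ (Tq-injective x′ y′ x y K′ K e))

  φ-range : ∀ ℓ → 1 ≤ ℓ → ℓ ≤ E → 1 ≤ φ ℓ × φ ℓ ≤ E
  φ-range ℓ ℓ≥1 ℓ≤E = let x , y , K , _ , φ≡ = φ-witness ℓ ℓ≥1 ℓ≤E
                      in subst (λ z → 1 ≤ z × z ≤ E) (sym φ≡) (proj₁ (proj₂ t′-labeling) x y K)

  φ-injective : ∀ j k → 1 ≤ j → j ≤ E → 1 ≤ k → k ≤ E → φ j ≡ φ k → j ≡ k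
  φ-injective j k j≥1 j≤E k≥1 k≤E e =
    let xj , yj , Kj , ej , φj = φ-witness j j≥1 j≤E
        xk , yk , Kk , ek , φk = φ-witness k k≥1 k≤E
    in trans (sym ej) (trans (Tq-same Kj (proj₁ (proj₂ (proj₂ t′-labeling)) xj yj xk yk Kj Kk (trans (sym φj) (trans e φk)))) ek)

  φ-onto : ∀ y → 1 ≤ y → y ≤ E → ∃[ k ] (1 ≤ k × k ≤ E × φ k ≡ y)
  φ-onto y y≥1 y≤E = let x , w , K , e = proj₂ (proj₂ (proj₂ t′-labeling)) y y≥1 y≤E
                     in Tq x w , proj₁ (Tq-range x w K) , proj₂ (Tq-range x w K) , trans (φ-edge x w K) e

  φ-near : ∀ k → 1 ≤ k → k ≤ E → φ k ≤ k + P × k ≤ φ k + P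
  φ-near k k≥1 k≤E = let x , y , K , e , φ≡ = φ-witness k k≥1 k≤E
                     in subst₂ (λ a b → a ≤ b + P × b ≤ a + P) (sym φ≡) e (∣m-n∣≤o⇒ (near x y K))

  open BoundedDisplacement E P φ φ-range φ-injective φ-onto φ-near

  inRun : ℕ → ℕ → Bool
  inRun st ℓ = (st ≤ᵇ ℓ) ∧ (ℓ <ᵇ st + q)

  inRun-sound : ∀ st ℓ → inRun st ℓ ≡ true → st ≤ ℓ × ℓ < st + q
  inRun-sound st ℓ h = let l , r = ∧-true⁻ _ _ h in ≤ᵇ-sound st ℓ l , <ᵇ-sound ℓ (st + q) r

  RunEdge : Fin n8 → ℕ → Fin n8 → Bool
  RunEdge u st w = Kedge u w ∧ inRun st (Tq u w)

  run-sum : ∀ u st → (∀ d → d < q → Hit u (st + d)) → (g : ℕ → ℕ) →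
    sumF (λ w → if RunEdge u st w then g (Tq u w) else 0) ≡ sumN q (λ i → g (st + i))
  run-sum u st run g = trans (sumF-cong shifted)
    (sumF-bijective q (RunEdge u st) offset (λ _ → true) (λ i → g (st + i)) offset<q (λ _ _ → refl) offset-injective offset-onto)
    where
    offset : Fin n8 → ℕ
    offset w = Tq u w ∸ st
    facts : ∀ w → RunEdge u st w ≡ true → Kedge u w ≡ true × st ≤ Tq u w × Tq u w < st + q
    facts w h = let K , r = ∧-true⁻ (Kedge u w) _ h in K , inRun-sound st (Tq u w) r
    shifted : ∀ w → (if RunEdge u st w then g (Tq u w) else 0) ≡ (if RunEdge u st w then g (st + offset w) else 0)
    shifted w with RunEdge u st w in h
    ... | false = refl
    ... | true  = cong g (sym (m+[n∸m]≡n (proj₁ (proj₂ (facts w h)))))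
    offset<q : ∀ w → RunEdge u st w ≡ true → offset w < q
    offset<q w h = m<n+o⇒m∸n<o (Tq u w) st (proj₂ (proj₂ (facts w h)))
    offset-injective : ∀ w w′ → RunEdge u st w ≡ true → RunEdge u st w′ ≡ true → offset w ≡ offset w′ → w ≡ w′
    offset-injective w w′ h h′ e with Tq-injective u w u w′ (proj₁ (facts w h)) (proj₁ (facts w′ h′))
                                        (∸-cancelʳ-≡ (proj₁ (proj₂ (facts w h))) (proj₁ (proj₂ (facts w′ h′))) e)
    ... | inj₁ (_ , w≡w′)     = w≡w′
    ... | inj₂ (u≡w′ , w≡u)  = ⊥-elim (Kedge⇒≢ {x = u} {w} (proj₁ (facts w h)) (sym w≡u))
    offset-onto : ∀ d → d < q → true ≡ true → ∃[ w ] (RunEdge u st w ≡ true × offset w ≡ d)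
    offset-onto d d<q _ =
      let w , K , e = run d d<q
      in w , cong₂ _∧_ K (trans (cong (inRun st) e) (cong₂ _∧_ (≤ᵇ-complete (m≤m+n st d)) (<ᵇ-complete (+-monoʳ-< st d<q)))) ,
         trans (cong (_∸ st) e) (m+n∸m≡n st d)

  Rest : Fin n8 → ℕ → ℕ → Fin n8 → Bool
  Rest u st₁ st₂ w = Kedge u w ∧ not (inRun st₁ (Tq u w)) ∧ not (inRun st₂ (Tq u w))

  split-at-runs : ∀ u st₁ st₂ → Disjoint1AP (st₁ , q) (st₂ , q) → (f : Fin n8 → ℕ) →
    sumF (λ w → if Kedge u w then f w else 0) ≡
      (sumF (λ w → if RunEdge u st₁ w then f w else 0) + sumF (λ w → if RunEdge u st₂ w then f w else 0))
        + sumF (λ w → if Rest u st₁ st₂ w then f w else 0)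
  split-at-runs u st₁ st₂ disjoint f =
    trans (sumF-cong pointwise)
          (trans (sumF-+ (λ w → R₁ w + R₂ w) R₃) (cong (_+ sumF R₃) (sumF-+ R₁ R₂)))
    where
    R₁ R₂ R₃ : Fin n8 → ℕ
    R₁ w = if RunEdge u st₁ w then f w else 0
    R₂ w = if RunEdge u st₂ w then f w else 0
    R₃ w = if Rest u st₁ st₂ w then f w else 0
    not-both : ∀ ℓ → inRun st₁ ℓ ≡ true → inRun st₂ ℓ ≡ true → ⊥
    not-both ℓ h₁ h₂ = apart disjoint
      where
      apart : Disjoint1AP (st₁ , q) (st₂ , q) → ⊥
      apart (inj₁ le) = <⇒≱ (<-≤-trans (proj₂ (inRun-sound st₁ ℓ h₁)) le) (proj₁ (inRun-sound st₂ ℓ h₂))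
      apart (inj₂ le) = <⇒≱ (<-≤-trans (proj₂ (inRun-sound st₂ ℓ h₂)) le) (proj₁ (inRun-sound st₁ ℓ h₁))
    pointwise : ∀ w → (if Kedge u w then f w else 0) ≡ (R₁ w + R₂ w) + R₃ w
    pointwise w with Kedge u w | inRun st₁ (Tq u w) in h₁ | inRun st₂ (Tq u w) in h₂
    ... | false | _     | _     = refl
    ... | true  | true  | true  = ⊥-elim (not-both (Tq u w) h₁ h₂)
    ... | true  | true  | false = sym (trans (+-identityʳ _) (+-identityʳ _))
    ... | true  | false | true  = sym (+-identityʳ _)
    ... | true  | false | false = refl

  sum-near : ∀ (R : Fin n8 → Bool) (f g : Fin n8 → ℕ) → (∀ w → R w ≡ true → f w ≤ g w + P) →
    sumF (λ w → if R w then f w else 0) ≤ sumF (λ w → if R w then g w else 0) + P * count R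
  sum-near R f g near′ = ≤-trans (sumF-mono pointwise)
    (≤-reflexive (trans (sumF-+ (λ w → if R w then g w else 0) (λ w → P * ind (R w))) (cong (_ +_) (sumF-*ˡ P (ind ∘ R)))))
    where
    pointwise : ∀ w → (if R w then f w else 0) ≤ (if R w then g w else 0) + P * ind (R w)
    pointwise w with R w in h
    ... | false = z≤n
    ... | true  = subst (f w ≤_) (cong (g w +_) (sym (*-identityʳ P))) (near′ w h)

  D : ℕ
  D = (Err + Err) + P * (6 * q)

  module AtVertex (u : Fin n8) where
    open TwoRuns (vertex-runs u)

    vertexSum : (Fin n8 → ℕ) → ℕ
    vertexSum f = sumF (λ w → if Kedge u w then f w else 0)

    over : (Fin n8 → Bool) → (Fin n8 → ℕ) → ℕ
    over R f = sumF (λ w → if R w then f w else 0)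

    edge-count : count (Kedge u) ≤ 8 * q
    edge-count = ≤-trans (sumF-mono at-most-1) (≤-reflexive (trans (sumF-const n8 1) (shape q)))
      where
      at-most-1 : ∀ w → ind (Kedge u w) ≤ 1
      at-most-1 w with Kedge u w
      ... | true  = ≤-refl
      ... | false = z≤n
      shape : ∀ q → (4 * q + 4 * q) * 1 ≡ 8 * q
      shape = solve-∀

    rest-count : count (Rest u start₁ start₂) ≤ 6 * q
    rest-count = +-cancelˡ-≤ (q + q) _ _ (begin
      q + q + count (Rest u start₁ start₂)
        ≡⟨ cong₂ (λ a b → a + b + count (Rest u start₁ start₂)) (sym (trans (run-sum u start₁ run₁ (λ _ → 1)) (sumN-ones q)))
                                                                 (sym (trans (run-sum u start₂ run₂ (λ _ → 1)) (sumN-ones q))) ⟩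
      over (RunEdge u start₁) (λ _ → 1) + over (RunEdge u start₂) (λ _ → 1) + count (Rest u start₁ start₂)
        ≡⟨ sym (split-at-runs u start₁ start₂ disjoint (λ _ → 1)) ⟩
      count (Kedge u)
        ≤⟨ edge-count ⟩
      8 * q
        ≡⟨ shape q ⟩
      q + q + 6 * q ∎)
      where
      open ≤-Reasoning
      shape : ∀ q → 8 * q ≡ q + q + 6 * q
      shape = solve-∀

    run-within : ∀ {st} → (∀ d → d < q → Hit u (st + d)) → 1 ≤ st × (st ∸ 1) + q ≤ E
    run-within {st} run =
      let w , K , e = run (q ∸ 1) (∸-monoʳ-< {q} {1} {0} z<s q≥1)
      in st≥1 , subst (_≤ E) (trans e (move-1 st q st≥1 q≥1)) (proj₂ (Tq-range u w K))
      where
      st≥1 : 1 ≤ st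
      st≥1 = let w₀ , K₀ , e₀ = run 0 q≥1 in subst (1 ≤_) (trans e₀ (+-identityʳ st)) (proj₁ (Tq-range u w₀ K₀))
      move-1 : ∀ a b → 1 ≤ a → 1 ≤ b → a + (b ∸ 1) ≡ (a ∸ 1) + b
      move-1 (suc a) (suc b) _ _ = sym (+-suc a b)

    run-t′ : ∀ {st} → (∀ d → d < q → Hit u (st + d)) → over (RunEdge u st) (t′ u) ≡ sumN q (λ i → φ (st + i))
    run-t′ {st} run = trans (sumF-cong via-φ) (run-sum u st run φ)
      where
      via-φ : ∀ w → (if RunEdge u st w then t′ u w else 0) ≡ (if RunEdge u st w then φ (Tq u w) else 0)
      via-φ w with RunEdge u st w in h
      ... | false = refl
      ... | true  = sym (φ-edge u w (proj₁ (∧-true⁻ (Kedge u w) _ h)))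

    run-bounds : ∀ {st} → (∀ d → d < q → Hit u (st + d)) →
      over (RunEdge u st) (t′ u) ≤ over (RunEdge u st) (Tq u) + Err × over (RunEdge u st) (Tq u) ≤ over (RunEdge u st) (t′ u) + Err
    run-bounds {st} run =
      subst₂ (λ a b → a ≤ b + Err) (sym (run-t′ run)) (sym (run-sum u st run (λ ℓ → ℓ)))
             (subst (λ a → sumN q (λ i → φ (a + i)) ≤ sumN q (λ i → a + i) + Err) st≡ (run-φ≤run+Err (st ∸ 1) q (proj₂ within))) ,
      subst₂ (λ a b → b ≤ a + Err) (sym (run-t′ run)) (sym (run-sum u st run (λ ℓ → ℓ)))
             (subst (λ a → sumN q (λ i → a + i) ≤ sumN q (λ i → φ (a + i)) + Err) st≡ (run≤run-φ+Err (st ∸ 1) q (proj₂ within)))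
      where
      within : 1 ≤ st × (st ∸ 1) + q ≤ E
      within = run-within run
      st≡ : suc (st ∸ 1) ≡ st
      st≡ = trans (+-comm 1 _) (m∸n+n≡m (proj₁ within))

    bound-by-parts : ∀ (f g : Fin n8 → ℕ) →
      over (RunEdge u start₁) f ≤ over (RunEdge u start₁) g + Err → over (RunEdge u start₂) f ≤ over (RunEdge u start₂) g + Err →
      (∀ w → Rest u start₁ start₂ w ≡ true → f w ≤ g w + P) → vertexSum f ≤ vertexSum g + D
    bound-by-parts f g bound₁ bound₂ near-rest = begin
      vertexSum f
        ≡⟨ split-at-runs u start₁ start₂ disjoint f ⟩
      (F₁ + F₂) + F₃
        ≤⟨ +-mono-≤ (+-mono-≤ bound₁ bound₂) (≤-trans (sum-near (Rest u start₁ start₂) f g near-rest) (+-monoʳ-≤ G₃ (*-monoʳ-≤ P rest-count))) ⟩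
      ((G₁ + Err) + (G₂ + Err)) + (G₃ + P * (6 * q))
        ≡⟨ shape G₁ G₂ G₃ Err (P * (6 * q)) ⟩
      ((G₁ + G₂) + G₃) + D
        ≡⟨ cong (_+ D) (sym (split-at-runs u start₁ start₂ disjoint g)) ⟩
      vertexSum g + D ∎
      where
      open ≤-Reasoning
      F₁ F₂ F₃ G₁ G₂ G₃ : ℕ
      F₁ = over (RunEdge u start₁) f
      F₂ = over (RunEdge u start₂) f
      F₃ = over (Rest u start₁ start₂) f
      G₁ = over (RunEdge u start₁) g
      G₂ = over (RunEdge u start₂) g
      G₃ = over (Rest u start₁ start₂) g
      shape : ∀ a b c e d → ((a + e) + (b + e)) + (c + d) ≡ ((a + b) + c) + ((e + e) + d)
      shape = solve-∀

    t′-near-Tq : s t′ u ≤ s Tq u + D × s Tq u ≤ s t′ u + D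
    t′-near-Tq =
      bound-by-parts (t′ u) (Tq u) (proj₁ (run-bounds run₁)) (proj₁ (run-bounds run₂)) (λ w h → proj₁ (∣m-n∣≤o⇒ (near u w (rest-edge w h)))) ,
      bound-by-parts (Tq u) (t′ u) (proj₂ (run-bounds run₁)) (proj₂ (run-bounds run₂)) (λ w h → proj₂ (∣m-n∣≤o⇒ (near u w (rest-edge w h))))
      where
      rest-edge : ∀ w → Rest u start₁ start₂ w ≡ true → Kedge u w ≡ true
      rest-edge w h = proj₁ (∧-true⁻ (Kedge u w) _ h)

    Tq-sum : s Tq u ≡ nonA-total + Tq u (partner u)
    Tq-sum = trans (sumF-cong split) (trans (sumF-+ (λ w → if notA u w then Tq u w else 0) (λ w → if InA u w then Tq u w else 0))
                   (cong₂ _+_ (nonA-sum u) (sumF-single (InA u) (Tq u) (partner u) (InA⇒partner u) (InA-partner u))))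
      where
      split : ∀ w → (if Kedge u w then Tq u w else 0) ≡ (if notA u w then Tq u w else 0) + (if InA u w then Tq u w else 0)
      split w with Kedge u w | G3 q u w
      ... | false | _     = refl
      ... | true  | true  = refl
      ... | true  | false = sym (+-identityʳ _)

    Tq-sum-range : nonA-total + lo < s Tq u × s Tq u ≤ nonA-total + 16 * q * q
    Tq-sum-range = subst (λ z → nonA-total + lo < z × z ≤ nonA-total + 16 * q * q) (sym Tq-sum)
      (+-monoʳ-< nonA-total (proj₁ partner-label) , +-monoʳ-≤ nonA-total (proj₂ partner-label))
      where
      g = InA⇒G3 u (partner u) (InA-partner u)
      partner-label : lo < Tq u (partner u) × Tq u (partner u) ≤ 16 * q * q
      partner-label = subst (λ t → lo < t × t ≤ 16 * q * q) (sym (Tq-G3 u (partner u) g)) (mLabel-range g)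

  vertex-sums-close : ∀ u v → ∣ s t′ u - s t′ v ∣ ≤ 4 * q + (D + D)
  vertex-sums-close u v = ∣m-n∣≤o (one-way u v) (one-way v u)
    where
    one-way : ∀ u v → s t′ u ≤ s t′ v + (4 * q + (D + D))
    one-way u v = begin
      s t′ u                               ≤⟨ proj₁ (AtVertex.t′-near-Tq u) ⟩
      s Tq u + D                           ≤⟨ +-monoˡ-≤ D (proj₂ (AtVertex.Tq-sum-range u)) ⟩
      nonA-total + 16 * q * q + D          ≡⟨ cong (λ z → nonA-total + z + D) (sym lo+4q≡16q²) ⟩
      nonA-total + (lo + 4 * q) + D        ≡⟨ cong (_+ D) (sym (+-assoc nonA-total lo (4 * q))) ⟩
      nonA-total + lo + 4 * q + D          ≤⟨ +-monoˡ-≤ D (+-monoˡ-≤ (4 * q) (<⇒≤ (proj₁ (AtVertex.Tq-sum-range v)))) ⟩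
      s Tq v + 4 * q + D                   ≤⟨ +-monoˡ-≤ D (+-monoˡ-≤ (4 * q) (proj₂ (AtVertex.t′-near-Tq v))) ⟩
      s t′ v + D + 4 * q + D               ≡⟨ shape (s t′ v) D (4 * q) ⟩
      s t′ v + (4 * q + (D + D))           ∎
      where
      open ≤-Reasoning
      shape : ∀ a d c → a + d + c + d ≡ a + (c + (d + d))
      shape = solve-∀

-- 4k (4q + 8P² + 12qP) = 16kq + 32kP² + 48kqP ≤ 64qP + 48kqP, using k ≤ P and kP ≤ q.
deviation-estimate : ∀ k P q → k ≤ P → k * P ≤ q →
  4 * k * (4 * q + (((P * (2 * P) + P * (2 * P)) + P * (6 * q)) + ((P * (2 * P) + P * (2 * P)) + P * (6 * q))))
    ≤ (3 * k + 4) * (2 * P * (4 * q + 4 * q))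
deviation-estimate k P q k≤P kP≤q = begin
    4 * k * (4 * q + (((P * (2 * P) + P * (2 * P)) + P * (6 * q)) + ((P * (2 * P) + P * (2 * P)) + P * (6 * q))))
      ≡⟨ expand k P q ⟩
    16 * (k * q) + 32 * (k * P * P) + 48 * (k * q * P)
      ≤⟨ +-monoˡ-≤ (48 * (k * q * P)) (+-mono-≤ (*-monoʳ-≤ 16 (*-monoˡ-≤ q k≤P)) (*-monoʳ-≤ 32 (*-monoˡ-≤ P kP≤q))) ⟩
    16 * (P * q) + 32 * (q * P) + 48 * (k * q * P)
      ≡⟨ cong (_+ 48 * (k * q * P)) (collect P q) ⟩
    48 * (P * q) + 48 * (k * q * P)
      ≤⟨ +-monoˡ-≤ (48 * (k * q * P)) (*-monoˡ-≤ (P * q) {48} {64} (m≤m+n 48 16)) ⟩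
    64 * (P * q) + 48 * (k * q * P)
      ≡⟨ sym (factor k P q) ⟩
    (3 * k + 4) * (2 * P * (4 * q + 4 * q)) ∎
  where
  open ≤-Reasoning
  expand : ∀ k P q → 4 * k * (4 * q + (((P * (2 * P) + P * (2 * P)) + P * (6 * q)) + ((P * (2 * P) + P * (2 * P)) + P * (6 * q))))
                     ≡ 16 * (k * q) + 32 * (k * P * P) + 48 * (k * q * P)
  expand = solve-∀
  collect : ∀ P q → 16 * (P * q) + 32 * (q * P) ≡ 48 * (P * q)
  collect = solve-∀
  factor : ∀ k P q → (3 * k + 4) * (2 * P * (4 * q + 4 * q)) ≡ 64 * (P * q) + 48 * (k * q * P)
  factor = solve-∀

r≤3/4 : ∀ (C : (q : ℕ) → 2 ≤ q → Choices q) (p : ℕ → ℕ) → Admissible p → rAtMost C p 3 4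
r≤3/4 C p (p=o[n] , p→∞) k k≥1 = N₁ + N₂ , bound
  where
  small : ∃[ N ] (∀ n → N ≤ n → 8 * k * p n ≤ n)
  small = p=o[n] (8 * k) (≤-trans k≥1 (m≤n*m k 8))
  large : ∃[ N ] (∀ n → N ≤ n → k ≤ p n)
  large = p→∞ k
  N₁ N₂ : ℕ
  N₁ = proj₁ small
  N₂ = proj₁ large
  bound : ∀ q (hq : 2 ≤ q) → N₁ + N₂ ≤ q →
    ∀ (t′ : Fin (4 * q + 4 * q) → Fin (4 * q + 4 * q) → ℕ) → IsEdgeLabeling (4 * q + 4 * q) t′ →
    (∀ x y → Kedge x y ≡ true → ∣ t′ x y - T q hq (C q hq) x y ∣ ≤ p (4 * q + 4 * q)) →
    ∀ u v → Kedge u v ≡ true →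
    4 * k * ∣ s t′ u - s t′ v ∣ ≤ (3 * k + 4) * (2 * p (4 * q + 4 * q) * (4 * q + 4 * q))
  bound q hq N≤q t′ t′-labeling near u v _ =
    ≤-trans (*-monoʳ-≤ (4 * k) (Perturbation.vertex-sums-close q hq (C q hq) P t′ t′-labeling near u v))
            (deviation-estimate k P q k≤P kP≤q)
    where
    n P : ℕ
    n = 4 * q + 4 * q
    P = p n
    q≤n : q ≤ n
    q≤n = ≤-trans (m≤m+n q (3 * q)) (m≤m+n (4 * q) (4 * q))
    k≤P : k ≤ P
    k≤P = proj₂ large n (≤-trans (m≤n+m N₂ N₁) (≤-trans N≤q q≤n))
    kP≤q : k * P ≤ q
    kP≤q = *-cancelˡ-≤ 8 (subst₂ _≤_ (*-assoc 8 k P) (n≡8q q) (proj₂ small n (≤-trans (m≤m+n N₁ N₂) (≤-trans N≤q q≤n))))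
      where
      n≡8q : ∀ q → 4 * q + 4 * q ≡ 8 * q
      n≡8q = solve-∀

lemma6p7 : (∀ (q : ℕ) (hq : 2 ≤ q) (C : Choices q) →
       AstrayGoodWith 1 (T q hq C) (G3 q) ×
       (∀ (p : ℕ) → 1 ≤ p → 2 * p ≤ q → OfType 2 (2 * q) p (T q hq C))) ×
    (∀ (C : (q : ℕ) → 2 ≤ q → Choices q) (p : ℕ → ℕ) →
       Admissible p → rAtMost C p 3 4)
lemma6p7 = (λ q hq C → Labeling.astray q hq C , runs-give-type q hq C) , r≤3/4
  where
  runs-give-type : ∀ q (hq : 2 ≤ q) (C : Choices q) p → 1 ≤ p → 2 * p ≤ q → OfType 2 (2 * q) p (T q hq C)
  runs-give-type q hq C p _ 2p≤q = two-runs⇒type (T q hq C) q p 2p≤q (Labeling.vertex-runs q hq C)
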